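{- Let $k>1$, let $U_1\in\mathbb{F}_q^{k\times k}$, $U_2\in\mathbb{F}_q^{k\times(k+1)}$ with $\mathrm{rk}(U_1)=\mathrm{rk}(U_2)=k$, and let $\mathbf{v}_1\in\mathbb{F}_q^k$, $\mathbf{v}_2\in\mathbb{F}_q^{k+1}\setminus\mathrm{rowsp}(U_2)$. Define $\mathcal{U}=\mathrm{rowsp}(U_1\mid U_2)$, $\mathcal{U}'=\mathrm{rowsp}(U_1\mid 0_{k\times(k+1)})$, $\mathcal{U}''=\mathrm{rowsp}(0_{k\times k}\mid U_2)$, $\mathcal{V}=\mathrm{rowsp}\begin{pmatrix}U_1&U_2\\ \mathbf{v}_1&\mathbf{v}_2\end{pmatrix}$, $\mathcal{V}'=\mathrm{rowsp}\begin{pmatrix}U_1&0_{k\times(k+1)}\\ \mathbf{v}_1&\mathbf{v}_2\end{pmatrix}$, $\mathcal{V}''=\mathrm{rowsp}\begin{pmatrix}0_{k\times k}&U_2\\ \mathbf{v}_1&\mathbf{v}_2\end{pmatrix}$. Let $\mathcal{F},\mathcal{F}',\mathcal{F}''$ be full flags on $\mathbb{F}_q^{2k+1}$ with $\mathcal{F}_k=\mathcal{U}$, $\mathcal{F}_{k+1}=\mathcal{V}$, $\mathcal{F}'_k=\mathcal{U}'$, $\mathcal{F}'_{k+1}=\mathcal{V}'$, $\mathcal{F}''_k=\mathcal{U}''$, $\mathcal{F}''_{k+1}=\mathcal{V}''$. Then the flag code $\mathcal{C}=\mathrm{Orb}_{\mathbf{G}}(\mathcal{F})\cup\{\mathcal{F}',\mathcal{F}''\}$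 is an optimum distance flag code with cardinality $q^{k+1}+1$ if and only if $\mathbf{v}_1=\mathbf{0}_k$.
   Context: Let $M_{k+1}\in\mathrm{GL}(k+1,q)$ be the companion matrix of a primitive polynomial of degree $k+1$ over $\mathbb{F}_q$, let $g=\begin{pmatrix}I_k&0\\0&M_{k+1}\end{pmatrix}\in\mathrm{GL}(2k+1,q)$ and $\mathbf{G}=\langle g\rangle$. A full flag on $\mathbb{F}_q^{2k+1}$ is a chain $\mathcal{F}_1\subsetneq\cdots\subsetneq\mathcal{F}_{2k}$ of subspaces with $\dim\mathcal{F}_i=i$. $\mathrm{GL}(2k+1,q)$ acts on subspaces by $\mathcal{V}\cdot A=\mathrm{rowsp}(VA)$ and on flags componentwise. With $d_S(\mathcal{A},\mathcal{B})=\dim(\mathcal{A}+\mathcal{B})-\dim(\mathcal{A}\cap\mathcal{B})$ and $d_f(\mathcal{F},\mathcal{F}')=\sum_i d_S(\mathcal{F}_i,\mathcal{F}'_i)$, a flag code $\mathcal{C}$ of type $(t_1,\dots,t_r)$ on $\mathbb{F}_q^n$ is an optimum distance flag code if its minimum flag distance between distinct members ($0$ if $|\mathcal{C}|=1$) equals $2\left(\sum_{2t_i\leq n}t_i+\sum_{2t_i>n}(n-t_i)\right)$. -}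

module Defs where

open import Level using (0ℓ)
open import Algebra.Bundles using (CommutativeRing)
open import Data.Nat as ℕ using (ℕ; zero; suc; _≤_; _<_; _∸_; _^_; _≤ᵇ_)
open import Data.Fin as Fin using (Fin; toℕ; splitAt)
open import Data.Sum using (_⊎_; inj₁; inj₂)
open import Data.Product using (Σ; ∃; _×_; _,_)
open import Data.List as List using (List; []; _∷_)
open import Data.Bool using (if_then_else_)
open import Relation.Nullary using (¬_)
open import Data.Empty using (⊥)
open import Relation.Nullary.Decidable using (⌊_⌋)
open import Relation.Binary.PropositionalEquality using (_≡_)
import Data.Vec.Functional as VF

record FiniteField : Set₁ where
  field
    cring : CommutativeRing 0ℓ 0ℓ
  private module R = CommutativeRing cring
  field
    1≉0     : ¬ (R.1# R.≈ R.0#)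
    inverse : ∀ x → ¬ (x R.≈ R.0#) → ∃ λ y → (x R.* y) R.≈ R.1#
    q         : ℕ
    enum      : Fin q → R.Carrier
    enum-surj : ∀ x → ∃ λ i → enum i R.≈ x
    enum-inj  : ∀ i j → enum i R.≈ enum j → i ≡ j

module FF (𝔽 : FiniteField) where
  open FiniteField 𝔽 public
  open CommutativeRing cring public

  Vector : ℕ → Set
  Vector n = Fin n → Carrier

  Matrix : ℕ → ℕ → Set
  Matrix m n = Fin m → Fin n → Carrier

  sumF : ∀ {n} → (Fin n → Carrier) → Carrier
  sumF {zero}  f = 0#
  sumF {suc n} f = f Fin.zero + sumF (λ i → f (Fin.suc i))

  zeroVec : ∀ {n} → Vector n
  zeroVec _ = 0#

  _·ᵥ_ : ∀ {m n} → Vector m → Matrix m n → Vector n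
  (v ·ᵥ A) j = sumF (λ i → v i * A i j)

  _·ₘ_ : ∀ {l m n} → Matrix l m → Matrix m n → Matrix l n
  (A ·ₘ B) i = A i ·ᵥ B

  identity : ∀ {n} → Matrix n n
  identity i j = if ⌊ i Fin.≟ j ⌋ then 1# else 0#

  _^ₘ_ : ∀ {n} → Matrix n n → ℕ → Matrix n n
  A ^ₘ zero  = identity
  A ^ₘ suc e = A ·ₘ (A ^ₘ e)

  zeroMat : ∀ {m n} → Matrix m n
  zeroMat _ _ = 0#

  _∣ₘ_ : ∀ {m n₁ n₂} → Matrix m n₁ → Matrix m n₂ → Matrix m (n₁ ℕ.+ n₂)
  (A ∣ₘ B) i = A i VF.++ B i

  addRow : ∀ {m n} → Matrix m n → Vector n → Matrix (m ℕ.+ 1) n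
  addRow A v = A VF.++ (λ _ → v)

  blockDiag : ∀ {m n} → Matrix m m → Matrix n n → Matrix (m ℕ.+ n) (m ℕ.+ n)
  blockDiag {m} A B i j with splitAt m i | splitAt m j
  ... | inj₁ i' | inj₁ j' = A i' j'
  ... | inj₂ i' | inj₂ j' = B i' j'
  ... | inj₁ _  | inj₂ _  = 0#
  ... | inj₂ _  | inj₁ _  = 0#

  -- Polynomials over 𝔽 as coefficient lists (constant term first)

  Poly : Set
  Poly = List Carrier

  coeff : Poly → ℕ → Carrier
  coeff []       _       = 0#
  coeff (a ∷ f)  zero    = a
  coeff (a ∷ f)  (suc i) = coeff f i

  _+ₚ_ : Poly → Poly → Poly
  []      +ₚ g       = g
  (a ∷ f) +ₚ []      = a ∷ f
  (a ∷ f) +ₚ (b ∷ g) = (a + b) ∷ (f +ₚ g)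

  _*ₚ_ : Poly → Poly → Poly
  []      *ₚ g = []
  (a ∷ f) *ₚ g = List.map (a *_) g +ₚ (0# ∷ (f *ₚ g))

  _≈ₚ_ : Poly → Poly → Set
  f ≈ₚ g = ∀ i → coeff f i ≈ coeff g i

  _∣ₚ_ : Poly → Poly → Set
  f ∣ₚ g = ∃ λ h → (f *ₚ h) ≈ₚ g

  IsConstant : Poly → Set
  IsConstant f = ∀ i → coeff f (suc i) ≈ 0#

  Irreducible : Poly → Set
  Irreducible f = ¬ IsConstant f
                × (∀ g h → (g *ₚ h) ≈ₚ f → IsConstant g ⊎ IsConstant h)

  xPowMinus1 : ℕ → Poly
  xPowMinus1 zero    = []
  xPowMinus1 (suc e) = (- 1#) ∷ (List.replicate e 0# List.++ (1# ∷ []))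

  HasOrder : Poly → ℕ → Set
  HasOrder f e = 1 ≤ e × f ∣ₚ xPowMinus1 e
               × (∀ e' → 1 ≤ e' → e' < e → ¬ (f ∣ₚ xPowMinus1 e'))

  monicPoly : ∀ {m} → Vector m → Poly
  monicPoly a = List.tabulate a List.++ (1# ∷ [])

  Primitive : ∀ {m} → Vector m → Set
  Primitive {zero}  a = ⊥
  Primitive {suc m} a = ¬ (a Fin.zero ≈ 0#)
                      × Irreducible (monicPoly a)
                      × HasOrder (monicPoly a) (q ^ suc m ∸ 1)

  -- companion matrix (acting on row vectors) of the monic polynomial
  -- x^{m+1} + a_m x^m + ... + a_0 : rows e_2, ..., e_{m+1}, (-a_0,...,-a_m)
  companion : ∀ {m} → Vector (suc m) → Matrix (suc m) (suc m)
  companion {m} a i j =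
    if toℕ i ℕ.<ᵇ m
      then (if ⌊ toℕ j ℕ.≟ suc (toℕ i) ⌋ then 1# else 0#)
      else - a j

  Subspace : ℕ → Set₁
  Subspace n = Vector n → Set

  _≈ᵥ_ : ∀ {n} → Vector n → Vector n → Set
  v ≈ᵥ w = ∀ j → v j ≈ w j

  _⊆_ : ∀ {n} → Subspace n → Subspace n → Set
  A ⊆ B = ∀ w → A w → B w

  _≐_ : ∀ {n} → Subspace n → Subspace n → Set
  A ≐ B = A ⊆ B × B ⊆ A

  rowsp : ∀ {m n} → Matrix m n → Subspace n
  rowsp M w = ∃ λ (c : Vector _) → w ≈ᵥ (c ·ᵥ M)

  _+ₛ_ : ∀ {n} → Subspace n → Subspace n → Subspace n
  (A +ₛ B) w = ∃ λ a → ∃ λ b → A a × B b × w ≈ᵥ (λ j → a j + b j)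

  _∩ₛ_ : ∀ {n} → Subspace n → Subspace n → Subspace n
  (A ∩ₛ B) w = A w × B w

  _·ₛ_ : ∀ {n} → Subspace n → Matrix n n → Subspace n
  (V ·ₛ A) w = ∃ λ v → V v × w ≈ᵥ (v ·ᵥ A)

  LinIndep : ∀ {d n} → Matrix d n → Set
  LinIndep b = ∀ c → (c ·ᵥ b) ≈ᵥ zeroVec → ∀ i → c i ≈ 0#

  Dim : ∀ {n} → Subspace n → ℕ → Set
  Dim {n} S d = ∃ λ (b : Matrix d n) → LinIndep b × S ≐ rowsp b

  Rank : ∀ {m n} → Matrix m n → ℕ → Set
  Rank M r = Dim (rowsp M) r

  SubDist : ∀ {n} → Subspace n → Subspace n → ℕ → Set
  SubDist A B D = ∃ λ a → ∃ λ b → Dim (A +ₛ B) a × Dim (A ∩ₛ B) b × D ≡ a ∸ b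

  -- Flags on 𝔽^n: F i is the i-th subspace, meaningful for 1 ≤ i ≤ n-1

  Flag : ℕ → Set₁
  Flag n = ℕ → Subspace n

  FullFlag : ∀ {n} → Flag n → Set
  FullFlag {n} F = (∀ i → 1 ≤ i → i < n → Dim (F i) i)
                 × (∀ i → 1 ≤ i → suc i < n → F i ⊆ F (suc i) × ¬ (F (suc i) ⊆ F i))

  _≐f_ : ∀ {n} → Flag n → Flag n → Set
  _≐f_ {n} F G = ∀ i → 1 ≤ i → i < n → F i ≐ G i

  _·f_ : ∀ {n} → Flag n → Matrix n n → Flag n
  (F ·f A) i = F i ·ₛ A

  sum1to : ℕ → (ℕ → ℕ) → ℕ
  sum1to zero    f = 0
  sum1to (suc m) f = sum1to m f ℕ.+ f (suc m)

  FlagDist : ∀ {n} → Flag n → Flag n → ℕ → Set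
  FlagDist {n} F G D = ∃ λ (ds : ℕ → ℕ) →
    (∀ i → 1 ≤ i → i < n → SubDist (F i) (G i) (ds i)) × D ≡ sum1to (n ∸ 1) ds

  maxDist : ℕ → ℕ
  maxDist n = 2 ℕ.* sum1to (n ∸ 1) (λ i → if (2 ℕ.* i) ≤ᵇ n then i else n ∸ i)

  -- flag codes as predicates on flags (closed under ≐f in our uses)
  Code : ℕ → Set₁
  Code n = Flag n → Set

  Card : ∀ {n} → Code n → ℕ → Set₁
  Card {n} C N = ∃ λ (L : Fin N → Flag n) →
      (∀ i → C (L i))
    × (∀ i j → L i ≐f L j → i ≡ j)
    × (∀ F → C F → ∃ λ i → F ≐f L i)

  -- minimum distance (0 if the code has a single element)
  MinDist : ∀ {n} → Code n → ℕ → Set₁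
  MinDist {n} C m =
      (Card C 1 × m ≡ 0)
    ⊎ ((∃ λ F → ∃ λ G → C F × C G × ¬ (F ≐f G) × FlagDist F G m)
       × (∀ F G d → C F → C G → ¬ (F ≐f G) → FlagDist F G d → m ≤ d))

  OptimumDistance : ∀ {n} → Code n → Set₁
  OptimumDistance {n} C = MinDist C (maxDist n)

  orbitCode : ∀ {n} → Matrix n n → Flag n → Flag n → Flag n → Code n
  orbitCode g F F' F'' H =
    (∃ λ j → H ≐f (F ·f (g ^ₘ j))) ⊎ H ≐f F' ⊎ H ≐f F''

{-# OPTIONS --safe #-}
-- The ambient dimension is n = 2k+1, and a pair of full flags is at maximal distance as
-- soon as its k-th subspaces meet trivially and its (k+1)-th subspaces span 𝔽ⁿ, since the
-- chain conditions propagate this to all levels below and above.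
-- As a is primitive, the companion matrix M satisfies a(M) = 0 (Cayley–Hamilton) and has
-- order N = q^(k+1) - 1, so it permutes the nonzero vectors of 𝔽^(k+1) in a single cycle.
-- Hence g = diag(I, M) has N distinct translates F·gʲ, and if v₁ = 0 any two members of
-- the code meet trivially at level k and span at level k+1, giving an optimum distance
-- code with N + 2 = q^(k+1) + 1 elements. If v₁ = c U₁ ≠ 0, transitivity of M yields a
-- shift j for which the (k+1)-th subspaces of F·gʲ and F″ both lie in the row space of
-- the 2k rows (U₁ | U₂·Mʲ) and (0 | U₂), so that pair is not at maximal distance.

module Submission where

open import Defs
import Data.Nat as ℕ
open import Data.Nat using (ℕ; zero; suc; _≤_; _<_; _∸_; z≤n; s≤s; _≤ᵇ_)
import Data.Nat.Properties as ℕP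
open import Data.Nat.Tactic.RingSolver using (solve-∀)
open import Data.Fin as Fin using (Fin; toℕ; _↑ˡ_; _↑ʳ_; splitAt)
import Data.Fin.Properties as FinP
open import Data.Sum using (_⊎_; inj₁; inj₂)
open import Data.Product using (_×_; _,_; ∃; proj₁; proj₂)
open import Relation.Binary.Definitions using (tri<; tri≈; tri>)
open import Data.Nat.DivMod using (_%_; _/_; m≡m%n+[m/n]*n; m%n<n; [m+kn]%n≡m%n; m<n⇒m%n≡m)
open import Data.Bool using (true; false; if_then_else_)
open import Relation.Nullary using (¬_; Dec; yes; no; contradiction)
open import Relation.Nullary.Decidable using (⌊_⌋; map′; _×-dec_; ¬?; decidable-stable)
open import Relation.Binary.PropositionalEquality as P using (_≡_)
open import Function.Bundles using (_⇔_; mk⇔)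
open import Function.Base using (_∘_; flip)
import Data.Vec.Functional as VF
import Data.List as List
open List using ([]; _∷_)
import Data.List.Properties as ListP
import Data.Vec.Functional.Properties as VFP
import Relation.Binary.Reasoning.Setoid
open VF using (_++_)

∸-double : ∀ m n → (m ℕ.+ m) ∸ (n ℕ.+ n) ≡ (m ∸ n) ℕ.+ (m ∸ n)
∸-double zero    n       = P.trans (ℕP.0∸n≡0 (n ℕ.+ n)) (P.sym (P.cong₂ ℕ._+_ (ℕP.0∸n≡0 n) (ℕP.0∸n≡0 n)))
∸-double (suc m) zero    = P.refl
∸-double (suc m) (suc n) = P.trans (P.cong₂ _∸_ (ℕP.+-suc m m) (ℕP.+-suc n n)) (∸-double m n)

a+b≡i+i⇒a∸b≡[a∸i]+[a∸i] : ∀ {a b i} → a ℕ.+ b ≡ i ℕ.+ i → a ∸ b ≡ (a ∸ i) ℕ.+ (a ∸ i)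
a+b≡i+i⇒a∸b≡[a∸i]+[a∸i] {a} {b} {i} a+b≡i+i = begin
  a ∸ b                   ≡⟨ ℕP.[m+n]∸[m+o]≡n∸o a a b ⟨
  (a ℕ.+ a) ∸ (a ℕ.+ b)   ≡⟨ P.cong ((a ℕ.+ a) ∸_) a+b≡i+i ⟩
  (a ℕ.+ a) ∸ (i ℕ.+ i)   ≡⟨ ∸-double a i ⟩
  (a ∸ i) ℕ.+ (a ∸ i)     ∎
  where open P.≡-Reasoning

2*s+[x+x]≡2*[s+x] : ∀ s x → 2 ℕ.* s ℕ.+ (x ℕ.+ x) ≡ 2 ℕ.* (s ℕ.+ x)
2*s+[x+x]≡2*[s+x] = solve-∀

[k+k]∸[1+k]<k : ∀ {k} → 1 ≤ k → (k ℕ.+ k) ∸ suc k < k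
[k+k]∸[1+k]<k {k} 1≤k = P.subst (_< k) (P.sym (P.trans (P.cong ((k ℕ.+ k) ∸_) (ℕP.+-comm 1 k)) (ℕP.[m+n]∸[m+o]≡n∸o k k 1)))
                                (ℕP.∸-monoʳ-< {o = 0} (s≤s z≤n) 1≤k)

halfMax : ℕ → ℕ → ℕ
halfMax n i = if 2 ℕ.* i ≤ᵇ n then i else n ∸ i

halfMax-low : ∀ {n i} → 2 ℕ.* i ≤ n → halfMax n i ≡ i
halfMax-low {n} {i} 2i≤n with 2 ℕ.* i ≤ᵇ n | ℕP.≤⇒≤ᵇ 2i≤n
... | true | _ = P.refl

halfMax-high : ∀ {n i} → n < 2 ℕ.* i → halfMax n i ≡ n ∸ i
halfMax-high {n} {i} n<2i with 2 ℕ.* i ≤ᵇ n | ℕP.≤ᵇ⇒≤ (2 ℕ.* i) n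
... | false | _     = P.refl
... | true  | 2i≤n = contradiction (2i≤n _) (ℕP.<⇒≱ n<2i)

≤∸1⇒< : ∀ {i n} → 1 ≤ i → i ≤ n ∸ 1 → i < n
≤∸1⇒< {n = zero}  1≤i i≤0 = contradiction (ℕP.≤-trans 1≤i i≤0) (λ ())
≤∸1⇒< {n = suc n} _   i≤n = s≤s i≤n

<⇒≤∸1 : ∀ {i n} → i < n → i ≤ n ∸ 1
<⇒≤∸1 (s≤s i≤n) = i≤n

module _ (𝔽 : FiniteField) where

  open FF 𝔽 hiding (zero)
  open import Algebra.Properties.Ring ring using (-‿distribˡ-*; -‿distribʳ-*; -0#≈0#; -‿involutive)
  open import Algebra.Properties.AbelianGroup +-abelianGroup using (⁻¹-∙-comm)
  open import Algebra.Properties.Group +-group using (inverseˡ-unique; x∙y⁻¹≈ε⇒x≈y; x≈y⇒x∙y⁻¹≈ε)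
  open import Algebra.Properties.CommutativeSemigroup +-commutativeSemigroup
    using (interchange; x∙yz≈y∙xz; xy∙z≈xz∙y)
  open import Algebra.Properties.CommutativeSemigroup *-commutativeSemigroup
    using () renaming (x∙yz≈y∙xz to x*yz≈y*xz)
  open import Algebra.Properties.Semiring.Sum semiring
    using (sum; sum-cong-≋; ∑-distrib-+; ∑-comm; *-distribˡ-sum; sum-init-last; sum-replicate-zero)
  open import Data.Vec.Functional.Relation.Binary.Equality.Setoid setoid
    using (≋-refl; ≋-sym; ≋-trans; ≋-reflexive; ≋-setoid; ++⁺; ++⁻)
  module ≈-Reasoning = Relation.Binary.Reasoning.Setoid setoid
  module ≈ᵥ-Reasoning {n : ℕ} = Relation.Binary.Reasoning.Setoid (≋-setoid n)

  -- Sums, row vectors and matrices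

  _≟_ : (x y : Carrier) → Dec (x ≈ y)
  x ≟ y with enum-surj x | enum-surj y
  ... | i , i↦x | j , j↦y with i Fin.≟ j
  ... | yes P.refl = yes (trans (sym i↦x) j↦y)
  ... | no i≢j     = no (λ x≈y → i≢j (enum-inj i j (trans i↦x (trans x≈y (sym j↦y)))))

  -‿distrib-+ : ∀ a b → - (a + b) ≈ - a + - b
  -‿distrib-+ a b = sym (⁻¹-∙-comm a b)

  x+[y-x]≈y : ∀ x y → x + (y + - x) ≈ y
  x+[y-x]≈y x y = trans (x∙yz≈y∙xz x y (- x)) (trans (+-cong refl (-‿inverseʳ x)) (+-identityʳ y))

  -[a-b]≈-a+b : ∀ a b → - (a + - b) ≈ - a + b
  -[a-b]≈-a+b a b = trans (-‿distrib-+ a (- b)) (+-cong refl (-‿involutive b))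

  [x+y]-y≈x : ∀ x y → (x + y) + - y ≈ x
  [x+y]-y≈x x y = trans (+-assoc x y (- y)) (trans (+-cong refl (-‿inverseʳ y)) (+-identityʳ x))

  x≈[x+0]+0 : ∀ {x y z} → y ≈ 0# → z ≈ 0# → x ≈ (x + y) + z
  x≈[x+0]+0 {x} y≈0 z≈0 = sym (trans (+-cong (trans (+-cong refl y≈0) (+-identityʳ x)) z≈0) (+-identityʳ x))

  x-y≈u-v⇒x-u≈y-v : ∀ {x y u v} → x + - y ≈ u + - v → x + - u ≈ y + - v
  x-y≈u-v⇒x-u≈y-v {x} {y} {u} {v} x-y≈u-v = x∙y⁻¹≈ε⇒x≈y _ _ (begin
    (x + - u) + - (y + - v) ≈⟨ +-cong refl (-[a-b]≈-a+b y v) ⟩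
    (x + - u) + (- y + v)   ≈⟨ interchange x (- u) (- y) v ⟩
    (x + - y) + (- u + v)   ≈⟨ +-cong refl (-[a-b]≈-a+b u v) ⟨
    (x + - y) + - (u + - v) ≈⟨ x≈y⇒x∙y⁻¹≈ε x-y≈u-v ⟩
    0#                      ∎)
    where open ≈-Reasoning

  sumF≈sum : ∀ {n} (f : Vector n) → sumF f ≈ sum f
  sumF≈sum {zero}  f = refl
  sumF≈sum {suc n} f = +-cong refl (sumF≈sum (λ i → f (Fin.suc i)))

  sumF-cong : ∀ {n} {f g : Vector n} → f ≈ᵥ g → sumF f ≈ sumF g
  sumF-cong {f = f} {g} f≈g = begin
    sumF f ≈⟨ sumF≈sum f ⟩ sum f ≈⟨ sum-cong-≋ f≈g ⟩ sum g ≈⟨ sumF≈sum g ⟨ sumF g ∎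
    where open ≈-Reasoning

  sumF-+ : ∀ {n} (f g : Vector n) → sumF (λ i → f i + g i) ≈ sumF f + sumF g
  sumF-+ f g = begin
    sumF (λ i → f i + g i) ≈⟨ sumF≈sum (λ i → f i + g i) ⟩
    sum (λ i → f i + g i)  ≈⟨ ∑-distrib-+ f g ⟩
    sum f + sum g          ≈⟨ +-cong (sumF≈sum f) (sumF≈sum g) ⟨
    sumF f + sumF g        ∎
    where open ≈-Reasoning

  sumF-* : ∀ {n} a (f : Vector n) → sumF (λ i → a * f i) ≈ a * sumF f
  sumF-* a f = begin
    sumF (λ i → a * f i) ≈⟨ sumF≈sum (λ i → a * f i) ⟩
    sum (λ i → a * f i)  ≈⟨ *-distribˡ-sum a f ⟨
    a * sum f            ≈⟨ *-cong refl (sumF≈sum f) ⟨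
    a * sumF f           ∎
    where open ≈-Reasoning

  sumF-0 : ∀ {n} {f : Vector n} → f ≈ᵥ zeroVec → sumF f ≈ 0#
  sumF-0 {n} f≈0 = trans (sumF-cong f≈0) (trans (sumF≈sum {n} zeroVec) (sum-replicate-zero n))

  sumF-comm : ∀ {m n} (f : Fin m → Fin n → Carrier) →
              sumF (λ i → sumF (f i)) ≈ sumF (λ j → sumF (λ i → f i j))
  sumF-comm {m} {n} f = begin
    sumF (λ i → sumF (f i))           ≈⟨ trans (sumF-cong (λ i → sumF≈sum (f i))) (sumF≈sum (λ i → sum (f i))) ⟩
    sum (λ i → sum (f i))             ≈⟨ ∑-comm f ⟩
    sum (λ j → sum (λ i → f i j))     ≈⟨ trans (sumF-cong (λ j → sumF≈sum (λ i → f i j))) (sumF≈sum (λ j → sum (λ i → f i j))) ⟨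
    sumF (λ j → sumF (λ i → f i j))   ∎
    where open ≈-Reasoning

  sumF-init-last : ∀ {m} (f : Vector (suc m)) → sumF f ≈ sumF (VF.init f) + VF.last f
  sumF-init-last f = begin
    sumF f                       ≈⟨ sumF≈sum f ⟩
    sum f                        ≈⟨ sum-init-last f ⟩
    sum (VF.init f) + VF.last f  ≈⟨ +-cong (sumF≈sum (VF.init f)) refl ⟨
    sumF (VF.init f) + VF.last f ∎
    where open ≈-Reasoning

  sumF-neg : ∀ {n} (f : Vector n) → sumF (λ i → - f i) ≈ - sumF f
  sumF-neg {zero}  f = sym -0#≈0#
  sumF-neg {suc n} f = trans (+-cong refl (sumF-neg (λ i → f (Fin.suc i)))) (sym (-‿distrib-+ _ _))

  sumF-++ : ∀ {m n} (f : Vector (m ℕ.+ n)) →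
            sumF f ≈ sumF (λ i → f (i ↑ˡ n)) + sumF (λ i → f (m ↑ʳ i))
  sumF-++ {zero}  f = sym (+-identityˡ _)
  sumF-++ {suc m} f = trans (+-cong refl (sumF-++ {m} (λ i → f (Fin.suc i)))) (sym (+-assoc _ _ _))

  sumF-δ : ∀ {n} (f : Vector n) j → (∀ i → ¬ i ≡ j → f i ≈ 0#) → sumF f ≈ f j
  sumF-δ f Fin.zero    f≈0 =
    trans (+-cong refl (sumF-0 (λ i → f≈0 (Fin.suc i) (λ ())))) (+-identityʳ _)
  sumF-δ f (Fin.suc j) f≈0 =
    trans (+-cong (f≈0 Fin.zero (λ ())) (sumF-δ (λ i → f (Fin.suc i)) j
            (λ i i≢j → f≈0 (Fin.suc i) (λ e → i≢j (FinP.suc-injective e)))))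
          (+-identityˡ _)

  infixl 26 _+ᵥ_ _-ᵥ_
  infix 29 -ᵥ_
  infixl 27 _*ᵥ_

  _+ᵥ_ : ∀ {n} → Vector n → Vector n → Vector n
  (u +ᵥ v) j = u j + v j

  _*ᵥ_ : ∀ {n} → Carrier → Vector n → Vector n
  (a *ᵥ v) j = a * v j

  -ᵥ_ : ∀ {n} → Vector n → Vector n
  (-ᵥ v) j = - v j

  _-ᵥ_ : ∀ {n} → Vector n → Vector n → Vector n
  u -ᵥ v = u +ᵥ (-ᵥ v)

  _≟ᵥ_ : ∀ {n} (v w : Vector n) → Dec (v ≈ᵥ w)
  v ≟ᵥ w = FinP.all? (λ j → v j ≟ w j)

  u-v≈0⇒u≈v : ∀ {n} {u v : Vector n} → (u -ᵥ v) ≈ᵥ zeroVec → u ≈ᵥ v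
  u-v≈0⇒u≈v u-v≈0 j = x∙y⁻¹≈ε⇒x≈y _ _ (u-v≈0 j)

  *ᵥ-zeroʳ : ∀ {m} t {v : Vector m} → v ≈ᵥ zeroVec → t *ᵥ v ≈ᵥ zeroVec
  *ᵥ-zeroʳ t v≈0 j = trans (*-cong refl (v≈0 j)) (zeroʳ t)

  *ᵥ-zeroˡ : ∀ {m} (v : Vector m) → 0# *ᵥ v ≈ᵥ zeroVec
  *ᵥ-zeroˡ v j = zeroˡ (v j)

  ·ᵥ-cong : ∀ {m n} {c c′ : Vector m} {B B′ : Matrix m n} →
            c ≈ᵥ c′ → (∀ i → B i ≈ᵥ B′ i) → (c ·ᵥ B) ≈ᵥ (c′ ·ᵥ B′)
  ·ᵥ-cong c≈c′ B≈B′ j = sumF-cong (λ i → *-cong (c≈c′ i) (B≈B′ i j))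

  ·ᵥ-congˡ : ∀ {m n} {c c′ : Vector m} (B : Matrix m n) → c ≈ᵥ c′ → (c ·ᵥ B) ≈ᵥ (c′ ·ᵥ B)
  ·ᵥ-congˡ B c≈c′ = ·ᵥ-cong c≈c′ (λ _ → ≋-refl)

  ·ᵥ-distribʳ-+ᵥ : ∀ {m n} (c d : Vector m) (B : Matrix m n) → ((c +ᵥ d) ·ᵥ B) ≈ᵥ ((c ·ᵥ B) +ᵥ (d ·ᵥ B))
  ·ᵥ-distribʳ-+ᵥ c d B j =
    trans (sumF-cong (λ i → distribʳ (B i j) (c i) (d i))) (sumF-+ (λ i → c i * B i j) (λ i → d i * B i j))

  *ᵥ-·ᵥ : ∀ {m n} a (c : Vector m) (B : Matrix m n) → ((a *ᵥ c) ·ᵥ B) ≈ᵥ (a *ᵥ (c ·ᵥ B))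
  *ᵥ-·ᵥ a c B j = trans (sumF-cong (λ i → *-assoc a (c i) (B i j))) (sumF-* a (λ i → c i * B i j))

  -ᵥ-·ᵥ : ∀ {m n} (c : Vector m) (B : Matrix m n) → ((-ᵥ c) ·ᵥ B) ≈ᵥ (-ᵥ (c ·ᵥ B))
  -ᵥ-·ᵥ c B j = trans (sumF-cong (λ i → sym (-‿distribˡ-* (c i) (B i j)))) (sumF-neg (λ i → c i * B i j))

  ·ᵥ-zeroˡ : ∀ {m n} {c : Vector m} (B : Matrix m n) → c ≈ᵥ zeroVec → (c ·ᵥ B) ≈ᵥ zeroVec
  ·ᵥ-zeroˡ B c≈0 j = sumF-0 (λ i → trans (*-cong (c≈0 i) refl) (zeroˡ (B i j)))

  ·ᵥ-zeroMat : ∀ {m n} (c : Vector m) → (c ·ᵥ zeroMat {m} {n}) ≈ᵥ zeroVec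
  ·ᵥ-zeroMat c j = sumF-0 (λ i → zeroʳ (c i))

  ·ᵥ-·ₘ : ∀ {l m n} (c : Vector l) (A : Matrix l m) (B : Matrix m n) → (c ·ᵥ (A ·ₘ B)) ≈ᵥ ((c ·ᵥ A) ·ᵥ B)
  ·ᵥ-·ₘ c A B j = begin
    sumF (λ i → c i * sumF (λ k → A i k * B k j))    ≈⟨ sumF-cong (λ i → sym (sumF-* (c i) (λ k → A i k * B k j))) ⟩
    sumF (λ i → sumF (λ k → c i * (A i k * B k j)))  ≈⟨ sumF-comm (λ i k → c i * (A i k * B k j)) ⟩
    sumF (λ k → sumF (λ i → c i * (A i k * B k j)))  ≈⟨ sumF-cong (λ k → sumF-cong (λ i → sym (*-assoc (c i) (A i k) (B k j)))) ⟩
    sumF (λ k → sumF (λ i → (c i * A i k) * B k j))  ≈⟨ sumF-cong (λ k → pull-right (λ i → c i * A i k) (B k j)) ⟩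
    sumF (λ k → sumF (λ i → c i * A i k) * B k j)    ∎
    where
    open ≈-Reasoning
    pull-right : ∀ {l} (f : Vector l) b → sumF (λ i → f i * b) ≈ sumF f * b
    pull-right f b = trans (sumF-cong (λ i → *-comm (f i) b)) (trans (sumF-* b f) (*-comm b (sumF f)))

  lincomb-+ᵥ : ∀ {m n} (c₀ c : Vector m) t (U : Matrix m n) v →
               ((c₀ +ᵥ c) ·ᵥ U) +ᵥ t *ᵥ v ≈ᵥ (c₀ ·ᵥ U) +ᵥ ((c ·ᵥ U) +ᵥ t *ᵥ v)
  lincomb-+ᵥ c₀ c t U v j = trans (+-cong (·ᵥ-distribʳ-+ᵥ c₀ c U j) refl) (+-assoc _ _ _)

  lincomb-negᵥ : ∀ {m n} (c : Vector m) t (U : Matrix m n) v →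
                 ((-ᵥ c) ·ᵥ U) +ᵥ (- t) *ᵥ v ≈ᵥ -ᵥ ((c ·ᵥ U) +ᵥ t *ᵥ v)
  lincomb-negᵥ c t U v j = trans (+-cong (-ᵥ-·ᵥ c U j) (sym (-‿distribˡ-* t (v j)))) (sym (-‿distrib-+ _ _))

  take-++-drop : ∀ {m n} (v : Vector (m ℕ.+ n)) → v ≈ᵥ (VF.take m v ++ VF.drop m v)
  take-++-drop {m} v j with splitAt m j in eq
  ... | inj₁ j′ = reflexive (P.cong v (P.sym (FinP.splitAt⁻¹-↑ˡ eq)))
  ... | inj₂ j′ = reflexive (P.cong v (P.sym (FinP.splitAt⁻¹-↑ʳ eq)))

  ·ᵥ-++ : ∀ {m d n} (c : Vector (m ℕ.+ d)) (X : Matrix m n) (Y : Matrix d n) →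
          (c ·ᵥ (X ++ Y)) ≈ᵥ ((VF.take m c ·ᵥ X) +ᵥ (VF.drop m c ·ᵥ Y))
  ·ᵥ-++ {m} {d} c X Y j = trans (sumF-++ {m} {d} _)
    (+-cong (sumF-cong (λ i → *-cong refl (reflexive (P.cong (λ r → r j) (VFP.lookup-++ˡ X Y i)))))
            (sumF-cong (λ i → *-cong refl (reflexive (P.cong (λ r → r j) (VFP.lookup-++ʳ X Y i))))))

  ++-·ᵥ-++ : ∀ {m d n} (c : Vector m) (e : Vector d) (X : Matrix m n) (Y : Matrix d n) →
             ((c ++ e) ·ᵥ (X ++ Y)) ≈ᵥ ((c ·ᵥ X) +ᵥ (e ·ᵥ Y))
  ++-·ᵥ-++ {m} c e X Y j = trans (·ᵥ-++ (c ++ e) X Y j)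
    (+-cong (·ᵥ-congˡ X (λ i → reflexive (VFP.lookup-++ˡ c e i)) j) (·ᵥ-congˡ Y (λ i → reflexive (VFP.lookup-++ʳ c e i)) j))

  ·ᵥ-∣ₘ : ∀ {m n₁ n₂} (c : Vector m) (A : Matrix m n₁) (B : Matrix m n₂) →
          (c ·ᵥ (A ∣ₘ B)) ≈ᵥ ((c ·ᵥ A) ++ (c ·ᵥ B))
  ·ᵥ-∣ₘ {n₁ = n₁} c A B j with splitAt n₁ j
  ... | inj₁ _ = refl
  ... | inj₂ _ = refl

  ++-+ᵥ : ∀ {m n} (u u′ : Vector m) (w w′ : Vector n) → ((u ++ w) +ᵥ (u′ ++ w′)) ≈ᵥ ((u +ᵥ u′) ++ (w +ᵥ w′))
  ++-+ᵥ {m} u u′ w w′ j with splitAt m j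
  ... | inj₁ _ = refl
  ... | inj₂ _ = refl

  *ᵥ-++ : ∀ {m n} a (u : Vector m) (w : Vector n) → (a *ᵥ (u ++ w)) ≈ᵥ ((a *ᵥ u) ++ (a *ᵥ w))
  *ᵥ-++ {m} a u w j with splitAt m j
  ... | inj₁ _ = refl
  ... | inj₂ _ = refl

  zeroVec-++ : ∀ {m n} → (zeroVec {m} ++ zeroVec {n}) ≈ᵥ zeroVec
  zeroVec-++ {m} j with splitAt m j
  ... | inj₁ _ = refl
  ... | inj₂ _ = refl

  identity-≢ : ∀ {n} (i j : Fin n) → ¬ i ≡ j → identity i j ≈ 0#
  identity-≢ i j i≢j with i Fin.≟ j
  ... | yes i≡j = contradiction i≡j i≢j
  ... | no _    = refl

  identity-diag : ∀ {n} (i : Fin n) → identity i i ≈ 1#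
  identity-diag i with i Fin.≟ i
  ... | yes _   = refl
  ... | no i≢i  = contradiction P.refl i≢i

  ·ᵥ-identity : ∀ {n} (c : Vector n) → (c ·ᵥ identity) ≈ᵥ c
  ·ᵥ-identity c j = trans (sumF-δ _ j (λ i i≢j → trans (*-cong refl (identity-≢ i j i≢j)) (zeroʳ _)))
                          (trans (*-cong refl (identity-diag j)) (*-identityʳ _))

  basis-·ᵥ : ∀ {m n} (i : Fin m) (B : Matrix m n) → (identity i ·ᵥ B) ≈ᵥ B i
  basis-·ᵥ i B j = trans (sumF-δ _ i (λ k k≢i → trans (*-cong (identity-≢ i k (λ e → k≢i (P.sym e))) refl) (zeroˡ _)))
                         (trans (*-cong (identity-diag i) refl) (*-identityˡ _))

  blockDiag-·ᵥ : ∀ {m n} (A : Matrix m m) (B : Matrix n n) (u : Vector m) (w : Vector n) →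
                 ((u ++ w) ·ᵥ blockDiag A B) ≈ᵥ ((u ·ᵥ A) ++ (w ·ᵥ B))
  blockDiag-·ᵥ {m} {n} A B u w j = begin
    ((u ++ w) ·ᵥ blockDiag A B) j
      ≈⟨ sumF-++ {m} {n} _ ⟩
    sumF (λ i → (u ++ w) (i ↑ˡ n) * blockDiag A B (i ↑ˡ n) j) + sumF (λ i → (u ++ w) (m ↑ʳ i) * blockDiag A B (m ↑ʳ i) j)
      ≈⟨ +-cong (sumF-cong (λ i → *-cong (reflexive (VFP.lookup-++ˡ u w i)) (upper i)))
                (sumF-cong (λ i → *-cong (reflexive (VFP.lookup-++ʳ u w i)) (lower i))) ⟩
    sumF (λ i → u i * (A i ++ zeroVec) j) + sumF (λ i → w i * (zeroVec {m} ++ B i) j)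
      ≈⟨ by-block ⟩
    ((u ·ᵥ A) ++ (w ·ᵥ B)) j ∎
    where
    open ≈-Reasoning
    upper : ∀ i → blockDiag A B (i ↑ˡ n) j ≈ (A i ++ zeroVec) j
    upper i rewrite FinP.splitAt-↑ˡ m i n with splitAt m j
    ... | inj₁ _ = refl
    ... | inj₂ _ = refl
    lower : ∀ i → blockDiag A B (m ↑ʳ i) j ≈ (zeroVec {m} ++ B i) j
    lower i rewrite FinP.splitAt-↑ʳ m n i with splitAt m j
    ... | inj₁ _ = refl
    ... | inj₂ _ = refl
    by-block : sumF (λ i → u i * (A i ++ zeroVec) j) + sumF (λ i → w i * (zeroVec {m} ++ B i) j)
             ≈ ((u ·ᵥ A) ++ (w ·ᵥ B)) j
    by-block with splitAt m j
    ... | inj₁ _ = trans (+-cong refl (sumF-0 (λ i → zeroʳ (w i)))) (+-identityʳ _)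
    ... | inj₂ _ = trans (+-cong (sumF-0 (λ i → zeroʳ (u i))) refl) (+-identityˡ _)

  -- Enumerating the vectors of 𝔽^m

  encode : ∀ {m} → Vector m → Fin (q ℕ.^ m)
  encode {zero}  v = Fin.zero
  encode {suc m} v = Fin.combine (proj₁ (enum-surj (v Fin.zero))) (encode (λ j → v (Fin.suc j)))

  decode : ∀ m → Fin (q ℕ.^ m) → Vector m
  decode zero    i = λ ()
  decode (suc m) i = let (i₀ , i′) = Fin.remQuot (q ℕ.^ m) i in enum i₀ VF.∷ decode m i′

  decode-encode : ∀ {m} (v : Vector m) → decode m (encode v) ≈ᵥ v
  decode-encode {suc m} v j =
    P.subst (λ (i₀ , i′) → (enum i₀ VF.∷ decode m i′) j ≈ v j) (P.sym remQuot-encode) (by-position j)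
    where
    tail = λ j → v (Fin.suc j)
    remQuot-encode : Fin.remQuot (q ℕ.^ m) (encode v) ≡ (proj₁ (enum-surj (v Fin.zero)) , encode tail)
    remQuot-encode = FinP.remQuot-combine {q} {q ℕ.^ m} _ _
    by-position : ∀ j → (enum (proj₁ (enum-surj (v Fin.zero))) VF.∷ decode m (encode tail)) j ≈ v j
    by-position Fin.zero    = proj₂ (enum-surj (v Fin.zero))
    by-position (Fin.suc j) = decode-encode tail j

  decode-injective : ∀ m {i j} → decode m i ≈ᵥ decode m j → i ≡ j
  decode-injective zero    {Fin.zero} {Fin.zero} _ = P.refl
  decode-injective (suc m) {i} {j} i≈j =
    P.trans (P.sym (FinP.combine-remQuot {q} (q ℕ.^ m) i))
      (P.trans (P.cong₂ Fin.combine (enum-inj _ _ (i≈j Fin.zero)) (decode-injective m (λ k → i≈j (Fin.suc k))))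
               (FinP.combine-remQuot {q} (q ℕ.^ m) j))

  encode-injective : ∀ {m} {x y : Vector m} → encode x ≡ encode y → x ≈ᵥ y
  encode-injective {m} {x} {y} e =
    ≋-trans (≋-sym (decode-encode x)) (≋-trans (≋-reflexive (P.cong (decode m) e)) (decode-encode y))

  encode-cong : ∀ {m} {x y : Vector m} → x ≈ᵥ y → encode x ≡ encode y
  encode-cong {m} {x} {y} x≈y = decode-injective m (≋-trans (decode-encode x) (≋-trans x≈y (≋-sym (decode-encode y))))

  2≤q : 2 ≤ q
  2≤q = distinct⇒2≤ (proj₁ (enum-surj 0#)) (proj₁ (enum-surj 1#)) 0≢1
    where
    0≢1 : ¬ proj₁ (enum-surj 0#) ≡ proj₁ (enum-surj 1#)
    0≢1 e = 1≉0 (trans (sym (proj₂ (enum-surj 1#))) (trans (reflexive (P.cong enum (P.sym e))) (proj₂ (enum-surj 0#))))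
    distinct⇒2≤ : ∀ {n} (i j : Fin n) → ¬ i ≡ j → 2 ≤ n
    distinct⇒2≤ {suc zero}    Fin.zero Fin.zero i≢j = contradiction P.refl i≢j
    distinct⇒2≤ {suc (suc n)} _        _        _   = s≤s (s≤s z≤n)

  q^m≤q^s⇒m≤s : ∀ {m s} → q ℕ.^ m ≤ q ℕ.^ s → m ≤ s
  q^m≤q^s⇒m≤s {m} {s} q^m≤q^s with m ℕ.≤? s
  ... | yes m≤s = m≤s
  ... | no  m≰s = contradiction q^m≤q^s (ℕP.<⇒≱ (ℕP.^-monoʳ-< q 2≤q (ℕP.≰⇒> m≰s)))

  injective⇒surjective : ∀ {n} (h : Fin n → Fin n) → (∀ {x y} → h x ≡ h y → x ≡ y) → ∀ y → ∃ λ x → h x ≡ y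
  injective⇒surjective {suc n} h h-inj y with FinP.any? (λ x → h x Fin.≟ y)
  ... | yes hit = hit
  ... | no  miss = contradiction (FinP.injective⇒≤ {f = h′} h′-inj) ℕP.1+n≰n
    where
    h′ : Fin (suc n) → Fin n
    h′ x = Fin.punchOut {i = y} {j = h x} (λ e → miss (x , P.sym e))
    h′-inj : ∀ {x z} → h′ x ≡ h′ z → x ≡ z
    h′-inj {x} {z} e = h-inj (FinP.punchOut-injective {i = y} (λ e → miss (x , P.sym e)) (λ e → miss (z , P.sym e)) e)

  vector-injective⇒surjective : ∀ {r} (f : Vector r → Vector r) → (∀ z z′ → f z ≈ᵥ f z′ → z ≈ᵥ z′) →
                                ∀ u → ∃ λ z → f z ≈ᵥ u
  vector-injective⇒surjective {r} f f-inj u with injective⇒surjective f̂ f̂-inj (encode u)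
    where
    f̂ : Fin (q ℕ.^ r) → Fin (q ℕ.^ r)
    f̂ i = encode (f (decode r i))
    f̂-inj : ∀ {i j} → f̂ i ≡ f̂ j → i ≡ j
    f̂-inj e = decode-injective r (f-inj _ _ (encode-injective e))
  ... | i , f̂i≡u = decode r i , encode-injective f̂i≡u

  vector-surjective⇒injective : ∀ {r} (f : Vector r → Vector r) → (∀ {z z′} → z ≈ᵥ z′ → f z ≈ᵥ f z′) →
                                (∀ u → ∃ λ z → f z ≈ᵥ u) → ∀ z z′ → f z ≈ᵥ f z′ → z ≈ᵥ z′
  vector-surjective⇒injective {r} f f-cong f-surj z z′ fz≈fz′ =
    ≋-trans (≋-sym sy≈z) (≋-trans (≋-reflexive (P.cong (λ i → proj₁ (f-surj (decode r i))) ey≡ey′)) sy′≈z′)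
    where
    -- choosing the preimage of a canonical representative makes s respect ≈ᵥ
    s : Vector r → Vector r
    s u = proj₁ (f-surj (decode r (encode u)))
    f∘s≈id : ∀ u → f (s u) ≈ᵥ u
    f∘s≈id u = ≋-trans (proj₂ (f-surj (decode r (encode u)))) (decode-encode u)
    s-inj : ∀ u u′ → s u ≈ᵥ s u′ → u ≈ᵥ u′
    s-inj u u′ su≈su′ = ≋-trans (≋-sym (f∘s≈id u)) (≋-trans (f-cong su≈su′) (f∘s≈id u′))
    y = proj₁ (vector-injective⇒surjective s s-inj z)
    sy≈z = proj₂ (vector-injective⇒surjective s s-inj z)
    y′ = proj₁ (vector-injective⇒surjective s s-inj z′)
    sy′≈z′ = proj₂ (vector-injective⇒surjective s s-inj z′)
    ey≡ey′ : encode y ≡ encode y′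
    ey≡ey′ = encode-cong (≋-trans (≋-sym (f∘s≈id y))
               (≋-trans (f-cong sy≈z) (≋-trans fz≈fz′ (≋-trans (f-cong (≋-sym sy′≈z′)) (f∘s≈id y′)))))

  -- Row spaces, independence and dimension

  rowsp-resp : ∀ {m n} (B : Matrix m n) {v w} → v ≈ᵥ w → rowsp B v → rowsp B w
  rowsp-resp B v≈w (c , v≈cB) = c , ≋-trans (≋-sym v≈w) v≈cB

  rowsp-row : ∀ {m n} (B : Matrix m n) i → rowsp B (B i)
  rowsp-row B i = identity i , ≋-sym (basis-·ᵥ i B)

  rowsp-zero : ∀ {m n} (B : Matrix m n) → rowsp B zeroVec
  rowsp-zero B = zeroVec , ≋-sym (·ᵥ-zeroˡ B ≋-refl)

  rowsp-+ : ∀ {m n} (B : Matrix m n) {x y} → rowsp B x → rowsp B y → rowsp B (x +ᵥ y)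
  rowsp-+ B (c , x≈cB) (d , y≈dB) = c +ᵥ d , λ j → trans (+-cong (x≈cB j) (y≈dB j)) (sym (·ᵥ-distribʳ-+ᵥ c d B j))

  rowsp-* : ∀ {m n} (B : Matrix m n) a {x} → rowsp B x → rowsp B (a *ᵥ x)
  rowsp-* B a (c , x≈cB) = a *ᵥ c , λ j → trans (*-cong refl (x≈cB j)) (sym (*ᵥ-·ᵥ a c B j))

  rowsp-neg : ∀ {m n} (B : Matrix m n) {x} → rowsp B x → rowsp B (-ᵥ x)
  rowsp-neg B (c , x≈cB) = -ᵥ c , λ j → trans (-‿cong (x≈cB j)) (sym (-ᵥ-·ᵥ c B j))

  coeffs : ∀ {m s n} {X : Matrix m n} {B : Matrix s n} → (∀ i → rowsp B (X i)) → Matrix m s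
  coeffs X⊆B i = proj₁ (X⊆B i)

  ·ᵥ-coeffs : ∀ {m s n} {X : Matrix m n} (B : Matrix s n) (X⊆B : ∀ i → rowsp B (X i)) →
              ∀ c → (c ·ᵥ X) ≈ᵥ ((c ·ᵥ coeffs X⊆B) ·ᵥ B)
  ·ᵥ-coeffs B X⊆B c = ≋-trans (·ᵥ-cong ≋-refl (λ i → proj₂ (X⊆B i))) (·ᵥ-·ₘ c (coeffs X⊆B) B)

  rowsp-lincomb : ∀ {m s n} {X : Matrix m n} (B : Matrix s n) → (∀ i → rowsp B (X i)) → ∀ c → rowsp B (c ·ᵥ X)
  rowsp-lincomb B X⊆B c = c ·ᵥ coeffs X⊆B , ·ᵥ-coeffs B X⊆B c

  rowsp? : ∀ {s n} (B : Matrix s n) v → Dec (rowsp B v)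
  rowsp? {s} B v with FinP.any? (λ i → v ≟ᵥ (decode s i ·ᵥ B))
  ... | yes (i , v≈) = yes (decode s i , v≈)
  ... | no  none     = no λ (c , v≈cB) → none (encode c , ≋-trans v≈cB (·ᵥ-congˡ B (≋-sym (decode-encode c))))

  LinIndep-injective : ∀ {m n} {b : Matrix m n} → LinIndep b → ∀ c d → (c ·ᵥ b) ≈ᵥ (d ·ᵥ b) → c ≈ᵥ d
  LinIndep-injective {b = b} ind c d cb≈db = u-v≈0⇒u≈v (ind (c -ᵥ d) (λ j → begin
    ((c -ᵥ d) ·ᵥ b) j          ≈⟨ ·ᵥ-distribʳ-+ᵥ c (-ᵥ d) b j ⟩
    (c ·ᵥ b) j + ((-ᵥ d) ·ᵥ b) j ≈⟨ +-cong (cb≈db j) (-ᵥ-·ᵥ d b j) ⟩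
    (d ·ᵥ b) j + - (d ·ᵥ b) j  ≈⟨ -‿inverseʳ _ ⟩
    0#                         ∎))
    where open ≈-Reasoning

  LinIndep-row≉0 : ∀ {r n} {A : Matrix r n} → LinIndep A → ∀ i → ¬ A i ≈ᵥ zeroVec
  LinIndep-row≉0 {A = A} ind i Aᵢ≈0 =
    1≉0 (trans (sym (identity-diag i)) (ind (identity i) (≋-trans (basis-·ᵥ i A) Aᵢ≈0) i))

  LinIndep⇒≤ : ∀ {m s n} (b : Matrix m n) (B : Matrix s n) → LinIndep b → (∀ i → rowsp B (b i)) → m ≤ s
  LinIndep⇒≤ {m} {s} b B ind b⊆B = q^m≤q^s⇒m≤s (FinP.injective⇒≤ {f = f} f-inj)
    where
    f : Fin (q ℕ.^ m) → Fin (q ℕ.^ s)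
    f i = encode (decode m i ·ᵥ coeffs b⊆B)
    f-inj : ∀ {i j} → f i ≡ f j → i ≡ j
    f-inj {i} {j} e = decode-injective m (LinIndep-injective ind _ _
      (≋-trans (·ᵥ-coeffs B b⊆B (decode m i))
        (≋-trans (·ᵥ-congˡ B (encode-injective e)) (≋-sym (·ᵥ-coeffs B b⊆B (decode m j))))))

  rowsp-∣ₘ⁻ : ∀ {m n₁ n₂} {A : Matrix m n₁} {B : Matrix m n₂} {w} → rowsp (A ∣ₘ B) w → ∃ λ c → w ≈ᵥ ((c ·ᵥ A) ++ (c ·ᵥ B))
  rowsp-∣ₘ⁻ {A = A} {B} (c , w≈) = c , ≋-trans w≈ (·ᵥ-∣ₘ c A B)

  rowsp-∣ₘ⁺ : ∀ {m n₁ n₂} {A : Matrix m n₁} {B : Matrix m n₂} c → rowsp (A ∣ₘ B) ((c ·ᵥ A) ++ (c ·ᵥ B))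
  rowsp-∣ₘ⁺ {A = A} {B} c = c , ≋-sym (·ᵥ-∣ₘ c A B)

  addRow-∣ₘ-lincomb : ∀ {m n₁ n₂} (A : Matrix m n₁) (B : Matrix m n₂) x y c t →
    ((c ·ᵥ (A ∣ₘ B)) +ᵥ t *ᵥ (x ++ y)) ≈ᵥ (((c ·ᵥ A) +ᵥ t *ᵥ x) ++ ((c ·ᵥ B) +ᵥ t *ᵥ y))
  addRow-∣ₘ-lincomb {n₁ = n₁} A B x y c t j = trans (+-cong (·ᵥ-∣ₘ c A B j) (*ᵥ-++ t x y j)) (++-+ᵥ {n₁} _ _ _ _ j)

  rowsp-addRow-∣ₘ⁻ : ∀ {m n₁ n₂} {A : Matrix m n₁} {B : Matrix m n₂} {x y w} →
    rowsp (addRow (A ∣ₘ B) (x ++ y)) w → ∃ λ c → ∃ λ t → w ≈ᵥ (((c ·ᵥ A) +ᵥ t *ᵥ x) ++ ((c ·ᵥ B) +ᵥ t *ᵥ y))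
  rowsp-addRow-∣ₘ⁻ {m} {A = A} {B} {x} {y} (c , w≈) = VF.take m c , VF.drop m c Fin.zero ,
    ≋-trans w≈ (≋-trans (·ᵥ-++ c (A ∣ₘ B) (λ _ → x ++ y)) (≋-trans (λ j → +-cong refl (+-identityʳ _))
      (addRow-∣ₘ-lincomb A B x y (VF.take m c) (VF.drop m c Fin.zero))))

  rowsp-addRow-∣ₘ⁺ : ∀ {m n₁ n₂} {A : Matrix m n₁} {B : Matrix m n₂} {x y} c t →
    rowsp (addRow (A ∣ₘ B) (x ++ y)) (((c ·ᵥ A) +ᵥ t *ᵥ x) ++ ((c ·ᵥ B) +ᵥ t *ᵥ y))
  rowsp-addRow-∣ₘ⁺ {A = A} {B} {x} {y} c t = c ++ (λ _ → t) ,
    ≋-sym (≋-trans (++-·ᵥ-++ c (λ _ → t) (A ∣ₘ B) (λ _ → x ++ y)) (≋-trans (λ j → +-cong refl (+-identityʳ _))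
      (addRow-∣ₘ-lincomb A B x y c t)))

  record IsDecSubspace {n} (S : Subspace n) : Set₁ where
    field
      ∈-dec     : ∀ v → Dec (S v)
      ∈-resp    : ∀ {v w} → v ≈ᵥ w → S v → S w
      ∈-lincomb : ∀ {m} (X : Matrix m n) → (∀ i → S (X i)) → ∀ c → S (c ·ᵥ X)

    ∈-zero : S zeroVec
    ∈-zero = ∈-lincomb {0} (λ ()) (λ ()) (λ ())
  open IsDecSubspace

  rowsp-isDecSubspace : ∀ {m n} (B : Matrix m n) → IsDecSubspace (rowsp B)
  rowsp-isDecSubspace B = record { ∈-dec = rowsp? B ; ∈-resp = rowsp-resp B ; ∈-lincomb = λ X X⊆B c → rowsp-lincomb B X⊆B c }

  ≐-isDecSubspace : ∀ {n} {S T : Subspace n} → S ≐ T → IsDecSubspace T → IsDecSubspace S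
  ≐-isDecSubspace (S⊆T , T⊆S) T-dec = record
    { ∈-dec     = λ v → map′ (T⊆S v) (S⊆T v) (∈-dec T-dec v)
    ; ∈-resp    = λ v≈w s → T⊆S _ (∈-resp T-dec v≈w (S⊆T _ s))
    ; ∈-lincomb = λ X X⊆S c → T⊆S _ (∈-lincomb T-dec X (λ i → S⊆T _ (X⊆S i)) c) }

  ∩-isDecSubspace : ∀ {n} {S T : Subspace n} → IsDecSubspace S → IsDecSubspace T → IsDecSubspace (S ∩ₛ T)
  ∩-isDecSubspace S-dec T-dec = record
    { ∈-dec     = λ v → ∈-dec S-dec v ×-dec ∈-dec T-dec v
    ; ∈-resp    = λ v≈w (s , t) → ∈-resp S-dec v≈w s , ∈-resp T-dec v≈w t
    ; ∈-lincomb = λ X X⊆S∩T c → ∈-lincomb S-dec X (λ i → proj₁ (X⊆S∩T i)) c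
                              , ∈-lincomb T-dec X (λ i → proj₂ (X⊆S∩T i)) c }

  Dim⇒isDecSubspace : ∀ {n d} {S : Subspace n} → Dim S d → IsDecSubspace S
  Dim⇒isDecSubspace (B , _ , S≐B) = ≐-isDecSubspace S≐B (rowsp-isDecSubspace B)

  Dim-≐ : ∀ {n d} {S T : Subspace n} → S ≐ T → Dim S d → Dim T d
  Dim-≐ (S⊆T , T⊆S) (B , ind , S⊆B , B⊆S) = B , ind , (λ w t → S⊆B w (T⊆S w t)) , (λ w b → S⊆T w (B⊆S w b))

  LinIndep₂ : ∀ {m d n} → Matrix m n → Matrix d n → Set
  LinIndep₂ X Y = ∀ c e → ((c ·ᵥ X) +ᵥ (e ·ᵥ Y)) ≈ᵥ zeroVec → c ≈ᵥ zeroVec × e ≈ᵥ zeroVec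

  rowsp₂ : ∀ {m d n} → Matrix m n → Matrix d n → Subspace n
  rowsp₂ X Y w = ∃ λ c → ∃ λ e → w ≈ᵥ ((c ·ᵥ X) +ᵥ (e ·ᵥ Y))

  LinIndep₂⇒LinIndep : ∀ {m d n} {X : Matrix m n} {Y : Matrix d n} → LinIndep₂ X Y → LinIndep (X ++ Y)
  LinIndep₂⇒LinIndep {m} {d} {X = X} {Y} ind c c·X++Y≈0 =
    ≋-trans (take-++-drop {m} c) (≋-trans (++⁺ _≈_ (proj₁ halves≈0) (proj₂ halves≈0)) (zeroVec-++ {m} {d}))
    where halves≈0 = ind (VF.take m c) (VF.drop m c) (≋-trans (≋-sym (·ᵥ-++ c X Y)) c·X++Y≈0)

  LinIndep⇒LinIndep₂ˡ : ∀ {m n} {X : Matrix m n} → LinIndep X → LinIndep₂ {d = 0} X (λ ())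
  LinIndep⇒LinIndep₂ˡ ind c e c·X≈0 = ind c (λ j → trans (sym (+-identityʳ _)) (c·X≈0 j)) , (λ ())

  LinIndep⇒LinIndep₂ʳ : ∀ {d n} {Y : Matrix d n} → LinIndep Y → LinIndep₂ {0} (λ ()) Y
  LinIndep⇒LinIndep₂ʳ ind c e e·Y≈0 = (λ ()) , ind e (λ j → trans (sym (+-identityˡ _)) (e·Y≈0 j))

  LinIndep₂⇒LinIndepʳ : ∀ {d n} {Y : Matrix d n} → LinIndep₂ {0} (λ ()) Y → LinIndep Y
  LinIndep₂⇒LinIndepʳ ind e e·Y≈0 = proj₂ (ind (λ ()) e (λ j → trans (+-identityˡ _) (e·Y≈0 j)))

  rowsp₂⇒rowsp : ∀ {m d n} {X : Matrix m n} {Y : Matrix d n} {w} → rowsp₂ X Y w → rowsp (X ++ Y) w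
  rowsp₂⇒rowsp {X = X} {Y} (c , e , w≈) = c ++ e , ≋-trans w≈ (≋-sym (++-·ᵥ-++ c e X Y))

  rowsp⇒rowsp₂ : ∀ {m d n} {X : Matrix m n} {Y : Matrix d n} {w} → rowsp (X ++ Y) w → rowsp₂ X Y w
  rowsp⇒rowsp₂ {m} {X = X} {Y} (c , w≈) = VF.take m c , VF.drop m c , ≋-trans w≈ (·ᵥ-++ c X Y)

  rowsp₂-resp : ∀ {m d n} (X : Matrix m n) (Y : Matrix d n) {v w} → v ≈ᵥ w → rowsp₂ X Y v → rowsp₂ X Y w
  rowsp₂-resp X Y v≈w (c , e , v≈) = c , e , ≋-trans (≋-sym v≈w) v≈

  LinIndep₂-∷ : ∀ {m d n} {L : Matrix m n} {Q : Matrix d n} {v} →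
                LinIndep₂ L Q → ¬ rowsp₂ L Q v → LinIndep₂ L (v VF.∷ Q)
  LinIndep₂-∷ {L = L} {Q} {v} ind v∉ c e sum≈0 with e Fin.zero ≟ 0#
  ... | yes e₀≈0 = proj₁ rest≈0 , λ { Fin.zero → e₀≈0 ; (Fin.suc i) → proj₂ rest≈0 i }
    where
    rest≈0 = ind c (VF.tail e) λ j →
      trans (+-cong refl (sym (trans (+-cong (trans (*-cong e₀≈0 refl) (zeroˡ _)) refl) (+-identityˡ _)))) (sum≈0 j)
  ... | no e₀≉0 = contradiction v∈ v∉
    where
    y = proj₁ (inverse (e Fin.zero) e₀≉0)
    -y = - y
    e₀y≈1 = proj₂ (inverse (e Fin.zero) e₀≉0)
    v∈ : rowsp₂ L Q v
    v∈ = -y *ᵥ c , -y *ᵥ VF.tail e , λ j →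
      trans (solve-for-v (sum≈0 j)) (trans (distribˡ -y _ _) (sym (+-cong (*ᵥ-·ᵥ -y c L j) (*ᵥ-·ᵥ -y (VF.tail e) Q j))))
      where
      solve-for-v : ∀ {x b c′} → b + (e Fin.zero * x + c′) ≈ 0# → x ≈ -y * (b + c′)
      solve-for-v {x} {b} {c′} h = begin
        x                      ≈⟨ *-identityˡ x ⟨
        1# * x                 ≈⟨ *-cong (trans (*-comm y _) e₀y≈1) refl ⟨
        (y * e Fin.zero) * x   ≈⟨ *-assoc y _ x ⟩
        y * (e Fin.zero * x)   ≈⟨ *-cong refl (inverseˡ-unique _ _ (trans (sym (x∙yz≈y∙xz b _ c′)) h)) ⟩
        y * - (b + c′)         ≈⟨ -‿distribʳ-* y _ ⟨
        - (y * (b + c′))       ≈⟨ -‿distribˡ-* y _ ⟩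
        -y * (b + c′)          ∎
        where open ≈-Reasoning

  rowsp₂? : ∀ {m d n} (X : Matrix m n) (Y : Matrix d n) v → Dec (rowsp₂ X Y v)
  rowsp₂? X Y v = map′ rowsp⇒rowsp₂ rowsp₂⇒rowsp (rowsp? (X ++ Y) v)

  BasisExtension : ∀ {m n} → Matrix m n → Subspace n → Set
  BasisExtension {n = n} L S = ∃ λ d → ∃ λ (Q : Matrix d n) → (∀ i → S (Q i)) × LinIndep₂ L Q × S ⊆ rowsp₂ L Q

  rowsp-identity : ∀ {n} (v : Vector n) → rowsp (identity {n}) v
  rowsp-identity v = v , ≋-sym (·ᵥ-identity v)

  extend-basis : ∀ {n} {S : Subspace n} → IsDecSubspace S → ∀ fuel {m d} (L : Matrix m n) (Q : Matrix d n) →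
                 m ℕ.+ d ℕ.+ fuel ≡ n → LinIndep₂ L Q → (∀ i → S (Q i)) → BasisExtension L S
  extend-basis {n} {S} S-dec fuel {m} {d} L Q size ind Q⊆S
    with FinP.any? (λ i → ∈-dec S-dec (decode n i) ×-dec ¬? (rowsp₂? L Q (decode n i)))
  ... | no none = d , Q , Q⊆S , ind , λ w w∈S → rowsp₂-resp L Q (decode-encode w)
          (decidable-stable (rowsp₂? L Q (decode n (encode w)))
             (λ w∉ → none (encode w , ∈-resp S-dec (≋-sym (decode-encode w)) w∈S , w∉)))
  ... | yes (i , v∈S , v∉) with fuel
  ...   | zero = contradiction (LinIndep⇒≤ _ identity (LinIndep₂⇒LinIndep {Y = decode n i VF.∷ Q} (LinIndep₂-∷ ind v∉)) (λ _ → rowsp-identity _))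
                               (λ le → ℕP.<-irrefl P.refl (P.subst₂ _≤_ (ℕP.+-suc m d) (P.sym (P.trans (P.sym (ℕP.+-identityʳ (m ℕ.+ d))) size)) le))
  ...   | suc fuel = extend-basis S-dec fuel L (decode n i VF.∷ Q)
                       (P.trans (P.cong (ℕ._+ fuel) (ℕP.+-suc m d)) (P.trans (P.sym (ℕP.+-suc (m ℕ.+ d) fuel)) size))
                       (LinIndep₂-∷ ind v∉) λ { Fin.zero → v∈S ; (Fin.suc j) → Q⊆S j }

  rows-++ : ∀ {m d n} {S : Subspace n} {X : Matrix m n} {Y : Matrix d n} →
            (∀ i → S (X i)) → (∀ i → S (Y i)) → ∀ i → S ((X ++ Y) i)
  rows-++ {m} X⊆S Y⊆S i with splitAt m i
  ... | inj₁ i′ = X⊆S i′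
  ... | inj₂ i′ = Y⊆S i′

  basis-length : ∀ {x a n} {S : Subspace n} (X : Matrix x n) →
                 LinIndep X → (∀ i → S (X i)) → S ⊆ rowsp X → Dim S a → x ≡ a
  basis-length X ind X⊆S S⊆X (B , B-ind , S⊆B , B⊆S) =
    ℕP.≤-antisym (LinIndep⇒≤ X B ind (λ i → S⊆B _ (X⊆S i)))
                 (LinIndep⇒≤ B X B-ind (λ i → S⊆X _ (B⊆S _ (rowsp-row B i))))

  Dim-≤ : ∀ {x a n} {S : Subspace n} (X : Matrix x n) → S ⊆ rowsp X → Dim S a → a ≤ x
  Dim-≤ X S⊆X (B , B-ind , _ , B⊆S) = LinIndep⇒≤ B X B-ind (λ i → S⊆X _ (B⊆S _ (rowsp-row B i)))

  Dim-exists : ∀ {n} {S : Subspace n} → IsDecSubspace S → ∃ λ a → Dim S a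
  Dim-exists {n} {S} S-dec with extend-basis S-dec n {0} {0} (λ ()) (λ ()) P.refl (λ _ _ _ → (λ ()) , (λ ())) (λ ())
  ... | a , Q , Q⊆S , ind , S⊆Q =
    a , Q , LinIndep₂⇒LinIndepʳ ind ,
    (λ w w∈S → let (_ , e , w≈) = S⊆Q w w∈S in e , λ j → trans (w≈ j) (+-identityˡ _)) ,
    (λ w (c , w≈cQ) → ∈-resp S-dec (≋-sym w≈cQ) (∈-lincomb S-dec Q Q⊆S c))

  Dim-trivial : ∀ {n b} {S : Subspace n} → (∀ w → S w → w ≈ᵥ zeroVec) → Dim S b → b ≡ 0
  Dim-trivial {b = zero}  _      _                     = P.refl
  Dim-trivial {b = suc b} S≈0 (B , B-ind , _ , B⊆S) =
    contradiction (S≈0 _ (B⊆S _ (rowsp-row B Fin.zero))) (LinIndep-row≉0 {A = B} B-ind Fin.zero)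

  Dim-full : ∀ {n a} {S : Subspace n} → (∀ w → S w) → Dim S a → a ≡ n
  Dim-full {n} S-full DS = P.sym (basis-length identity identity-ind (λ _ → S-full _) (λ w _ → rowsp-identity w) DS)
    where
    identity-ind : LinIndep (identity {n})
    identity-ind c c·I≈0 j = trans (sym (·ᵥ-identity c j)) (c·I≈0 j)

  +ₛ-introˡ : ∀ {n} {A B : Subspace n} → IsDecSubspace B → ∀ {u} → A u → (A +ₛ B) u
  +ₛ-introˡ B-dec {u} u∈A = u , zeroVec , u∈A , ∈-zero B-dec , λ _ → sym (+-identityʳ _)

  +ₛ-introʳ : ∀ {n} {A B : Subspace n} → IsDecSubspace A → ∀ {v} → B v → (A +ₛ B) v
  +ₛ-introʳ A-dec {v} v∈B = zeroVec , v , ∈-zero A-dec , v∈B , λ _ → sym (+-identityˡ _)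

  module _ {n} {A B : Subspace n} (A-dec : IsDecSubspace A) (B-dec : IsDecSubspace B) where

    LinIndep₂-across-meet : ∀ {b x r} {C : Matrix b n} {X : Matrix x n} {R : Matrix r n} →
      (A ∩ₛ B) ⊆ rowsp C → (∀ t → A (X t)) → LinIndep X → (∀ t → B (R t)) → LinIndep₂ C R → LinIndep₂ X R
    LinIndep₂-across-meet {C = C} {X} {R} A∩B⊆C X⊆A X-ind R⊆B C,R-ind x e xX+eR≈0 = x≈0 , e≈0
      where
      eR∈B : B (e ·ᵥ R)
      eR∈B = ∈-lincomb B-dec R R⊆B e
      eR∈A : A (e ·ᵥ R)
      eR∈A = ∈-resp A-dec (λ t → trans (-ᵥ-·ᵥ x X t) (sym (inverseˡ-unique _ _ (trans (+-comm _ _) (xX+eR≈0 t)))))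
                          (∈-lincomb A-dec X X⊆A (-ᵥ x))
      c′ = proj₁ (A∩B⊆C _ (eR∈A , eR∈B))
      eR≈c′C = proj₂ (A∩B⊆C _ (eR∈A , eR∈B))
      e≈0 : e ≈ᵥ zeroVec
      e≈0 = proj₂ (C,R-ind (-ᵥ c′) e λ t →
        trans (+-cong (-ᵥ-·ᵥ c′ C t) refl) (trans (+-comm _ _) (trans (+-cong (eR≈c′C t) refl) (-‿inverseʳ _))))
      x≈0 : x ≈ᵥ zeroVec
      x≈0 = X-ind x (λ t → trans (sym (+-identityʳ _)) (trans (+-cong refl (sym (·ᵥ-zeroˡ R e≈0 t))) (xX+eR≈0 t)))

    +ₛ⊆rowsp : ∀ {b p r} {C : Matrix b n} {P′ : Matrix p n} {R : Matrix r n} →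
               A ⊆ rowsp₂ C P′ → B ⊆ rowsp₂ C R → (A +ₛ B) ⊆ rowsp ((C ++ P′) ++ R)
    +ₛ⊆rowsp {C = C} {P′} {R} A⊆CP B⊆CR w (u , v , u∈A , v∈B , w≈u+v)
      with A⊆CP u u∈A | B⊆CR v v∈B
    ... | c₁ , p₁ , u≈ | c₂ , r₂ , v≈ = rowsp₂⇒rowsp ((c₁ +ᵥ c₂) ++ p₁ , r₂ , λ t → begin
      w t                                                           ≈⟨ w≈u+v t ⟩
      u t + v t                                                     ≈⟨ +-cong (u≈ t) (v≈ t) ⟩
      ((c₁ ·ᵥ C) t + (p₁ ·ᵥ P′) t) + ((c₂ ·ᵥ C) t + (r₂ ·ᵥ R) t)    ≈⟨ +-assoc _ _ _ ⟨
      (((c₁ ·ᵥ C) t + (p₁ ·ᵥ P′) t) + (c₂ ·ᵥ C) t) + (r₂ ·ᵥ R) t    ≈⟨ +-cong (xy∙z≈xz∙y _ _ _) refl ⟩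
      (((c₁ ·ᵥ C) t + (c₂ ·ᵥ C) t) + (p₁ ·ᵥ P′) t) + (r₂ ·ᵥ R) t    ≈⟨ +-cong (+-cong (·ᵥ-distribʳ-+ᵥ c₁ c₂ C t) refl) refl ⟨
      (((c₁ +ᵥ c₂) ·ᵥ C) t + (p₁ ·ᵥ P′) t) + (r₂ ·ᵥ R) t            ≈⟨ +-cong (++-·ᵥ-++ (c₁ +ᵥ c₂) p₁ C P′ t) refl ⟨
      (((c₁ +ᵥ c₂) ++ p₁) ·ᵥ (C ++ P′)) t + (r₂ ·ᵥ R) t             ∎)
      where open ≈-Reasoning

  grassmann : ∀ {n i j a b} {A B : Subspace n} → IsDecSubspace A → IsDecSubspace B →
              Dim A i → Dim B j → Dim (A +ₛ B) a → Dim (A ∩ₛ B) b → a ℕ.+ b ≡ i ℕ.+ j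
  grassmann {n} {i} {j} {a} {b} {A} {B} A-dec B-dec DA DB DA+B (C , C-ind , A∩B⊆C , C⊆A∩B)
    with extend-basis A-dec (n ∸ b) C (λ ()) size (LinIndep⇒LinIndep₂ˡ C-ind) (λ ())
       | extend-basis B-dec (n ∸ b) C (λ ()) size (LinIndep⇒LinIndep₂ˡ C-ind) (λ ())
    where
    size : b ℕ.+ 0 ℕ.+ (n ∸ b) ≡ n
    size = P.trans (P.cong (ℕ._+ (n ∸ b)) (ℕP.+-identityʳ b))
                   (ℕP.m+[n∸m]≡n (LinIndep⇒≤ C identity C-ind (λ _ → rowsp-identity _)))
  ... | p , P′ , P′⊆A , C,P′-ind , A⊆CP′ | r , R , R⊆B , C,R-ind , B⊆CR =
    P.trans (P.cong (ℕ._+ b) (P.sym count-A+B)) (P.trans (regroup b p r) (P.cong₂ ℕ._+_ count-A count-B))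
    where
    C⊆A : ∀ t → A (C t)
    C⊆A t = proj₁ (C⊆A∩B _ (rowsp-row C t))
    C⊆B : ∀ t → B (C t)
    C⊆B t = proj₂ (C⊆A∩B _ (rowsp-row C t))
    CP′⊆A : ∀ t → A ((C ++ P′) t)
    CP′⊆A = rows-++ {S = A} C⊆A P′⊆A
    count-A : b ℕ.+ p ≡ i
    count-A = basis-length (C ++ P′) (LinIndep₂⇒LinIndep C,P′-ind) CP′⊆A
                           (λ w w∈A → rowsp₂⇒rowsp (A⊆CP′ w w∈A)) DA
    count-B : b ℕ.+ r ≡ j
    count-B = basis-length (C ++ R) (LinIndep₂⇒LinIndep C,R-ind) (rows-++ {S = B} C⊆B R⊆B)
                           (λ w w∈B → rowsp₂⇒rowsp (B⊆CR w w∈B)) DB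
    count-A+B : b ℕ.+ p ℕ.+ r ≡ a
    count-A+B = basis-length ((C ++ P′) ++ R)
      (LinIndep₂⇒LinIndep (LinIndep₂-across-meet A-dec B-dec A∩B⊆C CP′⊆A
                            (LinIndep₂⇒LinIndep C,P′-ind) R⊆B C,R-ind))
      (rows-++ {S = A +ₛ B} (λ t → +ₛ-introˡ B-dec (CP′⊆A t)) (λ t → +ₛ-introʳ A-dec (R⊆B t)))
      (+ₛ⊆rowsp A-dec B-dec A⊆CP′ B⊆CR) DA+B
    regroup : ∀ b p r → b ℕ.+ p ℕ.+ r ℕ.+ b ≡ (b ℕ.+ p) ℕ.+ (b ℕ.+ r)
    regroup b p r = P.trans (ℕP.+-assoc (b ℕ.+ p) r b) (P.cong ((b ℕ.+ p) ℕ.+_) (ℕP.+-comm r b))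

  square-LinIndep⇒spanning : ∀ {r} (A : Matrix r r) → LinIndep A → ∀ x → rowsp A x
  square-LinIndep⇒spanning A ind x with vector-injective⇒surjective (_·ᵥ A) (LinIndep-injective ind) x
  ... | c , cA≈x = c , ≋-sym cA≈x

  Rank⇒LinIndep : ∀ {r n} (A : Matrix r n) → Rank A r → LinIndep A
  Rank⇒LinIndep {r} A (B , B-ind , A⊆B , B⊆A) c cA≈0 =
    vector-surjective⇒injective (_·ᵥ C) (·ᵥ-congˡ C) ·C-surjective c zeroVec
      (LinIndep-injective B-ind (c ·ᵥ C) (zeroVec ·ᵥ C)
        (≋-trans (≋-sym (·ᵥ-coeffs B rowsA c)) (≋-trans cA≈0 (≋-sym (·ᵥ-zeroˡ B (·ᵥ-zeroˡ C ≋-refl))))))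
    where
    rowsA : ∀ i → rowsp B (A i)
    rowsA i = A⊆B _ (rowsp-row A i)
    rowsB : ∀ i → rowsp A (B i)
    rowsB i = B⊆A _ (rowsp-row B i)
    C = coeffs rowsA
    D = coeffs rowsB
    DC≈I : ∀ i → (D i ·ᵥ C) ≈ᵥ identity i
    DC≈I i = LinIndep-injective B-ind _ _
      (≋-trans (≋-sym (·ᵥ-coeffs B rowsA (D i))) (≋-trans (≋-sym (proj₂ (rowsB i))) (≋-sym (basis-·ᵥ i B))))
    ·C-surjective : ∀ x → ∃ λ z → (z ·ᵥ C) ≈ᵥ x
    ·C-surjective x = x ·ᵥ D , ≋-trans (≋-sym (·ᵥ-·ₘ x D C)) (≋-trans (·ᵥ-cong ≋-refl DC≈I) (·ᵥ-identity x))

  -- Subspace and flag distances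

  +ₛ-≐ : ∀ {n i j} {A B : Subspace n} (bA : Matrix i n) (bB : Matrix j n) →
         A ≐ rowsp bA → B ≐ rowsp bB → (A +ₛ B) ≐ rowsp (bA ++ bB)
  +ₛ-≐ {i = i} bA bB (A⊆ , ⊆A) (B⊆ , ⊆B) =
    (λ w (x , y , x∈A , y∈B , w≈x+y) → let (c , x≈) = A⊆ x x∈A ; (e , y≈) = B⊆ y y∈B in
       c ++ e , λ t → trans (w≈x+y t) (trans (+-cong (x≈ t) (y≈ t)) (sym (++-·ᵥ-++ c e bA bB t)))) ,
    (λ w (c , w≈) → VF.take i c ·ᵥ bA , VF.drop i c ·ᵥ bB , ⊆A _ (VF.take i c , ≋-refl) , ⊆B _ (VF.drop i c , ≋-refl) ,
       ≋-trans w≈ (·ᵥ-++ c bA bB))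

  SubDist-exists : ∀ {n i j} {A B : Subspace n} → Dim A i → Dim B j → ∃ λ D → SubDist A B D
  SubDist-exists {A = A} {B} DA@(bA , _ , A≐) DB@(bB , _ , B≐) =
    proj₁ sum-dim ∸ proj₁ meet-dim , proj₁ sum-dim , proj₁ meet-dim , proj₂ sum-dim , proj₂ meet-dim , P.refl
    where
    sum-dim : ∃ λ a → Dim (A +ₛ B) a
    sum-dim = Dim-exists (≐-isDecSubspace (+ₛ-≐ bA bB A≐ B≐) (rowsp-isDecSubspace (bA ++ bB)))
    meet-dim : ∃ λ b → Dim (A ∩ₛ B) b
    meet-dim = Dim-exists (∩-isDecSubspace (Dim⇒isDecSubspace DA) (Dim⇒isDecSubspace DB))

  module _ {n i} {A B : Subspace n} (DA : Dim A i) (DB : Dim B i) where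

    private
      grassmann′ : ∀ {a b} → Dim (A +ₛ B) a → Dim (A ∩ₛ B) b → a ℕ.+ b ≡ i ℕ.+ i
      grassmann′ = grassmann (Dim⇒isDecSubspace DA) (Dim⇒isDecSubspace DB) DA DB

    SubDist-≤-dim : ∀ {D} → SubDist A B D → D ≤ i ℕ.+ i
    SubDist-≤-dim {D} (a , b , DA+B , DA∩B , D≡a∸b) = begin
      D     ≡⟨ D≡a∸b ⟩
      a ∸ b ≤⟨ ℕP.m∸n≤m a b ⟩
      a     ≤⟨ ℕP.m≤m+n a b ⟩
      a ℕ.+ b ≡⟨ grassmann′ DA+B DA∩B ⟩
      i ℕ.+ i ∎
      where open ℕP.≤-Reasoning

    SubDist-≤-span : ∀ {r D} (W : Matrix r n) → (A +ₛ B) ⊆ rowsp W → SubDist A B D → D ≤ (r ∸ i) ℕ.+ (r ∸ i)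
    SubDist-≤-span W A+B⊆W (a , b , DA+B , DA∩B , D≡a∸b) =
      P.subst (_≤ (_ ∸ i) ℕ.+ (_ ∸ i)) (P.sym (P.trans D≡a∸b (a+b≡i+i⇒a∸b≡[a∸i]+[a∸i] {a} {b} {i} (grassmann′ DA+B DA∩B))))
              (ℕP.+-mono-≤ a∸i≤r∸i a∸i≤r∸i)
      where a∸i≤r∸i = ℕP.∸-monoˡ-≤ i (Dim-≤ W A+B⊆W DA+B)

    SubDist-meet-trivial : ∀ {D} → (∀ w → A w → B w → w ≈ᵥ zeroVec) → SubDist A B D → D ≡ i ℕ.+ i
    SubDist-meet-trivial A∩B≈0 (a , b , DA+B , DA∩B , D≡a∸b) =
      P.trans D≡a∸b (P.trans (P.cong (a ∸_) b≡0)
        (P.trans (P.sym (ℕP.+-identityʳ a)) (P.trans (P.cong (a ℕ.+_) (P.sym b≡0)) (grassmann′ DA+B DA∩B))))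
      where
      b≡0 : b ≡ 0
      b≡0 = Dim-trivial (λ w (x , y) → A∩B≈0 w x y) DA∩B

    SubDist-spanning : ∀ {D} → (∀ w → (A +ₛ B) w) → SubDist A B D → D ≡ (n ∸ i) ℕ.+ (n ∸ i)
    SubDist-spanning A+B-full (a , b , DA+B , DA∩B , D≡a∸b) =
      P.trans D≡a∸b (P.trans (a+b≡i+i⇒a∸b≡[a∸i]+[a∸i] {a} {b} {i} (grassmann′ DA+B DA∩B))
                             (P.cong (λ a → (a ∸ i) ℕ.+ (a ∸ i)) (Dim-full A+B-full DA+B)))

  sum1to-cong : ∀ N {f g : ℕ → ℕ} → (∀ i → 1 ≤ i → i ≤ N → f i ≡ g i) → sum1to N f ≡ sum1to N g
  sum1to-cong zero    f≡g = P.refl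
  sum1to-cong (suc N) f≡g =
    P.cong₂ ℕ._+_ (sum1to-cong N (λ i 1≤i i≤N → f≡g i 1≤i (ℕP.m≤n⇒m≤1+n i≤N))) (f≡g (suc N) (s≤s z≤n) ℕP.≤-refl)

  sum1to-double : ∀ N t → sum1to N (λ i → t i ℕ.+ t i) ≡ 2 ℕ.* sum1to N t
  sum1to-double zero    t = P.refl
  sum1to-double (suc N) t = P.trans (P.cong (ℕ._+ (t (suc N) ℕ.+ t (suc N))) (sum1to-double N t))
                                    (2*s+[x+x]≡2*[s+x] (sum1to N t) (t (suc N)))

  sum1to-mono-≤ : ∀ N {f g : ℕ → ℕ} → (∀ i → 1 ≤ i → i ≤ N → f i ≤ g i) → sum1to N f ≤ sum1to N g
  sum1to-mono-≤ zero    f≤g = z≤n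
  sum1to-mono-≤ (suc N) f≤g =
    ℕP.+-mono-≤ (sum1to-mono-≤ N (λ i 1≤i i≤N → f≤g i 1≤i (ℕP.m≤n⇒m≤1+n i≤N))) (f≤g (suc N) (s≤s z≤n) ℕP.≤-refl)

  sum1to-mono-< : ∀ N {f g : ℕ → ℕ} i₀ → (∀ i → 1 ≤ i → i ≤ N → f i ≤ g i) →
                  1 ≤ i₀ → i₀ ≤ N → f i₀ < g i₀ → sum1to N f < sum1to N g
  sum1to-mono-< zero    i₀ f≤g 1≤i₀ i₀≤0 _ = contradiction (ℕP.≤-trans 1≤i₀ i₀≤0) (λ ())
  sum1to-mono-< (suc N) i₀ f≤g 1≤i₀ i₀≤N fi₀<gi₀ with i₀ ℕ.≟ suc N
  ... | yes P.refl = ℕP.+-mono-≤-< (sum1to-mono-≤ N (λ i 1≤i i≤N → f≤g i 1≤i (ℕP.m≤n⇒m≤1+n i≤N))) fi₀<gi₀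
  ... | no  i₀≢N   = ℕP.+-mono-<-≤ (sum1to-mono-< N i₀ (λ i 1≤i i≤N → f≤g i 1≤i (ℕP.m≤n⇒m≤1+n i≤N)) 1≤i₀
                                      (ℕP.≤-pred (ℕP.≤∧≢⇒< i₀≤N i₀≢N)) fi₀<gi₀)
                                   (f≤g (suc N) (s≤s z≤n) ℕP.≤-refl)

  module _ {n : ℕ} where

    FullFlag-⊆ : ∀ {X : Flag n} → FullFlag X → ∀ {i j} → 1 ≤ i → i ≤ j → j < n → X i ⊆ X j
    FullFlag-⊆ FX {j = zero}  1≤i i≤0 _ = contradiction (ℕP.≤-trans 1≤i i≤0) (λ ())
    FullFlag-⊆ FX {i} {suc j} 1≤i i≤j+1 j+1<n with i ℕ.≟ suc j
    ... | yes P.refl = λ _ x → x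
    ... | no  i≢j+1  = λ w x → proj₁ (proj₂ FX j (ℕP.≤-trans 1≤i i≤j) j+1<n) w
                                 (FullFlag-⊆ FX 1≤i i≤j (ℕP.<-trans (ℕP.n<1+n j) j+1<n) w x)
      where
      i≤j : i ≤ j
      i≤j = ℕP.≤-pred (ℕP.≤∧≢⇒< i≤j+1 i≢j+1)

    ≐f-refl : ∀ {X : Flag n} → X ≐f X
    ≐f-refl i _ _ = (λ _ x → x) , (λ _ x → x)

    ≐f-sym : ∀ {X Y : Flag n} → X ≐f Y → Y ≐f X
    ≐f-sym X≐Y i 1≤i i<n = proj₂ (X≐Y i 1≤i i<n) , proj₁ (X≐Y i 1≤i i<n)

    ≐f-trans : ∀ {X Y Z : Flag n} → X ≐f Y → Y ≐f Z → X ≐f Z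
    ≐f-trans X≐Y Y≐Z i 1≤i i<n =
      (λ w x → proj₁ (Y≐Z i 1≤i i<n) w (proj₁ (X≐Y i 1≤i i<n) w x)) ,
      (λ w z → proj₂ (X≐Y i 1≤i i<n) w (proj₂ (Y≐Z i 1≤i i<n) w z))

    FullFlag-≐f : ∀ {X Y : Flag n} → FullFlag X → X ≐f Y → FullFlag Y
    FullFlag-≐f {X} {Y} (dims , steps) X≐Y = (λ i 1≤i i<n → Dim-≐ (X≐Y i 1≤i i<n) (dims i 1≤i i<n)) , step
      where
      step : ∀ i → 1 ≤ i → suc i < n → Y i ⊆ Y (suc i) × ¬ (Y (suc i) ⊆ Y i)
      step i 1≤i i+1<n with X≐Y i 1≤i (ℕP.<-trans (ℕP.n<1+n i) i+1<n) | X≐Y (suc i) (ℕP.m≤n⇒m≤1+n 1≤i) i+1<n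
      ... | _ , Yᵢ⊆Xᵢ | Xᵢ₊₁⊆Yᵢ₊₁ , _ =
        (λ w y → Xᵢ₊₁⊆Yᵢ₊₁ w (proj₁ (steps i 1≤i i+1<n) w (Yᵢ⊆Xᵢ w y))) ,
        (λ Yᵢ₊₁⊆Yᵢ → proj₂ (steps i 1≤i i+1<n) (λ w x → Yᵢ⊆Xᵢ w (Yᵢ₊₁⊆Yᵢ w (Xᵢ₊₁⊆Yᵢ₊₁ w x))))

    FlagDist-exists : ∀ {X Y : Flag n} → FullFlag X → FullFlag Y → ∃ λ d → FlagDist X Y d
    FlagDist-exists {X} {Y} FX FY = sum1to (n ∸ 1) ds , ds , ds-correct , P.refl
      where
      level : ∀ {i} → Dec (1 ≤ i) → Dec (i < n) → ℕ
      level (yes 1≤i) (yes i<n) = proj₁ (SubDist-exists (proj₁ FX _ 1≤i i<n) (proj₁ FY _ 1≤i i<n))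
      level _         _         = 0
      ds : ℕ → ℕ
      ds i = level (1 ℕ.≤? i) (i ℕ.<? n)
      ds-correct : ∀ i → 1 ≤ i → i < n → SubDist (X i) (Y i) (ds i)
      ds-correct i 1≤i i<n with 1 ℕ.≤? i | i ℕ.<? n
      ... | yes 1≤i′ | yes i<n′ = proj₂ (SubDist-exists (proj₁ FX _ 1≤i′ i<n′) (proj₁ FY _ 1≤i′ i<n′))
      ... | no  1≰i  | _        = contradiction 1≤i 1≰i
      ... | yes _    | no  i≮n  = contradiction i<n i≮n

    SubDist-≤-halfMax : ∀ {i D} {A B : Subspace n} → Dim A i → Dim B i → SubDist A B D →
                        D ≤ halfMax n i ℕ.+ halfMax n i
    SubDist-≤-halfMax {i} {D} DA DB dist with 2 ℕ.* i ℕ.≤? n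
    ... | yes 2i≤n = P.subst (λ h → D ≤ h ℕ.+ h) (P.sym (halfMax-low {n} {i} 2i≤n)) (SubDist-≤-dim DA DB dist)
    ... | no  2i≰n = P.subst (λ h → D ≤ h ℕ.+ h) (P.sym (halfMax-high {n} {i} (ℕP.≰⇒> 2i≰n)))
                             (SubDist-≤-span DA DB identity (λ w _ → rowsp-identity w) dist)

    FlagDist-≡-maxDist : ∀ {X Y : Flag n} {d} →
      (∀ i → 1 ≤ i → i < n → ∀ D → SubDist (X i) (Y i) D → D ≡ halfMax n i ℕ.+ halfMax n i) →
      FlagDist X Y d → d ≡ maxDist n
    FlagDist-≡-maxDist levels (ds , ds-correct , d≡Σds) =
      P.trans d≡Σds (P.trans (sum1to-cong (n ∸ 1) (λ i 1≤i i≤n∸1 → levels i 1≤i (≤∸1⇒< 1≤i i≤n∸1) (ds i) (ds-correct i 1≤i (≤∸1⇒< 1≤i i≤n∸1))))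
                             (sum1to-double (n ∸ 1) (halfMax n)))

    FlagDist-<-maxDist : ∀ {X Y : Flag n} {d} → FullFlag X → FullFlag Y → ∀ i₀ → 1 ≤ i₀ → i₀ < n →
      (∀ D → SubDist (X i₀) (Y i₀) D → D < halfMax n i₀ ℕ.+ halfMax n i₀) →
      FlagDist X Y d → d < maxDist n
    FlagDist-<-maxDist FX FY i₀ 1≤i₀ i₀<n level-i₀ (ds , ds-correct , d≡Σds) =
      P.subst₂ _<_ (P.sym d≡Σds) (sum1to-double (n ∸ 1) (halfMax n))
        (sum1to-mono-< (n ∸ 1) i₀ bounded 1≤i₀ (<⇒≤∸1 i₀<n) (level-i₀ (ds i₀) (ds-correct i₀ 1≤i₀ i₀<n)))
      where
      bounded : ∀ i → 1 ≤ i → i ≤ n ∸ 1 → ds i ≤ halfMax n i ℕ.+ halfMax n i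
      bounded i 1≤i i≤n∸1 = let i<n = ≤∸1⇒< 1≤i i≤n∸1 in
        SubDist-≤-halfMax (proj₁ FX i 1≤i i<n) (proj₁ FY i 1≤i i<n) (ds-correct i 1≤i i<n)

    maxDist-positive : 2 ≤ n → 0 < maxDist n
    maxDist-positive 2≤n = ℕP.<-≤-trans (ℕP.≤-<-trans z≤n
      (sum1to-mono-< (n ∸ 1) {f = λ _ → 0} 1 (λ _ _ _ → z≤n) ℕP.≤-refl (<⇒≤∸1 2≤n)
                     (P.subst (0 <_) (P.sym (halfMax-low {n} {1} 2≤n)) (s≤s z≤n))))
      (ℕP.m≤m+n (sum1to (n ∸ 1) (halfMax n)) _)

  module _ {n} (G : Matrix n n) (G-injective : ∀ v v′ → (v ·ᵥ G) ≈ᵥ (v′ ·ᵥ G) → v ≈ᵥ v′) where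

    ·ₛ-Dim : ∀ {S : Subspace n} {d} → Dim S d → Dim (S ·ₛ G) d
    ·ₛ-Dim {S} (B , B-ind , S⊆B , B⊆S) = B ·ₘ G , BG-ind , SG⊆BG , BG⊆SG
      where
      BG-ind : LinIndep (B ·ₘ G)
      BG-ind c cBG≈0 = B-ind c (G-injective _ _ (≋-trans (≋-sym (·ᵥ-·ₘ c B G)) (≋-trans cBG≈0 (≋-sym (·ᵥ-zeroˡ G ≋-refl)))))
      SG⊆BG : (S ·ₛ G) ⊆ rowsp (B ·ₘ G)
      SG⊆BG w (v , v∈S , w≈vG) = let (c , v≈cB) = S⊆B v v∈S in
        c , ≋-trans w≈vG (≋-trans (·ᵥ-congˡ G v≈cB) (≋-sym (·ᵥ-·ₘ c B G)))
      BG⊆SG : rowsp (B ·ₘ G) ⊆ (S ·ₛ G)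
      BG⊆SG w (c , w≈cBG) = c ·ᵥ B , B⊆S _ (c , ≋-refl) , ≋-trans w≈cBG (·ᵥ-·ₘ c B G)

    ·f-FullFlag : ∀ {X : Flag n} → FullFlag X → FullFlag (X ·f G)
    ·f-FullFlag {X} (dims , steps) = (λ i 1≤i i<n → ·ₛ-Dim (dims i 1≤i i<n)) , λ i 1≤i i+1<n →
      (λ w (v , v∈Xᵢ , w≈vG) → v , proj₁ (steps i 1≤i i+1<n) v v∈Xᵢ , w≈vG) ,
      (λ Xᵢ₊₁G⊆XᵢG → proj₂ (steps i 1≤i i+1<n) λ v v∈Xᵢ₊₁ → preimage i 1≤i i+1<n (Xᵢ₊₁G⊆XᵢG _ (v , v∈Xᵢ₊₁ , ≋-refl)))
      where
      preimage : ∀ i → 1 ≤ i → suc i < n → ∀ {v} → (X i ·ₛ G) (v ·ᵥ G) → X i v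
      preimage i 1≤i i+1<n (v′ , v′∈Xᵢ , vG≈v′G) =
        ∈-resp (Dim⇒isDecSubspace (dims i 1≤i (ℕP.<-trans (ℕP.n<1+n i) i+1<n))) (G-injective _ _ (≋-sym vG≈v′G)) v′∈Xᵢ

  module _ {k : ℕ} where

    private
      n = k ℕ.+ suc k

      n≡1+2k : n ≡ suc (k ℕ.+ k)
      n≡1+2k = ℕP.+-suc k k

      halfMax-≤k : ∀ {i} → i ≤ k → halfMax n i ≡ i
      halfMax-≤k {i} i≤k = halfMax-low {n} {i} (P.subst (2 ℕ.* i ≤_) (P.sym n≡1+2k)
        (ℕP.m≤n⇒m≤1+n (P.subst (_≤ k ℕ.+ k) (P.cong (i ℕ.+_) (P.sym (ℕP.+-identityʳ i))) (ℕP.+-mono-≤ i≤k i≤k))))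

      halfMax->k : ∀ {i} → k < i → halfMax n i ≡ n ∸ i
      halfMax->k {i} k<i = halfMax-high {n} {i} (P.subst (_< 2 ℕ.* i) (P.sym n≡1+2k)
        (P.subst (suc (k ℕ.+ k) <_) (P.cong (i ℕ.+_) (P.sym (ℕP.+-identityʳ i)))
          (P.subst (_≤ i ℕ.+ i) (P.cong suc (ℕP.+-suc k k)) (ℕP.+-mono-≤ k<i k<i))))

    k<k+[1+k] : k < k ℕ.+ suc k
    k<k+[1+k] = ℕP.≤-trans (ℕP.n<1+n k) (ℕP.m≤n+m (suc k) k)

    1+k<k+[1+k] : 1 ≤ k → suc k < k ℕ.+ suc k
    1+k<k+[1+k] 1≤k = P.subst (suc k <_) (P.sym (ℕP.+-suc k k)) (s≤s (ℕP.+-monoˡ-≤ k 1≤k))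

    -- levels i ≤ k lie inside the k-th subspaces, levels i > k contain the (k+1)-th ones
    FlagDist-≡-maxDist-odd : ∀ {X Y : Flag n} {d} → FullFlag X → FullFlag Y →
      (∀ w → X k w → Y k w → w ≈ᵥ zeroVec) → (∀ w → (X (suc k) +ₛ Y (suc k)) w) →
      FlagDist X Y d → d ≡ maxDist n
    FlagDist-≡-maxDist-odd {X} {Y} FX FY meet span = FlagDist-≡-maxDist level
      where
      level : ∀ i → 1 ≤ i → i < n → ∀ D → SubDist (X i) (Y i) D → D ≡ halfMax n i ℕ.+ halfMax n i
      level i 1≤i i<n D dist with i ℕ.≤? k
      ... | yes i≤k = P.trans (SubDist-meet-trivial (proj₁ FX i 1≤i i<n) (proj₁ FY i 1≤i i<n)
                                (λ w x y → meet w (FullFlag-⊆ FX 1≤i i≤k k<k+[1+k] w x) (FullFlag-⊆ FY 1≤i i≤k k<k+[1+k] w y)) dist)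
                              (P.sym (P.cong₂ ℕ._+_ (halfMax-≤k i≤k) (halfMax-≤k i≤k)))
      ... | no  i≰k = P.trans (SubDist-spanning (proj₁ FX i 1≤i i<n) (proj₁ FY i 1≤i i<n)
                                (λ w → let (x , y , x∈ , y∈ , w≈) = span w in
                                  x , y , FullFlag-⊆ FX (s≤s z≤n) k<i i<n x x∈ , FullFlag-⊆ FY (s≤s z≤n) k<i i<n y y∈ , w≈) dist)
                              (P.sym (P.cong₂ ℕ._+_ (halfMax->k k<i) (halfMax->k k<i)))
        where k<i = ℕP.≰⇒> i≰k

    -- every level is bounded by its maximum, and level k+1 falls short since dim (X (k+1) + Y (k+1)) ≤ 2k
    FlagDist-<-maxDist-odd : ∀ {X Y : Flag n} {d} → 1 ≤ k → FullFlag X → FullFlag Y →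
      (W : Matrix (k ℕ.+ k) n) → (X (suc k) +ₛ Y (suc k)) ⊆ rowsp W →
      FlagDist X Y d → d < maxDist n
    FlagDist-<-maxDist-odd {X} {Y} 1≤k FX FY W X+Y⊆W = FlagDist-<-maxDist FX FY (suc k) (s≤s z≤n) k+1<n short
      where
      k+1<n = 1+k<k+[1+k] 1≤k
      short : ∀ D → SubDist (X (suc k)) (Y (suc k)) D → D < halfMax n (suc k) ℕ.+ halfMax n (suc k)
      short D dist = begin-strict
        D                                    ≤⟨ SubDist-≤-span (proj₁ FX (suc k) (s≤s z≤n) k+1<n) (proj₁ FY (suc k) (s≤s z≤n) k+1<n) W X+Y⊆W dist ⟩
        (k ℕ.+ k ∸ suc k) ℕ.+ (k ℕ.+ k ∸ suc k) <⟨ ℕP.+-mono-< ([k+k]∸[1+k]<k 1≤k) ([k+k]∸[1+k]<k 1≤k) ⟩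
        k ℕ.+ k                              ≡⟨ P.cong₂ ℕ._+_ half≡k half≡k ⟨
        halfMax n (suc k) ℕ.+ halfMax n (suc k) ∎
        where
        open ℕP.≤-Reasoning
        half≡k : halfMax n (suc k) ≡ k
        half≡k = P.trans (halfMax->k (ℕP.n<1+n k)) (ℕP.m+n∸n≡m k (suc k))

  -- Companion matrices of primitive polynomials

  infixl 28 _·[_]^_

  _·[_]^_ : ∀ {n} → Vector n → Matrix n n → ℕ → Vector n
  x ·[ A ]^ zero  = x
  x ·[ A ]^ suc j = (x ·ᵥ A) ·[ A ]^ j

  module _ {n} (A : Matrix n n) where

    ·^-cong : ∀ {x y} j → x ≈ᵥ y → x ·[ A ]^ j ≈ᵥ y ·[ A ]^ j
    ·^-cong zero    x≈y = x≈y
    ·^-cong (suc j) x≈y = ·^-cong j (·ᵥ-congˡ A x≈y)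

    ·^-+ : ∀ x a b → x ·[ A ]^ (a ℕ.+ b) ≡ (x ·[ A ]^ a) ·[ A ]^ b
    ·^-+ x zero    b = P.refl
    ·^-+ x (suc a) b = ·^-+ (x ·ᵥ A) a b

    ·^-+-≈ : ∀ x a b → x ·[ A ]^ (a ℕ.+ b) ≈ᵥ (x ·[ A ]^ a) ·[ A ]^ b
    ·^-+-≈ x a b = ≋-reflexive (·^-+ x a b)

    ·^-comm : ∀ x a b → (x ·[ A ]^ a) ·[ A ]^ b ≈ᵥ (x ·[ A ]^ b) ·[ A ]^ a
    ·^-comm x a b = ≋-reflexive (P.trans (P.sym (·^-+ x a b)) (P.trans (P.cong (x ·[ A ]^_) (ℕP.+-comm a b)) (·^-+ x b a)))

    ·^-suc : ∀ x j → x ·[ A ]^ suc j ≈ᵥ ((x ·[ A ]^ j) ·ᵥ A)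
    ·^-suc x zero    = ≋-refl
    ·^-suc x (suc j) = ·^-suc (x ·ᵥ A) j

    ·^-+ᵥ : ∀ x y j → (x +ᵥ y) ·[ A ]^ j ≈ᵥ (x ·[ A ]^ j) +ᵥ (y ·[ A ]^ j)
    ·^-+ᵥ x y zero    = ≋-refl
    ·^-+ᵥ x y (suc j) = ≋-trans (·^-cong j (·ᵥ-distribʳ-+ᵥ x y A)) (·^-+ᵥ (x ·ᵥ A) (y ·ᵥ A) j)

    ·^-*ᵥ : ∀ a x j → (a *ᵥ x) ·[ A ]^ j ≈ᵥ a *ᵥ (x ·[ A ]^ j)
    ·^-*ᵥ a x zero    = ≋-refl
    ·^-*ᵥ a x (suc j) = ≋-trans (·^-cong j (*ᵥ-·ᵥ a x A)) (·^-*ᵥ a (x ·ᵥ A) j)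

    ·^-negᵥ : ∀ x j → (-ᵥ x) ·[ A ]^ j ≈ᵥ -ᵥ (x ·[ A ]^ j)
    ·^-negᵥ x zero    = ≋-refl
    ·^-negᵥ x (suc j) = ≋-trans (·^-cong j (-ᵥ-·ᵥ x A)) (·^-negᵥ (x ·ᵥ A) j)

    ·^-zeroVec : ∀ j → zeroVec ·[ A ]^ j ≈ᵥ zeroVec
    ·^-zeroVec zero    = ≋-refl
    ·^-zeroVec (suc j) = ≋-trans (·^-cong j (·ᵥ-zeroˡ A ≋-refl)) (·^-zeroVec j)

    ·^-lincomb : ∀ {m} (c : Vector m) (B : Matrix m n) j → (c ·ᵥ B) ·[ A ]^ j ≈ᵥ (c ·ᵥ (λ i → B i ·[ A ]^ j))
    ·^-lincomb c B zero    = ≋-refl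
    ·^-lincomb c B (suc j) = ≋-trans (·^-cong j (≋-sym (·ᵥ-·ₘ c B A))) (·^-lincomb c (B ·ₘ A) j)

    ·^-shift-difference : ∀ u z i d → (u +ᵥ z) ·[ A ]^ i +ᵥ (-ᵥ z) ·[ A ]^ (i ℕ.+ d) ≈ᵥ u ·[ A ]^ i +ᵥ (z -ᵥ z ·[ A ]^ d) ·[ A ]^ i
    ·^-shift-difference u z i d j = begin
      ((u +ᵥ z) ·[ A ]^ i) j + ((-ᵥ z) ·[ A ]^ (i ℕ.+ d)) j
        ≈⟨ +-cong (·^-+ᵥ u z i j) (trans (·^-negᵥ z (i ℕ.+ d) j) (-‿cong (≋-trans (·^-+-≈ z i d) (·^-comm z i d) j))) ⟩
      ((u ·[ A ]^ i) j + (z ·[ A ]^ i) j) + - ((z ·[ A ]^ d) ·[ A ]^ i) j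
        ≈⟨ +-assoc _ _ _ ⟩
      (u ·[ A ]^ i) j + ((z ·[ A ]^ i) j + - ((z ·[ A ]^ d) ·[ A ]^ i) j)
        ≈⟨ +-cong refl (trans (·^-+ᵥ z (-ᵥ (z ·[ A ]^ d)) i j) (+-cong refl (·^-negᵥ (z ·[ A ]^ d) i j))) ⟨
      (u ·[ A ]^ i) j + ((z -ᵥ z ·[ A ]^ d) ·[ A ]^ i) j ∎
      where open ≈-Reasoning

    ·ᵥ-^ₘ : ∀ x j → (x ·ᵥ (A ^ₘ j)) ≈ᵥ x ·[ A ]^ j
    ·ᵥ-^ₘ x zero    = ·ᵥ-identity x
    ·ᵥ-^ₘ x (suc j) = ≋-trans (·ᵥ-·ₘ x A (A ^ₘ j)) (·ᵥ-^ₘ (x ·ᵥ A) j)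

  blockDiag-identity-·^ : ∀ {m n} (B : Matrix n n) (u : Vector m) (w : Vector n) j →
                          (u ++ w) ·[ blockDiag identity B ]^ j ≈ᵥ (u ++ w ·[ B ]^ j)
  blockDiag-identity-·^ B u w zero    = ≋-refl
  blockDiag-identity-·^ B u w (suc j) =
    ≋-trans (·^-cong _ j (≋-trans (blockDiag-·ᵥ identity B u w) (++⁺ _≈_ (·ᵥ-identity u) ≋-refl)))
            (blockDiag-identity-·^ B u (w ·ᵥ B) j)

  coeff-+ₚ : ∀ f g i → coeff (f +ₚ g) i ≈ coeff f i + coeff g i
  coeff-+ₚ []      g       i       = sym (+-identityˡ _)
  coeff-+ₚ (a ∷ f) []      i       = sym (+-identityʳ _)
  coeff-+ₚ (a ∷ f) (b ∷ g) zero    = refl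
  coeff-+ₚ (a ∷ f) (b ∷ g) (suc i) = coeff-+ₚ f g i

  coeff-*ₚ-[] : ∀ f i → coeff (f *ₚ []) i ≈ 0#
  coeff-*ₚ-[] []      i       = refl
  coeff-*ₚ-[] (a ∷ f) zero    = refl
  coeff-*ₚ-[] (a ∷ f) (suc i) = coeff-*ₚ-[] f i

  coeff-*ₚ-∷ : ∀ f c h i → coeff (f *ₚ (c ∷ h)) i ≈ c * coeff f i + coeff (0# ∷ (f *ₚ h)) i
  coeff-*ₚ-∷ []      c h zero    = sym (trans (+-cong (zeroʳ c) refl) (+-identityˡ _))
  coeff-*ₚ-∷ []      c h (suc i) = sym (trans (+-cong (zeroʳ c) refl) (+-identityˡ _))
  coeff-*ₚ-∷ (b ∷ f) c h zero    = +-cong (*-comm b c) refl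
  coeff-*ₚ-∷ (b ∷ f) c h (suc i) = begin
    coeff (List.map (b *_) h +ₚ (f *ₚ (c ∷ h))) i                          ≈⟨ coeff-+ₚ (List.map (b *_) h) _ i ⟩
    coeff (List.map (b *_) h) i + coeff (f *ₚ (c ∷ h)) i                   ≈⟨ +-cong refl (coeff-*ₚ-∷ f c h i) ⟩
    coeff (List.map (b *_) h) i + (c * coeff f i + coeff (0# ∷ (f *ₚ h)) i) ≈⟨ x∙yz≈y∙xz _ _ _ ⟩
    c * coeff f i + (coeff (List.map (b *_) h) i + coeff (0# ∷ (f *ₚ h)) i) ≈⟨ +-cong refl (coeff-+ₚ (List.map (b *_) h) _ i) ⟨
    c * coeff f i + coeff (List.map (b *_) h +ₚ (0# ∷ (f *ₚ h))) i        ∎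
    where open ≈-Reasoning

  coeff-tabulate : ∀ {n} (v : Vector n) (l : Fin n) → coeff (List.tabulate v) (toℕ l) ≡ v l
  coeff-tabulate v Fin.zero    = P.refl
  coeff-tabulate v (Fin.suc l) = coeff-tabulate (VF.tail v) l

  coeff-tabulate-≥ : ∀ {n} (v : Vector n) i → n ≤ i → coeff (List.tabulate v) i ≡ 0#
  coeff-tabulate-≥ {zero}  v i       _         = P.refl
  coeff-tabulate-≥ {suc n} v (suc i) (s≤s n≤i) = coeff-tabulate-≥ (VF.tail v) i n≤i

  coeff-tabulate-cong : ∀ {n} {v w : Vector n} → v ≈ᵥ w → ∀ i → coeff (List.tabulate v) i ≈ coeff (List.tabulate w) i
  coeff-tabulate-cong {zero}  v≈w i       = refl
  coeff-tabulate-cong {suc n} v≈w zero    = v≈w Fin.zero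
  coeff-tabulate-cong {suc n} v≈w (suc i) = coeff-tabulate-cong (λ j → v≈w (Fin.suc j)) i

  coeff-tabulate-≈0 : ∀ {n} {v : Vector n} → v ≈ᵥ zeroVec → ∀ i → coeff (List.tabulate v) i ≈ 0#
  coeff-tabulate-≈0 {zero}  v≈0 i       = refl
  coeff-tabulate-≈0 {suc n} v≈0 zero    = v≈0 Fin.zero
  coeff-tabulate-≈0 {suc n} v≈0 (suc i) = coeff-tabulate-≈0 (λ j → v≈0 (Fin.suc j)) i

  coeff-++ˡ : ∀ (f g : Poly) i → i < List.length f → coeff (f List.++ g) i ≡ coeff f i
  coeff-++ˡ (a ∷ f) g zero    _         = P.refl
  coeff-++ˡ (a ∷ f) g (suc i) (s≤s i<f) = coeff-++ˡ f g i i<f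

  coeff-++ʳ : ∀ (f g : Poly) i → coeff (f List.++ g) (List.length f ℕ.+ i) ≡ coeff g i
  coeff-++ʳ []      g i = P.refl
  coeff-++ʳ (a ∷ f) g i = coeff-++ʳ f g i

  xPow : ℕ → Poly
  xPow e = List.replicate e 0# List.++ (1# ∷ [])

  module PolyAction {n} (A : Matrix n n) where

    infixl 28 _⋆_

    -- x ⋆ f is the row vector x · f(A), evaluated by Horner's rule
    _⋆_ : Vector n → Poly → Vector n
    x ⋆ []      = zeroVec
    x ⋆ (c ∷ f) = c *ᵥ x +ᵥ (x ·ᵥ A) ⋆ f

    ⋆-cong : ∀ {x y} f → x ≈ᵥ y → x ⋆ f ≈ᵥ y ⋆ f
    ⋆-cong []      x≈y = ≋-refl
    ⋆-cong (c ∷ f) x≈y j = +-cong (*-cong refl (x≈y j)) (⋆-cong f (·ᵥ-congˡ A x≈y) j)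

    ⋆-+ᵥ : ∀ x y f → (x +ᵥ y) ⋆ f ≈ᵥ x ⋆ f +ᵥ y ⋆ f
    ⋆-+ᵥ x y []      j = sym (+-identityʳ _)
    ⋆-+ᵥ x y (c ∷ f) j = trans (+-cong (distribˡ c (x j) (y j))
                                       (trans (⋆-cong f (·ᵥ-distribʳ-+ᵥ x y A) j) (⋆-+ᵥ (x ·ᵥ A) (y ·ᵥ A) f j)))
                               (interchange _ _ _ _)

    ⋆-*ᵥ : ∀ a x f → (a *ᵥ x) ⋆ f ≈ᵥ a *ᵥ (x ⋆ f)
    ⋆-*ᵥ a x []      j = sym (zeroʳ a)
    ⋆-*ᵥ a x (c ∷ f) j = trans (+-cong (x*yz≈y*xz c a (x j)) (trans (⋆-cong f (*ᵥ-·ᵥ a x A) j) (⋆-*ᵥ a (x ·ᵥ A) f j)))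
                               (sym (distribˡ a _ _))

    ⋆-zeroVec : ∀ f → zeroVec ⋆ f ≈ᵥ zeroVec
    ⋆-zeroVec []      = ≋-refl
    ⋆-zeroVec (c ∷ f) j = trans (+-cong (zeroʳ c) (trans (⋆-cong f (·ᵥ-zeroˡ A ≋-refl) j) (⋆-zeroVec f j))) (+-identityʳ _)

    ⋆-·ᵥ : ∀ x f → (x ·ᵥ A) ⋆ f ≈ᵥ ((x ⋆ f) ·ᵥ A)
    ⋆-·ᵥ x []      = ≋-sym (·ᵥ-zeroˡ A ≋-refl)
    ⋆-·ᵥ x (c ∷ f) j = trans (+-cong (sym (*ᵥ-·ᵥ c x A j)) (⋆-·ᵥ (x ·ᵥ A) f j)) (sym (·ᵥ-distribʳ-+ᵥ (c *ᵥ x) ((x ·ᵥ A) ⋆ f) A j))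

    ⋆-+ₚ : ∀ x f g → x ⋆ (f +ₚ g) ≈ᵥ x ⋆ f +ᵥ x ⋆ g
    ⋆-+ₚ x []      g       j = sym (+-identityˡ _)
    ⋆-+ₚ x (a ∷ f) []      j = sym (+-identityʳ _)
    ⋆-+ₚ x (a ∷ f) (b ∷ g) j = trans (+-cong (distribʳ (x j) a b) (⋆-+ₚ (x ·ᵥ A) f g j)) (interchange _ _ _ _)

    ⋆-map-* : ∀ x c f → x ⋆ List.map (c *_) f ≈ᵥ c *ᵥ (x ⋆ f)
    ⋆-map-* x c []      j = sym (zeroʳ c)
    ⋆-map-* x c (a ∷ f) j = trans (+-cong (*-assoc c a (x j)) (⋆-map-* (x ·ᵥ A) c f j)) (sym (distribˡ c _ _))

    ⋆-*ₚ : ∀ x f g → x ⋆ (f *ₚ g) ≈ᵥ (x ⋆ f) ⋆ g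
    ⋆-*ₚ x []      g = ≋-sym (⋆-zeroVec g)
    ⋆-*ₚ x (a ∷ f) g j = begin
      (x ⋆ (List.map (a *_) g +ₚ (0# ∷ (f *ₚ g)))) j              ≈⟨ ⋆-+ₚ x (List.map (a *_) g) (0# ∷ (f *ₚ g)) j ⟩
      (x ⋆ List.map (a *_) g) j + (0# * x j + ((x ·ᵥ A) ⋆ (f *ₚ g)) j)
        ≈⟨ +-cong (⋆-map-* x a g j) (trans (+-cong (zeroˡ _) refl) (trans (+-identityˡ _) (⋆-*ₚ (x ·ᵥ A) f g j))) ⟩
      a * (x ⋆ g) j + (((x ·ᵥ A) ⋆ f) ⋆ g) j                       ≈⟨ +-cong (sym (⋆-*ᵥ a x g j)) refl ⟩
      ((a *ᵥ x) ⋆ g) j + (((x ·ᵥ A) ⋆ f) ⋆ g) j                    ≈⟨ ⋆-+ᵥ (a *ᵥ x) ((x ·ᵥ A) ⋆ f) g j ⟨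
      ((a *ᵥ x +ᵥ (x ·ᵥ A) ⋆ f) ⋆ g) j                             ∎
      where open ≈-Reasoning

    ⋆-comm : ∀ x f g → (x ⋆ f) ⋆ g ≈ᵥ (x ⋆ g) ⋆ f
    ⋆-comm x []      g = ⋆-zeroVec g
    ⋆-comm x (a ∷ f) g j = begin
      ((a *ᵥ x +ᵥ (x ·ᵥ A) ⋆ f) ⋆ g) j           ≈⟨ ⋆-+ᵥ (a *ᵥ x) ((x ·ᵥ A) ⋆ f) g j ⟩
      ((a *ᵥ x) ⋆ g) j + (((x ·ᵥ A) ⋆ f) ⋆ g) j  ≈⟨ +-cong (⋆-*ᵥ a x g j) (⋆-comm (x ·ᵥ A) f g j) ⟩
      a * (x ⋆ g) j + (((x ·ᵥ A) ⋆ g) ⋆ f) j     ≈⟨ +-cong refl (⋆-cong f (⋆-·ᵥ x g) j) ⟩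
      a * (x ⋆ g) j + (((x ⋆ g) ·ᵥ A) ⋆ f) j     ∎
      where open ≈-Reasoning

    ⋆-≈0 : ∀ x f → (∀ i → coeff f i ≈ 0#) → x ⋆ f ≈ᵥ zeroVec
    ⋆-≈0 x []      f≈0 = ≋-refl
    ⋆-≈0 x (a ∷ f) f≈0 j =
      trans (+-cong (trans (*-cong (f≈0 zero) refl) (zeroˡ _)) (⋆-≈0 (x ·ᵥ A) f (λ i → f≈0 (suc i)) j)) (+-identityʳ _)

    ⋆-≈ₚ : ∀ x f g → f ≈ₚ g → x ⋆ f ≈ᵥ x ⋆ g
    ⋆-≈ₚ x []      g       f≈g = ≋-sym (⋆-≈0 x g (λ i → sym (f≈g i)))
    ⋆-≈ₚ x (a ∷ f) []      f≈g = ⋆-≈0 x (a ∷ f) f≈g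
    ⋆-≈ₚ x (a ∷ f) (b ∷ g) f≈g j = +-cong (*-cong (f≈g zero) refl) (⋆-≈ₚ (x ·ᵥ A) f g (λ i → f≈g (suc i)) j)

    ⋆-xPow : ∀ x e → x ⋆ xPow e ≈ᵥ x ·[ A ]^ e
    ⋆-xPow x zero    j = trans (+-cong (*-identityˡ _) refl) (+-identityʳ _)
    ⋆-xPow x (suc e) j = trans (+-cong (zeroˡ _) refl) (trans (+-identityˡ _) (⋆-xPow (x ·ᵥ A) e j))

    ⋆-xPowMinus1 : ∀ x e → x ⋆ xPowMinus1 (suc e) ≈ᵥ x ·[ A ]^ suc e -ᵥ x
    ⋆-xPowMinus1 x e j =
      trans (+-cong (trans (sym (-‿distribˡ-* 1# (x j))) (-‿cong (*-identityˡ _))) (⋆-xPow (x ·ᵥ A) e j)) (+-comm _ _)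

    ⋆-tabulate : ∀ {m} x (c : Vector m) → x ⋆ List.tabulate c ≈ᵥ (c ·ᵥ (λ i → x ·[ A ]^ toℕ i))
    ⋆-tabulate {zero}  x c j = refl
    ⋆-tabulate {suc m} x c j = +-cong refl (⋆-tabulate (x ·ᵥ A) (VF.tail c) j)

    ⋆-++ : ∀ x f g → x ⋆ (f List.++ g) ≈ᵥ x ⋆ f +ᵥ (x ·[ A ]^ List.length f) ⋆ g
    ⋆-++ x []      g j = sym (+-identityˡ _)
    ⋆-++ x (a ∷ f) g j = trans (+-cong refl (⋆-++ (x ·ᵥ A) f g j)) (sym (+-assoc _ _ _))

  δ-≡ : ∀ {x y} → x ≡ y → (if ⌊ x ℕ.≟ y ⌋ then 1# else 0#) ≈ 1#
  δ-≡ {x} {y} x≡y with x ℕ.≟ y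
  ... | yes _   = refl
  ... | no x≢y  = contradiction x≡y x≢y

  δ-≢ : ∀ {x y} → ¬ x ≡ y → (if ⌊ x ℕ.≟ y ⌋ then 1# else 0#) ≈ 0#
  δ-≢ {x} {y} x≢y with x ℕ.≟ y
  ... | yes x≡y = contradiction x≡y x≢y
  ... | no _    = refl

  module Companion {m : ℕ} (a : Vector (suc m)) where

    M : Matrix (suc m) (suc m)
    M = companion a

    open PolyAction M public

    f : Poly
    f = monicPoly a

    e₀ : Vector (suc m)
    e₀ = identity Fin.zero

    last : Fin (suc m)
    last = Fin.fromℕ m

    M-row-< : ∀ t col → toℕ t < m → M t col ≡ (if ⌊ toℕ col ℕ.≟ suc (toℕ t) ⌋ then 1# else 0#)
    M-row-< t col t<m with toℕ t ℕ.<ᵇ m | ℕP.<⇒<ᵇ t<m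
    ... | true | _ = P.refl

    M-row-last : ∀ col → M last col ≈ - a col
    M-row-last col with toℕ last ℕ.<ᵇ m | ℕP.<ᵇ⇒< (toℕ last) m
    ... | false | _      = refl
    ... | true  | last<m = contradiction (last<m _) (ℕP.<-irrefl (FinP.toℕ-fromℕ m))

    inject₁<m : ∀ (t : Fin m) → toℕ (Fin.inject₁ t) < m
    inject₁<m t = P.subst (_< m) (P.sym (FinP.toℕ-inject₁ t)) (FinP.toℕ<n t)

    ·M-zero : ∀ r → (r ·ᵥ M) Fin.zero ≈ - (r last * a Fin.zero)
    ·M-zero r = begin
      sumF (λ t → r t * M t Fin.zero)
        ≈⟨ sumF-init-last (λ t → r t * M t Fin.zero) ⟩
      sumF (λ t → r (Fin.inject₁ t) * M (Fin.inject₁ t) Fin.zero) + r last * M last Fin.zero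
        ≈⟨ +-cong (sumF-0 (λ t → trans (*-cong refl (off-diagonal t)) (zeroʳ _))) (*-cong refl (M-row-last Fin.zero)) ⟩
      0# + r last * - a Fin.zero
        ≈⟨ trans (+-identityˡ _) (sym (-‿distribʳ-* _ _)) ⟩
      - (r last * a Fin.zero) ∎
      where
      open ≈-Reasoning
      off-diagonal : ∀ t → M (Fin.inject₁ t) Fin.zero ≈ 0#
      off-diagonal t = trans (reflexive (M-row-< (Fin.inject₁ t) Fin.zero (inject₁<m t))) (δ-≢ {0} {suc (toℕ (Fin.inject₁ t))} (λ ()))

    ·M-suc : ∀ r (l : Fin m) → (r ·ᵥ M) (Fin.suc l) ≈ r (Fin.inject₁ l) + - (r last * a (Fin.suc l))
    ·M-suc r l = begin
      sumF (λ t → r t * M t (Fin.suc l))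
        ≈⟨ sumF-init-last (λ t → r t * M t (Fin.suc l)) ⟩
      sumF (λ t → r (Fin.inject₁ t) * M (Fin.inject₁ t) (Fin.suc l)) + r last * M last (Fin.suc l)
        ≈⟨ +-cong (sumF-δ _ l (λ t t≢l → trans (*-cong refl (off-diagonal t t≢l)) (zeroʳ _))) (*-cong refl (M-row-last (Fin.suc l))) ⟩
      r (Fin.inject₁ l) * M (Fin.inject₁ l) (Fin.suc l) + r last * - a (Fin.suc l)
        ≈⟨ +-cong (trans (*-cong refl diagonal) (*-identityʳ _)) (sym (-‿distribʳ-* _ _)) ⟩
      r (Fin.inject₁ l) + - (r last * a (Fin.suc l)) ∎
      where
      open ≈-Reasoning
      off-diagonal : ∀ t → ¬ t ≡ l → M (Fin.inject₁ t) (Fin.suc l) ≈ 0#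
      off-diagonal t t≢l = trans (reflexive (M-row-< (Fin.inject₁ t) (Fin.suc l) (inject₁<m t)))
        (δ-≢ (λ e → t≢l (P.sym (FinP.toℕ-injective (P.trans (ℕP.suc-injective e) (FinP.toℕ-inject₁ t))))))
      diagonal : M (Fin.inject₁ l) (Fin.suc l) ≈ 1#
      diagonal = trans (reflexive (M-row-< (Fin.inject₁ l) (Fin.suc l) (inject₁<m l)))
                       (δ-≡ (P.cong suc (P.sym (FinP.toℕ-inject₁ l))))

    e₀·M^i≈eᵢ : ∀ t (i : Fin (suc m)) → toℕ i ≡ t → e₀ ·[ M ]^ t ≈ᵥ identity i
    e₀·M^i≈eᵢ zero    Fin.zero    _ = ≋-refl
    e₀·M^i≈eᵢ (suc t) (Fin.suc i) e col = begin
      (e₀ ·[ M ]^ suc t) col                ≈⟨ ·^-suc M e₀ t col ⟩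
      ((e₀ ·[ M ]^ t) ·ᵥ M) col             ≈⟨ ·ᵥ-congˡ M (e₀·M^i≈eᵢ t (Fin.inject₁ i) (P.trans (FinP.toℕ-inject₁ i) (ℕP.suc-injective e))) col ⟩
      (identity (Fin.inject₁ i) ·ᵥ M) col   ≈⟨ basis-·ᵥ (Fin.inject₁ i) M col ⟩
      M (Fin.inject₁ i) col                 ≈⟨ reflexive (M-row-< (Fin.inject₁ i) col (inject₁<m i)) ⟩
      (if ⌊ toℕ col ℕ.≟ suc (toℕ (Fin.inject₁ i)) ⌋ then 1# else 0#) ≈⟨ δ≈identity ⟩
      identity (Fin.suc i) col              ∎
      where
      open ≈-Reasoning
      δ≈identity : (if ⌊ toℕ col ℕ.≟ suc (toℕ (Fin.inject₁ i)) ⌋ then 1# else 0#) ≈ identity (Fin.suc i) col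
      δ≈identity with Fin.suc i Fin.≟ col
      ... | yes P.refl = δ-≡ (P.cong suc (P.sym (FinP.toℕ-inject₁ i)))
      ... | no  i≢col  = δ-≢ (λ e′ → i≢col (P.sym (FinP.toℕ-injective (P.trans e′ (P.cong suc (FinP.toℕ-inject₁ i))))))

    e₀⋆tabulate : ∀ x → e₀ ⋆ List.tabulate x ≈ᵥ x
    e₀⋆tabulate x = ≋-trans (⋆-tabulate e₀ x) (≋-trans (·ᵥ-cong {c = x} ≋-refl (λ i → e₀·M^i≈eᵢ (toℕ i) i P.refl)) (·ᵥ-identity x))

    cayley-hamilton-e₀ : e₀ ⋆ f ≈ᵥ zeroVec
    cayley-hamilton-e₀ col = begin
      (e₀ ⋆ f) col
        ≈⟨ ⋆-++ e₀ (List.tabulate a) (1# ∷ []) col ⟩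
      (e₀ ⋆ List.tabulate a) col + ((e₀ ·[ M ]^ List.length (List.tabulate a)) ⋆ (1# ∷ [])) col
        ≈⟨ +-cong (e₀⋆tabulate a col) (reflexive (P.cong (λ t → ((e₀ ·[ M ]^ t) ⋆ (1# ∷ [])) col) (ListP.length-tabulate a))) ⟩
      a col + (1# * (e₀ ·[ M ]^ suc m) col + 0#)
        ≈⟨ +-cong refl (trans (+-identityʳ _) (*-identityˡ _)) ⟩
      a col + (e₀ ·[ M ]^ suc m) col
        ≈⟨ +-cong refl (trans (·^-suc M e₀ m col) (trans (·ᵥ-congˡ M (e₀·M^i≈eᵢ m last (FinP.toℕ-fromℕ m)) col)
                                                 (trans (basis-·ᵥ last M col) (M-row-last col)))) ⟩
      a col + - a col
        ≈⟨ -‿inverseʳ _ ⟩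
      0# ∎
      where open ≈-Reasoning

    -- every x is g(M) applied to e₀ for the polynomial g = tabulate x, and g(M) commutes with f(M)
    cayley-hamilton : ∀ x → x ⋆ f ≈ᵥ zeroVec
    cayley-hamilton x =
      ≋-trans (⋆-cong f (≋-sym (e₀⋆tabulate x)))
        (≋-trans (⋆-comm e₀ (List.tabulate x) f) (≋-trans (⋆-cong (List.tabulate x) cayley-hamilton-e₀) (⋆-zeroVec (List.tabulate x))))

    ∣xPowMinus1⇒periodic : ∀ e → f ∣ₚ xPowMinus1 (suc e) → ∀ x → x ·[ M ]^ suc e ≈ᵥ x
    ∣xPowMinus1⇒periodic e (h , fh≈) x = u-v≈0⇒u≈v (begin
      x ·[ M ]^ suc e -ᵥ x      ≈⟨ ⋆-xPowMinus1 x e ⟨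
      x ⋆ xPowMinus1 (suc e)    ≈⟨ ⋆-≈ₚ x (xPowMinus1 (suc e)) (f *ₚ h) (λ i → sym (fh≈ i)) ⟩
      x ⋆ (f *ₚ h)              ≈⟨ ⋆-*ₚ x f h ⟩
      (x ⋆ f) ⋆ h               ≈⟨ ⋆-cong h (cayley-hamilton x) ⟩
      zeroVec ⋆ h               ≈⟨ ⋆-zeroVec h ⟩
      zeroVec                   ∎)
      where
      open ≈ᵥ-Reasoning

    coeff-e₀-suc : ∀ i → coeff (List.tabulate e₀) (suc i) ≈ 0#
    coeff-e₀-suc = coeff-tabulate-≈0 {v = VF.tail e₀} (λ j → identity-≢ Fin.zero (Fin.suc j) (λ ()))

    coeff-f-< : ∀ (l : Fin (suc m)) → coeff f (toℕ l) ≡ a l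
    coeff-f-< l = P.trans (coeff-++ˡ (List.tabulate a) (1# ∷ []) (toℕ l)
                             (P.subst (toℕ l <_) (P.sym (ListP.length-tabulate a)) (FinP.toℕ<n l)))
                          (coeff-tabulate a l)

    coeff-f-top : coeff f (suc m) ≡ 1#
    coeff-f-top = P.subst (λ t → coeff f t ≡ 1#) (P.trans (ℕP.+-identityʳ _) (ListP.length-tabulate a))
                          (coeff-++ʳ (List.tabulate a) (1# ∷ []) 0)

    coeff-f-> : ∀ i → suc m < i → coeff f i ≡ 0#
    coeff-f-> (suc (suc i)) (s≤s m<i) = P.subst (λ t → coeff f t ≡ 0#) index (coeff-++ʳ (List.tabulate a) (1# ∷ []) (suc (suc i ∸ suc m)))
      where
      index : List.length (List.tabulate a) ℕ.+ suc (suc i ∸ suc m) ≡ suc (suc i)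
      index = P.trans (P.cong (ℕ._+ suc (suc i ∸ suc m)) (ListP.length-tabulate a))
                      (P.trans (ℕP.+-suc (suc m) (suc i ∸ suc m)) (P.cong suc (ℕP.m+[n∸m]≡n m<i)))

    -- multiplying by x shifts coefficients, and the overflow r_last·x^(m+1) is reduced modulo f, as M does
    coeff-tabulate-·M : ∀ r i → coeff (List.tabulate r) i ≈ r last * coeff f (suc i) + coeff (List.tabulate (r ·ᵥ M)) (suc i)
    coeff-tabulate-·M r i with ℕP.<-cmp i m
    ... | tri< i<m _ _ = P.subst (λ t → coeff (List.tabulate r) t ≈ r last * coeff f (suc t) + coeff (List.tabulate (r ·ᵥ M)) (suc t))
                                 (FinP.toℕ-fromℕ< i<m) (at (Fin.fromℕ< i<m))
      where
      at : ∀ (l : Fin m) → coeff (List.tabulate r) (toℕ l) ≈ r last * coeff f (suc (toℕ l)) + coeff (List.tabulate (r ·ᵥ M)) (suc (toℕ l))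
      at l = begin
        coeff (List.tabulate r) (toℕ l)                   ≈⟨ reflexive (P.trans (P.cong (coeff (List.tabulate r)) (P.sym (FinP.toℕ-inject₁ l)))
                                                                         (coeff-tabulate r (Fin.inject₁ l))) ⟩
        r (Fin.inject₁ l)                                 ≈⟨ x+[y-x]≈y _ _ ⟨
        r last * a (Fin.suc l) + (r (Fin.inject₁ l) + - (r last * a (Fin.suc l)))
                                                          ≈⟨ +-cong (*-cong refl (sym (reflexive (coeff-f-< (Fin.suc l))))) (sym (·M-suc r l)) ⟩
        r last * coeff f (suc (toℕ l)) + (r ·ᵥ M) (Fin.suc l) ≈⟨ +-cong refl (sym (reflexive (coeff-tabulate (r ·ᵥ M) (Fin.suc l)))) ⟩
        r last * coeff f (suc (toℕ l)) + coeff (List.tabulate (r ·ᵥ M)) (suc (toℕ l)) ∎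
        where open ≈-Reasoning
    ... | tri≈ _ P.refl _ = begin
        coeff (List.tabulate r) i  ≈⟨ reflexive (P.trans (P.cong (coeff (List.tabulate r)) (P.sym (FinP.toℕ-fromℕ m))) (coeff-tabulate r last)) ⟩
        r last                     ≈⟨ trans (*-cong refl (reflexive coeff-f-top)) (*-identityʳ _) ⟨
        r last * coeff f (suc i)   ≈⟨ +-identityʳ _ ⟨
        r last * coeff f (suc i) + 0# ≈⟨ +-cong refl (reflexive (coeff-tabulate-≥ (r ·ᵥ M) (suc i) ℕP.≤-refl)) ⟨
        r last * coeff f (suc i) + coeff (List.tabulate (r ·ᵥ M)) (suc i) ∎
        where open ≈-Reasoning
    ... | tri> _ _ i>m = begin
        coeff (List.tabulate r) i  ≈⟨ reflexive (coeff-tabulate-≥ r i i>m) ⟩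
        0#                         ≈⟨ trans (+-cong (trans (*-cong refl (reflexive (coeff-f-> (suc i) (s≤s i>m)))) (zeroʳ _))
                                                     (reflexive (coeff-tabulate-≥ (r ·ᵥ M) (suc i) (ℕP.m≤n⇒m≤1+n i>m))))
                                            (+-identityʳ _) ⟨
        r last * coeff f (suc i) + coeff (List.tabulate (r ·ᵥ M)) (suc i) ∎
        where open ≈-Reasoning

    xPow-division : ∀ j → ∃ λ h → ∀ i → coeff (xPow j) i ≈ coeff (f *ₚ h) i + coeff (List.tabulate (e₀ ·[ M ]^ j)) i
    xPow-division zero = [] , λ
      { zero    → sym (trans (+-cong (coeff-*ₚ-[] f zero) (identity-diag {suc m} Fin.zero)) (+-identityˡ 1#))
      ; (suc i) → sym (trans (+-cong (coeff-*ₚ-[] f (suc i)) (coeff-e₀-suc i)) (+-identityʳ 0#)) }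
    xPow-division (suc j) with xPow-division j
    ... | h , xʲ≈ = r last ∷ h , λ
      { zero    → sym (trans (step zero) (trans (+-cong (+-identityʳ _) (·M-zero r)) (-‿inverseʳ _)))
      ; (suc i) → trans (xʲ≈ i) (trans (rearrange (coeff-tabulate-·M r i)) (sym (step (suc i)))) }
      where
      r = e₀ ·[ M ]^ j
      step : ∀ i → coeff (f *ₚ (r last ∷ h)) i + coeff (List.tabulate (e₀ ·[ M ]^ suc j)) i
                 ≈ (r last * coeff f i + coeff (0# ∷ (f *ₚ h)) i) + coeff (List.tabulate (r ·ᵥ M)) i
      step i = +-cong (coeff-*ₚ-∷ f (r last) h i) (coeff-tabulate-cong (·^-suc M e₀ j) i)
      rearrange : ∀ {x y z w} → y ≈ z + w → x + y ≈ (z + x) + w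
      rearrange y≈z+w = trans (+-cong refl y≈z+w) (trans (sym (+-assoc _ _ _)) (+-cong (+-comm _ _) refl))

    e₀-periodic⇒∣xPowMinus1 : ∀ e → e₀ ·[ M ]^ suc e ≈ᵥ e₀ → f ∣ₚ xPowMinus1 (suc e)
    e₀-periodic⇒∣xPowMinus1 e periodic with xPow-division (suc e)
    ... | h , xᵉ≈ = h , λ
      { zero    → inverseˡ-unique _ _ (trans (+-cong refl (sym (trans (periodic Fin.zero) (identity-diag {suc m} Fin.zero)))) (sym (xᵉ≈ zero)))
      ; (suc i) → sym (trans (xᵉ≈ (suc i)) (trans (+-cong refl (trans (coeff-tabulate-cong periodic (suc i)) (coeff-e₀-suc i))) (+-identityʳ _))) }

  module PrimitiveOrbit {m : ℕ} (a : Vector (suc m)) (a-primitive : Primitive a) where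

    open Companion a public

    order : ℕ
    order = q ℕ.^ suc m ∸ 1

    E : ℕ
    E = order ∸ 1

    N : ℕ
    N = suc E

    N≡order : N ≡ order
    N≡order = P.trans (ℕP.+-comm 1 E) (ℕP.m∸n+n≡m (proj₁ (proj₂ (proj₂ a-primitive))))

    q^[1+m]≡1+N : q ℕ.^ suc m ≡ suc N
    q^[1+m]≡1+N = P.trans (P.sym (ℕP.m∸n+n≡m 1≤q^[1+m])) (P.trans (ℕP.+-comm order 1) (P.cong suc (P.sym N≡order)))
      where
      1≤q^[1+m] : 1 ≤ q ℕ.^ suc m
      1≤q^[1+m] = ℕP.m^n>0 q {{ℕ.>-nonZero (ℕP.≤-trans (s≤s z≤n) 2≤q)}} (suc m)

    hasOrder : HasOrder f N
    hasOrder = P.subst (HasOrder f) (P.sym N≡order) (proj₂ (proj₂ a-primitive))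

    periodic : ∀ x → x ·[ M ]^ N ≈ᵥ x
    periodic = ∣xPowMinus1⇒periodic E (proj₁ (proj₂ hasOrder))

    periodic-* : ∀ x k → x ·[ M ]^ (k ℕ.* N) ≈ᵥ x
    periodic-* x zero    = ≋-refl
    periodic-* x (suc k) = ≋-trans (·^-+-≈ M x N (k ℕ.* N)) (≋-trans (·^-cong M (k ℕ.* N) (periodic x)) (periodic-* x k))

    ·^-% : ∀ x j → x ·[ M ]^ j ≈ᵥ x ·[ M ]^ (j % N)
    ·^-% x j = ≋-trans (≋-reflexive (P.cong (x ·[ M ]^_) (m≡m%n+[m/n]*n j N)))
                       (≋-trans (·^-+-≈ M x (j % N) ((j / N) ℕ.* N)) (periodic-* _ (j / N)))

    -- t + t·E = t·N and M^N acts as the identity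
    ·^-inverse : ∀ x t → (x ·[ M ]^ t) ·[ M ]^ (t ℕ.* E) ≈ᵥ x
    ·^-inverse x t = ≋-trans (≋-sym (·^-+-≈ M x t (t ℕ.* E)))
                             (≋-trans (≋-reflexive (P.cong (x ·[ M ]^_) (P.sym (ℕP.*-suc t E)))) (periodic-* x t))

    ·^-cancel : ∀ {x y} t → x ·[ M ]^ t ≈ᵥ y ·[ M ]^ t → x ≈ᵥ y
    ·^-cancel {x} {y} t xMᵗ≈yMᵗ =
      ≋-trans (≋-sym (·^-inverse x t)) (≋-trans (·^-cong M (t ℕ.* E) xMᵗ≈yMᵗ) (·^-inverse y t))

    Aperiodic : Vector (suc m) → Set
    Aperiodic w = ∀ d → 0 < d → d < N → ¬ w ·[ M ]^ d ≈ᵥ w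

    e₀-aperiodic : Aperiodic e₀
    e₀-aperiodic (suc d) _ d<N e₀Mᵈ≈e₀ = proj₂ (proj₂ hasOrder) (suc d) (s≤s z≤n) d<N (e₀-periodic⇒∣xPowMinus1 d e₀Mᵈ≈e₀)

    orbit-no-repeat : ∀ {w} → Aperiodic w → ∀ {s t} → s < t → t < N → ¬ w ·[ M ]^ t ≈ᵥ w ·[ M ]^ s
    orbit-no-repeat {w} aperiodic {s} {t} s<t t<N wMᵗ≈wMˢ =
      aperiodic (t ∸ s) (ℕP.m<n⇒0<n∸m s<t) (ℕP.≤-<-trans (ℕP.m∸n≤m t s) t<N) (·^-cancel s (begin
        (w ·[ M ]^ (t ∸ s)) ·[ M ]^ s  ≈⟨ ·^-comm M w (t ∸ s) s ⟩
        (w ·[ M ]^ s) ·[ M ]^ (t ∸ s)  ≈⟨ ·^-+-≈ M w s (t ∸ s) ⟨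
        w ·[ M ]^ (s ℕ.+ (t ∸ s))      ≡⟨ P.cong (w ·[ M ]^_) (ℕP.m+[n∸m]≡n (ℕP.<⇒≤ s<t)) ⟩
        w ·[ M ]^ t                    ≈⟨ wMᵗ≈wMˢ ⟩
        w ·[ M ]^ s                    ∎))
      where open ≈ᵥ-Reasoning

    orbit-injective : ∀ {w} → Aperiodic w → ∀ {r₁ r₂} → r₁ < N → r₂ < N → w ·[ M ]^ r₁ ≈ᵥ w ·[ M ]^ r₂ → r₁ ≡ r₂
    orbit-injective aperiodic {r₁} {r₂} r₁<N r₂<N wMʳ¹≈wMʳ² with ℕP.<-cmp r₁ r₂
    ... | tri< r₁<r₂ _ _ = contradiction (≋-sym wMʳ¹≈wMʳ²) (orbit-no-repeat aperiodic r₁<r₂ r₂<N)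
    ... | tri≈ _ r₁≡r₂ _ = r₁≡r₂
    ... | tri> _ _ r₂<r₁ = contradiction wMʳ¹≈wMʳ² (orbit-no-repeat aperiodic r₂<r₁ r₁<N)

    e₀-orbit-≉0 : ∀ t → ¬ e₀ ·[ M ]^ t ≈ᵥ zeroVec
    e₀-orbit-≉0 t e₀Mᵗ≈0 = 1≉0 (trans (sym (identity-diag {suc m} Fin.zero)) (≋-trans (≋-sym (·^-inverse e₀ t)) (≋-trans (·^-cong M (t ℕ.* E) e₀Mᵗ≈0) (·^-zeroVec M (t ℕ.* E))) Fin.zero))

    -- the N distinct nonzero vectors e₀·M^t, t < N, exhaust the q^(m+1) - 1 nonzero vectors
    e₀-orbit-surjective : ∀ x → ¬ x ≈ᵥ zeroVec → ∃ λ t → e₀ ·[ M ]^ t ≈ᵥ x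
    e₀-orbit-surjective x x≉0 = toℕ t , code-injective (FinP.punchOut-injective (orbit≢0 t) code-0≢code-x ht≡)
      where
      code : Vector (suc m) → Fin (suc N)
      code v = Fin.cast q^[1+m]≡1+N (encode v)
      code-injective : ∀ {v w} → code v ≡ code w → v ≈ᵥ w
      code-injective {v} {w} e = encode-injective (FinP.toℕ-injective
        (P.trans (P.sym (FinP.toℕ-cast q^[1+m]≡1+N (encode v))) (P.trans (P.cong toℕ e) (FinP.toℕ-cast q^[1+m]≡1+N (encode w)))))
      code-0≢code-x : ¬ code zeroVec ≡ code x
      code-0≢code-x e = x≉0 (≋-sym (code-injective e))
      orbit≢0 : ∀ t → ¬ code zeroVec ≡ code (e₀ ·[ M ]^ toℕ t)
      orbit≢0 t e = e₀-orbit-≉0 (toℕ t) (≋-sym (code-injective e))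
      h : Fin N → Fin N
      h t = Fin.punchOut (orbit≢0 t)
      h-injective : ∀ {s t} → h s ≡ h t → s ≡ t
      h-injective {s} {t} e = FinP.toℕ-injective (orbit-injective e₀-aperiodic (FinP.toℕ<n s) (FinP.toℕ<n t)
                                (code-injective (FinP.punchOut-injective (orbit≢0 s) (orbit≢0 t) e)))
      t = proj₁ (injective⇒surjective h h-injective (Fin.punchOut code-0≢code-x))
      ht≡ = proj₂ (injective⇒surjective h h-injective (Fin.punchOut code-0≢code-x))

    aperiodic : ∀ w → ¬ w ≈ᵥ zeroVec → Aperiodic w
    aperiodic w w≉0 d 0<d d<N wMᵈ≈w = e₀-aperiodic d 0<d d<N (·^-cancel t
      (≋-trans (·^-comm M e₀ d t) (≋-trans (·^-cong M d e₀Mᵗ≈w) (≋-trans wMᵈ≈w (≋-sym e₀Mᵗ≈w)))))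
      where
      t = proj₁ (e₀-orbit-surjective w w≉0)
      e₀Mᵗ≈w = proj₂ (e₀-orbit-surjective w w≉0)

    ·^-≈⇒%-≡ : ∀ {w} → ¬ w ≈ᵥ zeroVec → ∀ a b → w ·[ M ]^ a ≈ᵥ w ·[ M ]^ b → a % N ≡ b % N
    ·^-≈⇒%-≡ {w} w≉0 a b wMᵃ≈wMᵇ =
      orbit-injective (aperiodic w w≉0) (m%n<n a N) (m%n<n b N) (≋-trans (≋-sym (·^-% w a)) (≋-trans wMᵃ≈wMᵇ (·^-% w b)))

    transitive : ∀ x y → ¬ x ≈ᵥ zeroVec → ¬ y ≈ᵥ zeroVec → ∃ λ t → x ·[ M ]^ t ≈ᵥ y
    transitive x y x≉0 y≉0 = s ℕ.* E ℕ.+ u , (begin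
      x ·[ M ]^ (s ℕ.* E ℕ.+ u)            ≈⟨ ·^-+-≈ M x (s ℕ.* E) u ⟩
      (x ·[ M ]^ (s ℕ.* E)) ·[ M ]^ u      ≈⟨ ·^-cong M u (·^-cong M (s ℕ.* E) e₀Mˢ≈x) ⟨
      ((e₀ ·[ M ]^ s) ·[ M ]^ (s ℕ.* E)) ·[ M ]^ u ≈⟨ ·^-cong M u (·^-inverse e₀ s) ⟩
      e₀ ·[ M ]^ u                         ≈⟨ e₀Mᵘ≈y ⟩
      y                                    ∎)
      where
      open ≈ᵥ-Reasoning
      s = proj₁ (e₀-orbit-surjective x x≉0)
      e₀Mˢ≈x = proj₂ (e₀-orbit-surjective x x≉0)
      u = proj₁ (e₀-orbit-surjective y y≉0)
      e₀Mᵘ≈y = proj₂ (e₀-orbit-surjective y y≉0)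

    shift-% : ∀ i d → d % N ≡ 0 → (i ℕ.+ d) % N ≡ i % N
    shift-% i d d%N≡0 = P.trans (P.cong (λ d → (i ℕ.+ d) % N) d≡[d/N]*N) ([m+kn]%n≡m%n i (d / N) N)
      where
      d≡[d/N]*N : d ≡ (d / N) ℕ.* N
      d≡[d/N]*N = P.trans (m≡m%n+[m/n]*n d N) (P.cong (ℕ._+ (d / N) ℕ.* N) d%N≡0)

    I-M^d-surjective : ∀ d → ¬ d % N ≡ 0 → ∀ u → ∃ λ z → z -ᵥ z ·[ M ]^ d ≈ᵥ u
    I-M^d-surjective d d≢0 = vector-injective⇒surjective (λ z → z -ᵥ z ·[ M ]^ d) injective
      where
      injective : ∀ z z′ → z -ᵥ z ·[ M ]^ d ≈ᵥ z′ -ᵥ z′ ·[ M ]^ d → z ≈ᵥ z′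
      injective z z′ eq with (z -ᵥ z′) ≟ᵥ zeroVec
      ... | yes z-z′≈0 = u-v≈0⇒u≈v z-z′≈0
      ... | no  z-z′≉0 = contradiction (·^-≈⇒%-≡ z-z′≉0 d 0 fixed) d≢0
        where
        fixed : (z -ᵥ z′) ·[ M ]^ d ≈ᵥ z -ᵥ z′
        fixed j = trans (·^-+ᵥ M z (-ᵥ z′) d j) (trans (+-cong refl (·^-negᵥ M z′ d j))
                        (sym (x-y≈u-v⇒x-u≈y-v (eq j))))

  -- The orbit code

  module Setting
    (k : ℕ) (1<k : 1 < k) (a : Vector (suc k)) (a-primitive : Primitive a)
    (U₁ : Matrix k k) (U₂ : Matrix k (suc k)) (rank-U₁ : Rank U₁ k) (rank-U₂ : Rank U₂ k)
    (v₁ : Vector k) (v₂ : Vector (suc k)) (v₂∉U₂ : ¬ rowsp U₂ v₂)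
    (F F′ F″ : Flag (k ℕ.+ suc k)) (F-full : FullFlag F) (F′-full : FullFlag F′) (F″-full : FullFlag F″)
    (Fₖ : F k ≐ rowsp (U₁ ∣ₘ U₂))
    (Fₖ₊₁ : F (suc k) ≐ rowsp (addRow (U₁ ∣ₘ U₂) (v₁ ++ v₂)))
    (F′ₖ : F′ k ≐ rowsp (U₁ ∣ₘ zeroMat))
    (F′ₖ₊₁ : F′ (suc k) ≐ rowsp (addRow (U₁ ∣ₘ zeroMat) (v₁ ++ v₂)))
    (F″ₖ : F″ k ≐ rowsp (zeroMat ∣ₘ U₂))
    (F″ₖ₊₁ : F″ (suc k) ≐ rowsp (addRow (zeroMat ∣ₘ U₂) (v₁ ++ v₂)))
    where

    open PrimitiveOrbit a a-primitive

    n : ℕ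
    n = k ℕ.+ suc k

    g : Matrix n n
    g = blockDiag identity M

    C : Code n
    C = orbitCode g F F′ F″

    Orb : ℕ → Flag n
    Orb j = F ·f (g ^ₘ j)

    1≤k : 1 ≤ k
    1≤k = ℕP.<⇒≤ 1<k

    k+1<n : suc k < n
    k+1<n = 1+k<k+[1+k] 1≤k

    U₁-independent : LinIndep U₁
    U₁-independent = Rank⇒LinIndep U₁ rank-U₁

    U₁-spanning : ∀ x → rowsp U₁ x
    U₁-spanning = square-LinIndep⇒spanning U₁ U₁-independent

    U₂-independent : LinIndep U₂
    U₂-independent = Rank⇒LinIndep U₂ rank-U₂

    U₂,v₂-spanning : ∀ y → ∃ λ c → ∃ λ t → y ≈ᵥ (c ·ᵥ U₂) +ᵥ t *ᵥ v₂
    U₂,v₂-spanning y = VF.tail c , c Fin.zero , λ j → trans (y≈ j) (+-comm _ _)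
      where
      v₂∷U₂-independent : LinIndep (v₂ VF.∷ U₂)
      v₂∷U₂-independent = LinIndep₂⇒LinIndepʳ {Y = v₂ VF.∷ U₂} (LinIndep₂-∷ {0} {L = λ ()} {Q = U₂} {v = v₂} (LinIndep⇒LinIndep₂ʳ U₂-independent)
        (λ (_ , e , v₂≈) → v₂∉U₂ (e , λ j → trans (v₂≈ j) (+-identityˡ _))))
      c = proj₁ (square-LinIndep⇒spanning (v₂ VF.∷ U₂) v₂∷U₂-independent y)
      y≈ = proj₂ (square-LinIndep⇒spanning (v₂ VF.∷ U₂) v₂∷U₂-independent y)

    v₂≉0 : ¬ v₂ ≈ᵥ zeroVec
    v₂≉0 v₂≈0 = v₂∉U₂ (rowsp-resp U₂ (≋-sym v₂≈0) (rowsp-zero U₂))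

    ·g^ : ∀ (u : Vector k) w j → ((u ++ w) ·ᵥ (g ^ₘ j)) ≈ᵥ (u ++ w ·[ M ]^ j)
    ·g^ u w j = ≋-trans (·ᵥ-^ₘ g (u ++ w) j) (blockDiag-identity-·^ M u w j)

    ·g^-take-drop : ∀ (v : Vector n) j → (v ·ᵥ (g ^ₘ j)) ≈ᵥ (VF.take k v ++ VF.drop k v ·[ M ]^ j)
    ·g^-take-drop v j = ≋-trans (·ᵥ-congˡ (g ^ₘ j) (take-++-drop {k} v)) (·g^ (VF.take k v) (VF.drop k v) j)

    g^-injective : ∀ j v v′ → (v ·ᵥ (g ^ₘ j)) ≈ᵥ (v′ ·ᵥ (g ^ₘ j)) → v ≈ᵥ v′
    g^-injective j v v′ vgʲ≈v′gʲ =
      ≋-trans (take-++-drop {k} v) (≋-trans (++⁺ _≈_ {k} (proj₁ halves) (·^-cancel j (proj₂ halves))) (≋-sym (take-++-drop {k} v′)))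
      where
      halves = ++⁻ _≈_ (VF.take k v) (VF.take k v′) (≋-trans (≋-sym (·g^-take-drop v j)) (≋-trans vgʲ≈v′gʲ (·g^-take-drop v′ j)))

    Orb-full : ∀ j → FullFlag (Orb j)
    Orb-full j = ·f-FullFlag (g ^ₘ j) (g^-injective j) F-full

    Orb-% : ∀ j → Orb j ≐f Orb (j % N)
    Orb-% j _ _ _ = (λ w (v , v∈F , w≈) → v , v∈F , ≋-trans w≈ (gʲ≈g^[j%N] v))
                  , (λ w (v , v∈F , w≈) → v , v∈F , ≋-trans w≈ (≋-sym (gʲ≈g^[j%N] v)))
      where
      gʲ≈g^[j%N] : ∀ v → (v ·ᵥ (g ^ₘ j)) ≈ᵥ (v ·ᵥ (g ^ₘ (j % N)))
      gʲ≈g^[j%N] v = ≋-trans (·g^-take-drop v j) (≋-trans (++⁺ _≈_ {k} ≋-refl (·^-% (VF.drop k v) j)) (≋-sym (·g^-take-drop v (j % N))))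

    Orbₖ⁻ : ∀ j {w} → Orb j k w → ∃ λ c → w ≈ᵥ ((c ·ᵥ U₁) ++ (c ·ᵥ U₂) ·[ M ]^ j)
    Orbₖ⁻ j (v , v∈Fₖ , w≈vgʲ) with rowsp-∣ₘ⁻ {A = U₁} {B = U₂} (proj₁ Fₖ v v∈Fₖ)
    ... | c , v≈ = c , ≋-trans w≈vgʲ (≋-trans (·ᵥ-congˡ (g ^ₘ j) v≈) (·g^ _ _ j))

    Orbₖ⁺ : ∀ j c → Orb j k ((c ·ᵥ U₁) ++ (c ·ᵥ U₂) ·[ M ]^ j)
    Orbₖ⁺ j c = _ , proj₂ Fₖ _ (rowsp-∣ₘ⁺ {A = U₁} {B = U₂} c) , ≋-sym (·g^ _ _ j)

    Orbₖ₊₁⁻ : ∀ j {w} → Orb j (suc k) w →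
              ∃ λ c → ∃ λ t → w ≈ᵥ (((c ·ᵥ U₁) +ᵥ t *ᵥ v₁) ++ ((c ·ᵥ U₂) +ᵥ t *ᵥ v₂) ·[ M ]^ j)
    Orbₖ₊₁⁻ j (v , v∈Fₖ₊₁ , w≈vgʲ) with rowsp-addRow-∣ₘ⁻ {A = U₁} {B = U₂} (proj₁ Fₖ₊₁ v v∈Fₖ₊₁)
    ... | c , t , v≈ = c , t , ≋-trans w≈vgʲ (≋-trans (·ᵥ-congˡ (g ^ₘ j) v≈) (·g^ _ _ j))

    Orbₖ₊₁⁺ : ∀ j c t → Orb j (suc k) (((c ·ᵥ U₁) +ᵥ t *ᵥ v₁) ++ ((c ·ᵥ U₂) +ᵥ t *ᵥ v₂) ·[ M ]^ j)
    Orbₖ₊₁⁺ j c t = _ , proj₂ Fₖ₊₁ _ (rowsp-addRow-∣ₘ⁺ {A = U₁} {B = U₂} c t) , ≋-sym (·g^ _ _ j)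

    F′ₖ⁻ : ∀ {w} → F′ k w → ∃ λ c → w ≈ᵥ ((c ·ᵥ U₁) ++ zeroVec)
    F′ₖ⁻ w∈ with rowsp-∣ₘ⁻ {A = U₁} {B = zeroMat} (proj₁ F′ₖ _ w∈)
    ... | c , w≈ = c , ≋-trans w≈ (++⁺ _≈_ {k} ≋-refl (·ᵥ-zeroMat c))

    F′ₖ⁺ : ∀ c → F′ k ((c ·ᵥ U₁) ++ zeroVec)
    F′ₖ⁺ c = proj₂ F′ₖ _ (rowsp-resp _ (++⁺ _≈_ {k} ≋-refl (·ᵥ-zeroMat c)) (rowsp-∣ₘ⁺ {A = U₁} {B = zeroMat} c))

    F′ₖ₊₁⁺ : ∀ c t → F′ (suc k) (((c ·ᵥ U₁) +ᵥ t *ᵥ v₁) ++ t *ᵥ v₂)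
    F′ₖ₊₁⁺ c t = proj₂ F′ₖ₊₁ _ (rowsp-resp _ (++⁺ _≈_ {k} ≋-refl (λ j → trans (+-cong (·ᵥ-zeroMat c j) refl) (+-identityˡ _)))
                                               (rowsp-addRow-∣ₘ⁺ {A = U₁} {B = zeroMat} c t))

    F″ₖ⁻ : ∀ {w} → F″ k w → ∃ λ c → w ≈ᵥ (zeroVec ++ (c ·ᵥ U₂))
    F″ₖ⁻ w∈ with rowsp-∣ₘ⁻ {A = zeroMat} {B = U₂} (proj₁ F″ₖ _ w∈)
    ... | c , w≈ = c , ≋-trans w≈ (++⁺ _≈_ {k} (·ᵥ-zeroMat c) ≋-refl)

    F″ₖ⁺ : ∀ c → F″ k (zeroVec ++ (c ·ᵥ U₂))
    F″ₖ⁺ c = proj₂ F″ₖ _ (rowsp-resp _ (++⁺ _≈_ {k} (·ᵥ-zeroMat c) ≋-refl) (rowsp-∣ₘ⁺ {A = zeroMat} {B = U₂} c))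

    F″ₖ₊₁⁻ : ∀ {w} → F″ (suc k) w → ∃ λ c → ∃ λ t → w ≈ᵥ (t *ᵥ v₁ ++ (c ·ᵥ U₂) +ᵥ t *ᵥ v₂)
    F″ₖ₊₁⁻ w∈ with rowsp-addRow-∣ₘ⁻ {A = zeroMat} {B = U₂} (proj₁ F″ₖ₊₁ _ w∈)
    ... | c , t , w≈ = c , t , ≋-trans w≈ (++⁺ _≈_ {k} (λ j → trans (+-cong (·ᵥ-zeroMat c j) refl) (+-identityˡ _)) ≋-refl)

    F″ₖ₊₁⁺ : ∀ c t → F″ (suc k) (t *ᵥ v₁ ++ (c ·ᵥ U₂) +ᵥ t *ᵥ v₂)
    F″ₖ₊₁⁺ c t = proj₂ F″ₖ₊₁ _ (rowsp-resp _ (++⁺ _≈_ {k} (λ j → trans (+-cong (·ᵥ-zeroMat c j) refl) (+-identityˡ _)) ≋-refl)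
                                               (rowsp-addRow-∣ₘ⁺ {A = zeroMat} {B = U₂} c t))

    MeetTrivially : Flag n → Flag n → Set
    MeetTrivially X Y = ∀ w → X k w → Y k w → w ≈ᵥ zeroVec

    Spans : Flag n → Flag n → Set
    Spans X Y = ∀ w → (X (suc k) +ₛ Y (suc k)) w

    MeetTrivially-sym : ∀ X Y → MeetTrivially X Y → MeetTrivially Y X
    MeetTrivially-sym _ _ X∩Y≈0 w y x = X∩Y≈0 w x y

    Spans-sym : ∀ X Y → Spans X Y → Spans Y X
    Spans-sym _ _ X+Y w with X+Y w
    ... | x , y , x∈ , y∈ , w≈x+y = y , x , y∈ , x∈ , λ j → trans (w≈x+y j) (+-comm _ _)

    MeetTrivially-≐f : ∀ X Y {X′ Y′} → MeetTrivially X Y → X′ ≐f X → Y′ ≐f Y → MeetTrivially X′ Y′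
    MeetTrivially-≐f _ _ X∩Y≈0 X′≐X Y′≐Y w x y = X∩Y≈0 w (proj₁ (X′≐X k 1≤k k<k+[1+k]) w x) (proj₁ (Y′≐Y k 1≤k k<k+[1+k]) w y)

    Spans-≐f : ∀ X Y {X′ Y′} → Spans X Y → X′ ≐f X → Y′ ≐f Y → Spans X′ Y′
    Spans-≐f _ _ X+Y X′≐X Y′≐Y w with X+Y w
    ... | x , y , x∈ , y∈ , w≈x+y =
      x , y , proj₂ (X′≐X (suc k) (s≤s z≤n) k+1<n) x x∈ , proj₂ (Y′≐Y (suc k) (s≤s z≤n) k+1<n) y y∈ , w≈x+y

    orbit-vector≈0 : ∀ j {c} → c ≈ᵥ zeroVec → ((c ·ᵥ U₁) ++ (c ·ᵥ U₂) ·[ M ]^ j) ≈ᵥ zeroVec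
    orbit-vector≈0 j c≈0 = ≋-trans (++⁺ _≈_ {k} (·ᵥ-zeroˡ U₁ c≈0) (≋-trans (·^-cong M j (·ᵥ-zeroˡ U₂ c≈0)) (·^-zeroVec M j)))
                                   (zeroVec-++ {k})

    Orb-Orb-meet : ∀ i j → ¬ i % N ≡ j % N → MeetTrivially (Orb i) (Orb j)
    Orb-Orb-meet i j i≢j w w∈Orbᵢ w∈Orbⱼ with Orbₖ⁻ i w∈Orbᵢ | Orbₖ⁻ j w∈Orbⱼ
    ... | c , w≈ | d , w≈′ with ++⁻ _≈_ (c ·ᵥ U₁) (d ·ᵥ U₁) (≋-trans (≋-sym w≈) w≈′) | (c ·ᵥ U₂) ≟ᵥ zeroVec
    ...   | _ ,       _     | yes cU₂≈0 = ≋-trans w≈ (orbit-vector≈0 i (U₂-independent c cU₂≈0))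
    ...   | cU₁≈dU₁ , lower | no  cU₂≉0 = contradiction (·^-≈⇒%-≡ cU₂≉0 i j
              (≋-trans lower (·^-cong M j (·ᵥ-congˡ U₂ (≋-sym (LinIndep-injective U₁-independent c d cU₁≈dU₁)))))) i≢j

    Orb-F′-meet : ∀ j → MeetTrivially (Orb j) F′
    Orb-F′-meet j w w∈Orb w∈F′ with Orbₖ⁻ j w∈Orb | F′ₖ⁻ w∈F′
    ... | c , w≈ | d , w≈′ = ≋-trans w≈ (orbit-vector≈0 j (U₂-independent c (·^-cancel j
          (≋-trans (proj₂ (++⁻ _≈_ (c ·ᵥ U₁) (d ·ᵥ U₁) (≋-trans (≋-sym w≈) w≈′))) (≋-sym (·^-zeroVec M j))))))

    Orb-F″-meet : ∀ j → MeetTrivially (Orb j) F″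
    Orb-F″-meet j w w∈Orb w∈F″ with Orbₖ⁻ j w∈Orb | F″ₖ⁻ w∈F″
    ... | c , w≈ | d , w≈′ = ≋-trans w≈ (orbit-vector≈0 j (U₁-independent c
          (proj₁ (++⁻ _≈_ (c ·ᵥ U₁) zeroVec (≋-trans (≋-sym w≈) w≈′)))))

    F′-F″-meet : MeetTrivially F′ F″
    F′-F″-meet w w∈F′ w∈F″ with F′ₖ⁻ w∈F′ | F″ₖ⁻ w∈F″
    ... | c , w≈ | d , w≈′ = ≋-trans w≈ (≋-trans (++⁺ _≈_ {k} (proj₁ (++⁻ _≈_ (c ·ᵥ U₁) zeroVec (≋-trans (≋-sym w≈) w≈′))) ≋-refl)
                                                 (zeroVec-++ {k}))

    i₀ : Fin k
    i₀ = Fin.fromℕ< 1≤k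

    NonTrivialₖ : Flag n → Set
    NonTrivialₖ X = ∃ λ w → X k w × ¬ w ≈ᵥ zeroVec

    Orb-nonTrivial : ∀ j → NonTrivialₖ (Orb j)
    Orb-nonTrivial j = _ , Orbₖ⁺ j (identity i₀) , λ w≈0 → LinIndep-row≉0 U₁-independent i₀
      (≋-trans (≋-sym (basis-·ᵥ i₀ U₁)) (proj₁ (++⁻ _≈_ _ zeroVec (≋-trans w≈0 (≋-sym (zeroVec-++ {k}))))))

    F′-nonTrivial : NonTrivialₖ F′
    F′-nonTrivial = _ , F′ₖ⁺ (identity i₀) , λ w≈0 → LinIndep-row≉0 U₁-independent i₀
      (≋-trans (≋-sym (basis-·ᵥ i₀ U₁)) (proj₁ (++⁻ _≈_ _ zeroVec (≋-trans w≈0 (≋-sym (zeroVec-++ {k}))))))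

    F″-nonTrivial : NonTrivialₖ F″
    F″-nonTrivial = _ , F″ₖ⁺ (identity i₀) , λ w≈0 → LinIndep-row≉0 U₂-independent i₀
      (≋-trans (≋-sym (basis-·ᵥ i₀ U₂)) (proj₂ (++⁻ _≈_ zeroVec zeroVec (≋-trans w≈0 (≋-sym (zeroVec-++ {k}))))))

    meet⇒distinct : ∀ {X Y} → NonTrivialₖ X → MeetTrivially X Y → ¬ X ≐f Y
    meet⇒distinct (w , w∈X , w≉0) X∩Y≈0 X≐Y = w≉0 (X∩Y≈0 w w∈X (proj₁ (X≐Y k 1≤k k<k+[1+k]) w w∈X))

    ++-∈-+ₛ : ∀ {X Y : Subspace n} {u u′ : Vector k} {y y′ : Vector (suc k)} {w} → X (u ++ y) → Y (u′ ++ y′) →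
              VF.take k w ≈ᵥ u +ᵥ u′ → VF.drop k w ≈ᵥ y +ᵥ y′ → (X +ₛ Y) w
    ++-∈-+ₛ {u = u} {u′} {y} {y′} {w} x∈X y∈Y upper lower = u ++ y , u′ ++ y′ , x∈X , y∈Y ,
      ≋-trans (take-++-drop {k} w) (≋-trans (++⁺ _≈_ {k} upper lower) (≋-sym (++-+ᵥ {k} u u′ y y′)))

    -- the U₁-parts cancel, and Z - Z·M^d ranges over all vectors as d ≢ 0 (mod N)
    Orb-Orb-span-+ : ∀ i d → ¬ d % N ≡ 0 → Spans (Orb i) (Orb (i ℕ.+ d))
    Orb-Orb-span-+ i d d≢0 w =
      ++-∈-+ₛ {Orb i (suc k)} {Orb (i ℕ.+ d) (suc k)} (Orbₖ₊₁⁺ i (c₀ +ᵥ c) t) (Orbₖ₊₁⁺ (i ℕ.+ d) (-ᵥ c) (- t)) upper lower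
      where
      x = VF.take k w
      y = VF.drop k w
      c₀ = proj₁ (U₁-spanning x)
      x≈ = proj₂ (U₁-spanning x)
      P = (c₀ ·ᵥ U₂) ·[ M ]^ i
      Z = proj₁ (I-M^d-surjective d d≢0 ((y -ᵥ P) ·[ M ]^ (i ℕ.* E)))
      Z-ZMᵈ≈ = proj₂ (I-M^d-surjective d d≢0 ((y -ᵥ P) ·[ M ]^ (i ℕ.* E)))
      c = proj₁ (U₂,v₂-spanning Z)
      t = proj₁ (proj₂ (U₂,v₂-spanning Z))
      Z≈ = proj₂ (proj₂ (U₂,v₂-spanning Z))
      upper : x ≈ᵥ (((c₀ +ᵥ c) ·ᵥ U₁) +ᵥ t *ᵥ v₁) +ᵥ (((-ᵥ c) ·ᵥ U₁) +ᵥ (- t) *ᵥ v₁)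
      upper j = trans (x≈ j) (sym (trans (+-cong (lincomb-+ᵥ c₀ c t U₁ v₁ j) (lincomb-negᵥ c t U₁ v₁ j)) ([x+y]-y≈x _ _)))
      lower : y ≈ᵥ (((c₀ +ᵥ c) ·ᵥ U₂) +ᵥ t *ᵥ v₂) ·[ M ]^ i +ᵥ (((-ᵥ c) ·ᵥ U₂) +ᵥ (- t) *ᵥ v₂) ·[ M ]^ (i ℕ.+ d)
      lower = ≋-sym (begin
        (((c₀ +ᵥ c) ·ᵥ U₂) +ᵥ t *ᵥ v₂) ·[ M ]^ i +ᵥ (((-ᵥ c) ·ᵥ U₂) +ᵥ (- t) *ᵥ v₂) ·[ M ]^ (i ℕ.+ d)
          ≈⟨ (λ j → +-cong (·^-cong M i (≋-trans (lincomb-+ᵥ c₀ c t U₂ v₂) (λ j → +-cong refl (sym (Z≈ j)))) j)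
                           (·^-cong M (i ℕ.+ d) (≋-trans (lincomb-negᵥ c t U₂ v₂) (λ j → -‿cong (sym (Z≈ j)))) j)) ⟩
        ((c₀ ·ᵥ U₂) +ᵥ Z) ·[ M ]^ i +ᵥ (-ᵥ Z) ·[ M ]^ (i ℕ.+ d)
          ≈⟨ ·^-shift-difference M (c₀ ·ᵥ U₂) Z i d ⟩
        P +ᵥ (Z -ᵥ Z ·[ M ]^ d) ·[ M ]^ i
          ≈⟨ (λ j → +-cong refl (≋-trans (·^-cong M i Z-ZMᵈ≈) (≋-trans (·^-comm M (y -ᵥ P) (i ℕ.* E) i) (·^-inverse (y -ᵥ P) i)) j)) ⟩
        P +ᵥ (y -ᵥ P)
          ≈⟨ (λ j → x+[y-x]≈y (P j) (y j)) ⟩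
        y ∎)
        where open ≈ᵥ-Reasoning

    Orb-Orb-span : ∀ i j → ¬ i % N ≡ j % N → Spans (Orb i) (Orb j)
    Orb-Orb-span i j i≢j with ℕP.≤-total i j
    ... | inj₁ i≤j = P.subst (λ j → Spans (Orb i) (Orb j)) (ℕP.m+[n∸m]≡n i≤j)
                       (Orb-Orb-span-+ i (j ∸ i) (λ d≡0 → i≢j (P.sym (P.trans (P.cong (_% N) (P.sym (ℕP.m+[n∸m]≡n i≤j))) (shift-% i (j ∸ i) d≡0)))))
    ... | inj₂ j≤i = Spans-sym (Orb j) (Orb i) (P.subst (λ i → Spans (Orb j) (Orb i)) (ℕP.m+[n∸m]≡n j≤i)
                       (Orb-Orb-span-+ j (i ∸ j) (λ d≡0 → i≢j (P.trans (P.cong (_% N) (P.sym (ℕP.m+[n∸m]≡n j≤i))) (shift-% j (i ∸ j) d≡0)))))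

    C-full : ∀ {H} → C H → FullFlag H
    C-full (inj₁ (j , H≐Orbⱼ)) = FullFlag-≐f (Orb-full j) (≐f-sym H≐Orbⱼ)
    C-full (inj₂ (inj₁ H≐F′))  = FullFlag-≐f F′-full (≐f-sym H≐F′)
    C-full (inj₂ (inj₂ H≐F″))  = FullFlag-≐f F″-full (≐f-sym H≐F″)

    Orb-≐f : ∀ i j → i % N ≡ j % N → Orb i ≐f Orb j
    Orb-≐f i j i≡j = ≐f-trans (Orb-% i) (P.subst (λ r → Orb r ≐f Orb j) (P.sym i≡j) (≐f-sym (Orb-% j)))

    member : Fin N ⊎ Fin 2 → Flag n
    member (inj₁ j)                  = Orb (toℕ j)
    member (inj₂ Fin.zero)           = F′
    member (inj₂ (Fin.suc Fin.zero)) = F″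

    member∈C : ∀ s → C (member s)
    member∈C (inj₁ j)                  = inj₁ (toℕ j , ≐f-refl)
    member∈C (inj₂ Fin.zero)           = inj₂ (inj₁ ≐f-refl)
    member∈C (inj₂ (Fin.suc Fin.zero)) = inj₂ (inj₂ ≐f-refl)

    Orb-injective : ∀ {i j} → i < N → j < N → Orb i ≐f Orb j → i ≡ j
    Orb-injective {i} {j} i<N j<N Orbᵢ≐Orbⱼ with i ℕ.≟ j
    ... | yes i≡j = i≡j
    ... | no  i≢j = contradiction Orbᵢ≐Orbⱼ (meet⇒distinct (Orb-nonTrivial i) (Orb-Orb-meet i j
                      (λ e → i≢j (P.trans (P.sym (m<n⇒m%n≡m i<N)) (P.trans e (m<n⇒m%n≡m j<N))))))

    member-injective : ∀ s s′ → member s ≐f member s′ → s ≡ s′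
    member-injective (inj₁ i) (inj₁ j) Orbᵢ≐Orbⱼ =
      P.cong inj₁ (FinP.toℕ-injective (Orb-injective (FinP.toℕ<n i) (FinP.toℕ<n j) Orbᵢ≐Orbⱼ))
    member-injective (inj₁ i) (inj₂ Fin.zero) = flip contradiction (meet⇒distinct (Orb-nonTrivial (toℕ i)) (Orb-F′-meet (toℕ i)))
    member-injective (inj₁ i) (inj₂ (Fin.suc Fin.zero)) = flip contradiction (meet⇒distinct (Orb-nonTrivial (toℕ i)) (Orb-F″-meet (toℕ i)))
    member-injective (inj₂ Fin.zero) (inj₁ j) =
      flip contradiction (meet⇒distinct F′-nonTrivial (MeetTrivially-sym (Orb (toℕ j)) F′ (Orb-F′-meet (toℕ j))))
    member-injective (inj₂ Fin.zero) (inj₂ Fin.zero) _ = P.refl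
    member-injective (inj₂ Fin.zero) (inj₂ (Fin.suc Fin.zero)) = flip contradiction (meet⇒distinct F′-nonTrivial F′-F″-meet)
    member-injective (inj₂ (Fin.suc Fin.zero)) (inj₁ j) =
      flip contradiction (meet⇒distinct F″-nonTrivial (MeetTrivially-sym (Orb (toℕ j)) F″ (Orb-F″-meet (toℕ j))))
    member-injective (inj₂ (Fin.suc Fin.zero)) (inj₂ Fin.zero) =
      flip contradiction (meet⇒distinct F″-nonTrivial (MeetTrivially-sym F′ F″ F′-F″-meet))
    member-injective (inj₂ (Fin.suc Fin.zero)) (inj₂ (Fin.suc Fin.zero)) _ = P.refl

    card : Card C (q ℕ.^ suc k ℕ.+ 1)
    card = P.subst (Card C) N+2≡q^[1+k]+1 (member ∘ splitAt N , member∈C ∘ splitAt N , injective , covers)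
      where
      N+2≡q^[1+k]+1 : N ℕ.+ 2 ≡ q ℕ.^ suc k ℕ.+ 1
      N+2≡q^[1+k]+1 = P.trans (ℕP.+-suc N 1) (P.cong (ℕ._+ 1) (P.sym q^[1+m]≡1+N))
      injective : ∀ i j → member (splitAt N i) ≐f member (splitAt N j) → i ≡ j
      injective i j same = P.trans (P.sym (FinP.join-splitAt N 2 i))
        (P.trans (P.cong (Fin.join N 2) (member-injective (splitAt N i) (splitAt N j) same)) (FinP.join-splitAt N 2 j))
      covers : ∀ H → C H → ∃ λ i → H ≐f member (splitAt N i)
      covers H (inj₁ (j , H≐Orbⱼ)) = Fin.fromℕ< (m%n<n j N) ↑ˡ 2 ,
        P.subst (H ≐f_) (P.sym (P.trans (P.cong member (FinP.splitAt-↑ˡ N (Fin.fromℕ< (m%n<n j N)) 2)) (P.cong Orb (FinP.toℕ-fromℕ< (m%n<n j N)))))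
                (≐f-trans H≐Orbⱼ (Orb-% j))
      covers H (inj₂ (inj₁ H≐F′)) = N ↑ʳ Fin.zero ,
        P.subst (H ≐f_) (P.sym (P.cong member (FinP.splitAt-↑ʳ N 2 Fin.zero))) H≐F′
      covers H (inj₂ (inj₂ H≐F″)) = N ↑ʳ Fin.suc Fin.zero ,
        P.subst (H ≐f_) (P.sym (P.cong member (FinP.splitAt-↑ʳ N 2 (Fin.suc Fin.zero)))) H≐F″

    module Spanning (v₁≈0 : v₁ ≈ᵥ zeroVec) where

      F′-F″-span : Spans F′ F″
      F′-F″-span w = ++-∈-+ₛ {F′ (suc k)} {F″ (suc k)} (F′ₖ₊₁⁺ c₀ 0#) (F″ₖ₊₁⁺ d t)
        (λ j → trans (x≈ j) (x≈[x+0]+0 (*ᵥ-zeroʳ 0# v₁≈0 j) (*ᵥ-zeroʳ t v₁≈0 j)))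
        (λ j → trans (y≈ j) (sym (trans (+-cong (*ᵥ-zeroˡ v₂ j) refl) (+-identityˡ _))))
        where
        c₀ = proj₁ (U₁-spanning (VF.take k w))
        x≈ = proj₂ (U₁-spanning (VF.take k w))
        d = proj₁ (U₂,v₂-spanning (VF.drop k w))
        t = proj₁ (proj₂ (U₂,v₂-spanning (VF.drop k w)))
        y≈ = proj₂ (proj₂ (U₂,v₂-spanning (VF.drop k w)))

      Orb-F′-span : ∀ j → Spans (Orb j) F′
      Orb-F′-span j w = ++-∈-+ₛ {Orb j (suc k)} {F′ (suc k)} (Orbₖ₊₁⁺ j c t) (F′ₖ₊₁⁺ d 0#) upper lower
        where
        x = VF.take k w
        y = VF.drop k w
        z = y ·[ M ]^ (j ℕ.* E)
        c = proj₁ (U₂,v₂-spanning z)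
        t = proj₁ (proj₂ (U₂,v₂-spanning z))
        z≈ = proj₂ (proj₂ (U₂,v₂-spanning z))
        d = proj₁ (U₁-spanning (x -ᵥ (c ·ᵥ U₁)))
        x-cU₁≈ = proj₂ (U₁-spanning (x -ᵥ (c ·ᵥ U₁)))
        upper : x ≈ᵥ ((c ·ᵥ U₁) +ᵥ t *ᵥ v₁) +ᵥ ((d ·ᵥ U₁) +ᵥ 0# *ᵥ v₁)
        upper i = sym (trans (+-cong (trans (+-cong refl (*ᵥ-zeroʳ t v₁≈0 i)) (+-identityʳ _))
                                     (trans (+-cong refl (*ᵥ-zeroʳ 0# v₁≈0 i)) (trans (+-identityʳ _) (sym (x-cU₁≈ i)))))
                             (x+[y-x]≈y _ (x i)))
        lower : y ≈ᵥ ((c ·ᵥ U₂) +ᵥ t *ᵥ v₂) ·[ M ]^ j +ᵥ 0# *ᵥ v₂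
        lower i = sym (trans (+-cong refl (*ᵥ-zeroˡ v₂ i)) (trans (+-identityʳ _)
                        (trans (·^-cong M j (≋-sym z≈) i) (≋-trans (·^-comm M y (j ℕ.* E) j) (·^-inverse y j) i))))

      Orb-F″-span : ∀ j → Spans (Orb j) F″
      Orb-F″-span j w = ++-∈-+ₛ {Orb j (suc k)} {F″ (suc k)} (Orbₖ₊₁⁺ j c₀ 0#) (F″ₖ₊₁⁺ d s) upper lower
        where
        x = VF.take k w
        y = VF.drop k w
        c₀ = proj₁ (U₁-spanning x)
        x≈ = proj₂ (U₁-spanning x)
        P = ((c₀ ·ᵥ U₂) +ᵥ 0# *ᵥ v₂) ·[ M ]^ j
        d = proj₁ (U₂,v₂-spanning (y -ᵥ P))
        s = proj₁ (proj₂ (U₂,v₂-spanning (y -ᵥ P)))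
        y-P≈ = proj₂ (proj₂ (U₂,v₂-spanning (y -ᵥ P)))
        upper : x ≈ᵥ ((c₀ ·ᵥ U₁) +ᵥ 0# *ᵥ v₁) +ᵥ s *ᵥ v₁
        upper i = trans (x≈ i) (x≈[x+0]+0 (*ᵥ-zeroʳ 0# v₁≈0 i) (*ᵥ-zeroʳ s v₁≈0 i))
        lower : y ≈ᵥ P +ᵥ ((d ·ᵥ U₂) +ᵥ s *ᵥ v₂)
        lower i = sym (trans (+-cong refl (sym (y-P≈ i))) (x+[y-x]≈y (P i) (y i)))

      C-pair : ∀ {H H′} → C H → C H′ → ¬ H ≐f H′ → MeetTrivially H H′ × Spans H H′
      C-pair (inj₁ (i , H≐)) (inj₁ (j , H′≐)) H≢H′ with i % N ℕ.≟ j % N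
      ... | yes i≡j = contradiction (≐f-trans H≐ (≐f-trans (Orb-≐f i j i≡j) (≐f-sym H′≐))) H≢H′
      ... | no  i≢j = MeetTrivially-≐f (Orb i) (Orb j) (Orb-Orb-meet i j i≢j) H≐ H′≐
                    , Spans-≐f (Orb i) (Orb j) (Orb-Orb-span i j i≢j) H≐ H′≐
      C-pair (inj₁ (i , H≐)) (inj₂ (inj₁ H′≐)) _ =
        MeetTrivially-≐f (Orb i) F′ (Orb-F′-meet i) H≐ H′≐ , Spans-≐f (Orb i) F′ (Orb-F′-span i) H≐ H′≐
      C-pair (inj₁ (i , H≐)) (inj₂ (inj₂ H′≐)) _ =
        MeetTrivially-≐f (Orb i) F″ (Orb-F″-meet i) H≐ H′≐ , Spans-≐f (Orb i) F″ (Orb-F″-span i) H≐ H′≐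
      C-pair (inj₂ (inj₁ H≐)) (inj₁ (j , H′≐)) _ =
        MeetTrivially-≐f F′ (Orb j) (MeetTrivially-sym (Orb j) F′ (Orb-F′-meet j)) H≐ H′≐
        , Spans-≐f F′ (Orb j) (Spans-sym (Orb j) F′ (Orb-F′-span j)) H≐ H′≐
      C-pair (inj₂ (inj₁ H≐)) (inj₂ (inj₁ H′≐)) H≢H′ = contradiction (≐f-trans H≐ (≐f-sym H′≐)) H≢H′
      C-pair (inj₂ (inj₁ H≐)) (inj₂ (inj₂ H′≐)) _ =
        MeetTrivially-≐f F′ F″ F′-F″-meet H≐ H′≐ , Spans-≐f F′ F″ F′-F″-span H≐ H′≐
      C-pair (inj₂ (inj₂ H≐)) (inj₁ (j , H′≐)) _ =
        MeetTrivially-≐f F″ (Orb j) (MeetTrivially-sym (Orb j) F″ (Orb-F″-meet j)) H≐ H′≐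
        , Spans-≐f F″ (Orb j) (Spans-sym (Orb j) F″ (Orb-F″-span j)) H≐ H′≐
      C-pair (inj₂ (inj₂ H≐)) (inj₂ (inj₁ H′≐)) _ =
        MeetTrivially-≐f F″ F′ (MeetTrivially-sym F′ F″ F′-F″-meet) H≐ H′≐
        , Spans-≐f F″ F′ (Spans-sym F′ F″ F′-F″-span) H≐ H′≐
      C-pair (inj₂ (inj₂ H≐)) (inj₂ (inj₂ H′≐)) H≢H′ = contradiction (≐f-trans H≐ (≐f-sym H′≐)) H≢H′

      C-pair-at-max : ∀ {H H′ d} → C H → C H′ → ¬ H ≐f H′ → FlagDist H H′ d → d ≡ maxDist n
      C-pair-at-max H∈C H′∈C H≢H′ = FlagDist-≡-maxDist-odd (C-full H∈C) (C-full H′∈C) (proj₁ pair) (proj₂ pair)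
        where pair = C-pair H∈C H′∈C H≢H′

      optimum : OptimumDistance C
      optimum = inj₂ ((Orb 0 , F′ , Orb₀∈C , F′∈C , Orb₀≢F′ , at-max)
                     , λ H H′ d H∈C H′∈C H≢H′ H-H′ → ℕP.≤-reflexive (P.sym (C-pair-at-max H∈C H′∈C H≢H′ H-H′)))
        where
        Orb₀∈C : C (Orb 0)
        Orb₀∈C = inj₁ (0 , ≐f-refl)
        F′∈C : C F′
        F′∈C = inj₂ (inj₁ ≐f-refl)
        Orb₀≢F′ : ¬ Orb 0 ≐f F′
        Orb₀≢F′ = meet⇒distinct (Orb-nonTrivial 0) (Orb-F′-meet 0)
        dist = FlagDist-exists (Orb-full 0) F′-full
        at-max : FlagDist (Orb 0) F′ (maxDist n)
        at-max = P.subst (FlagDist (Orb 0) F′) (C-pair-at-max Orb₀∈C F′∈C Orb₀≢F′ (proj₂ dist)) (proj₂ dist)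

    row-leaving : ∀ t → rowsp U₂ (v₂ ·[ M ]^ t) → ∃ λ i → ¬ rowsp U₂ (U₂ i ·[ M ]^ t)
    row-leaving t v₂Mᵗ∈U₂ with FinP.any? (λ i → ¬? (rowsp? U₂ (U₂ i ·[ M ]^ t)))
    ... | yes leaving = leaving
    ... | no  none    = contradiction v₂∈U₂ v₂∉U₂
      where
      rows-stay : ∀ i → rowsp U₂ (U₂ i ·[ M ]^ t)
      rows-stay i = decidable-stable (rowsp? U₂ _) (λ ∉ → none (i , ∉))
      -- v₂ = (v₂·M^(tE))·M^t and v₂·M^(tE) is a combination of U₂ and v₂
      x = v₂ ·[ M ]^ (t ℕ.* E)
      c = proj₁ (U₂,v₂-spanning x)
      λ′ = proj₁ (proj₂ (U₂,v₂-spanning x))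
      x≈ = proj₂ (proj₂ (U₂,v₂-spanning x))
      v₂∈U₂ : rowsp U₂ v₂
      v₂∈U₂ = rowsp-resp U₂ (≋-trans (≋-sym (·^-cong M t x≈)) (≋-trans (·^-comm M v₂ (t ℕ.* E) t) (·^-inverse v₂ t)))
        (rowsp-resp U₂ (λ j → sym (trans (·^-+ᵥ M (c ·ᵥ U₂) (λ′ *ᵥ v₂) t j) (+-cong (·^-lincomb M c U₂ t j) (·^-*ᵥ M λ′ v₂ t j))))
          (rowsp-+ U₂ (rowsp-lincomb U₂ rows-stay c) (rowsp-* U₂ λ′ v₂Mᵗ∈U₂)))

    correction : ∀ t → rowsp U₂ (v₂ ·[ M ]^ t) → ∃ λ r → rowsp U₂ r × rowsp U₂ (r ·[ M ]^ t -ᵥ v₂)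
    correction t v₂Mᵗ∈U₂ = μ *ᵥ U₂ i , rowsp-* U₂ μ (rowsp-row U₂ i) ,
      rowsp-resp U₂ (λ j → sym (begin
        ((μ *ᵥ U₂ i) ·[ M ]^ t) j + - v₂ j         ≈⟨ +-cong (·^-*ᵥ M μ (U₂ i) t j) refl ⟩
        μ * (U₂ i ·[ M ]^ t) j + - v₂ j            ≈⟨ +-cong (*-cong refl (UᵢMᵗ≈ j)) refl ⟩
        μ * ((c ·ᵥ U₂) j + λ′ * v₂ j) + - v₂ j     ≈⟨ +-cong (distribˡ μ _ _) refl ⟩
        (μ * (c ·ᵥ U₂) j + μ * (λ′ * v₂ j)) + - v₂ j ≈⟨ +-cong (+-cong refl μλ′v₂≈v₂) refl ⟩
        (μ * (c ·ᵥ U₂) j + v₂ j) + - v₂ j          ≈⟨ trans (+-assoc _ _ _) (trans (+-cong refl (-‿inverseʳ _)) (+-identityʳ _)) ⟩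
        μ * (c ·ᵥ U₂) j                            ∎))
        (rowsp-* U₂ μ (c , ≋-refl))
      where
      open ≈-Reasoning
      i = proj₁ (row-leaving t v₂Mᵗ∈U₂)
      UᵢMᵗ∉U₂ = proj₂ (row-leaving t v₂Mᵗ∈U₂)
      c = proj₁ (U₂,v₂-spanning (U₂ i ·[ M ]^ t))
      λ′ = proj₁ (proj₂ (U₂,v₂-spanning (U₂ i ·[ M ]^ t)))
      UᵢMᵗ≈ = proj₂ (proj₂ (U₂,v₂-spanning (U₂ i ·[ M ]^ t)))
      λ′≉0 : ¬ λ′ ≈ 0#
      λ′≉0 λ′≈0 = UᵢMᵗ∉U₂ (c , λ j → trans (UᵢMᵗ≈ j) (trans (+-cong refl (trans (*-cong λ′≈0 refl) (zeroˡ _))) (+-identityʳ _)))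
      μ = proj₁ (inverse λ′ λ′≉0)
      μλ′v₂≈v₂ : ∀ {x} → μ * (λ′ * x) ≈ x
      μλ′v₂≈v₂ {x} = trans (sym (*-assoc μ λ′ x)) (trans (*-cong (trans (*-comm μ λ′) (proj₂ (inverse λ′ λ′≉0))) refl) (*-identityˡ x))

    aligning-shift : ∀ w → rowsp U₂ w → ¬ w ≈ᵥ zeroVec →
      ∃ λ j → rowsp U₂ (v₂ -ᵥ w ·[ M ]^ j) × rowsp U₂ (v₂ ·[ M ]^ j -ᵥ w ·[ M ]^ j)
    aligning-shift w w∈U₂ w≉0 = j , rowsp-resp U₂ (λ i → sym (first i)) (rowsp-neg U₂ (rowsp-+ U₂ w∈U₂ rMᵗ-v₂∈U₂))
                                  , rowsp-resp U₂ (λ i → sym (second i)) (rowsp-+ U₂ (rowsp-+ U₂ r∈U₂ (rowsp-neg U₂ w∈U₂)) (rowsp-neg U₂ rMᵗ-v₂∈U₂))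
      where
      t = proj₁ (transitive v₂ w v₂≉0 w≉0)
      v₂Mᵗ≈w = proj₂ (transitive v₂ w v₂≉0 w≉0)
      r = proj₁ (correction t (rowsp-resp U₂ (≋-sym v₂Mᵗ≈w) w∈U₂))
      r∈U₂ = proj₁ (proj₂ (correction t (rowsp-resp U₂ (≋-sym v₂Mᵗ≈w) w∈U₂)))
      rMᵗ-v₂∈U₂ = proj₂ (proj₂ (correction t (rowsp-resp U₂ (≋-sym v₂Mᵗ≈w) w∈U₂)))
      Y = v₂ +ᵥ r
      Y≉0 : ¬ Y ≈ᵥ zeroVec
      Y≉0 Y≈0 = v₂∉U₂ (rowsp-resp U₂ (λ i → sym (inverseˡ-unique _ _ (Y≈0 i))) (rowsp-neg U₂ r∈U₂))
      j = proj₁ (transitive v₂ Y v₂≉0 Y≉0)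
      v₂Mʲ≈Y = proj₂ (transitive v₂ Y v₂≉0 Y≉0)
      wMʲ≈ : w ·[ M ]^ j ≈ᵥ w +ᵥ r ·[ M ]^ t
      wMʲ≈ = ≋-trans (·^-cong M j (≋-sym v₂Mᵗ≈w)) (≋-trans (·^-comm M v₂ t j)
               (≋-trans (·^-cong M t v₂Mʲ≈Y) (≋-trans (·^-+ᵥ M v₂ r t) (λ i → +-cong (v₂Mᵗ≈w i) refl))))
      first : ∀ i → (v₂ -ᵥ w ·[ M ]^ j) i ≈ (-ᵥ (w +ᵥ (r ·[ M ]^ t -ᵥ v₂))) i
      first i = begin
        v₂ i + - (w ·[ M ]^ j) i                  ≈⟨ +-cong refl (-‿cong (wMʲ≈ i)) ⟩
        v₂ i + - (w i + (r ·[ M ]^ t) i)          ≈⟨ +-cong refl (-‿distrib-+ _ _) ⟩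
        v₂ i + (- w i + - (r ·[ M ]^ t) i)        ≈⟨ x∙yz≈y∙xz _ _ _ ⟩
        - w i + (v₂ i + - (r ·[ M ]^ t) i)        ≈⟨ +-cong refl (+-comm _ _) ⟩
        - w i + (- (r ·[ M ]^ t) i + v₂ i)        ≈⟨ +-cong refl (-[a-b]≈-a+b _ _) ⟨
        - w i + - ((r ·[ M ]^ t) i + - v₂ i)      ≈⟨ -‿distrib-+ _ _ ⟨
        - (w i + ((r ·[ M ]^ t) i + - v₂ i))      ∎
        where open ≈-Reasoning
      second : ∀ i → (v₂ ·[ M ]^ j -ᵥ w ·[ M ]^ j) i ≈ ((r +ᵥ (-ᵥ w)) +ᵥ (-ᵥ (r ·[ M ]^ t -ᵥ v₂))) i
      second i = begin
        (v₂ ·[ M ]^ j) i + - (w ·[ M ]^ j) i      ≈⟨ +-cong (v₂Mʲ≈Y i) (trans (-‿cong (wMʲ≈ i)) (-‿distrib-+ _ _)) ⟩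
        (v₂ i + r i) + (- w i + - (r ·[ M ]^ t) i) ≈⟨ +-cong (+-comm _ _) refl ⟩
        (r i + v₂ i) + (- w i + - (r ·[ M ]^ t) i) ≈⟨ interchange _ _ _ _ ⟩
        (r i + - w i) + (v₂ i + - (r ·[ M ]^ t) i) ≈⟨ +-cong refl (+-comm _ _) ⟩
        (r i + - w i) + (- (r ·[ M ]^ t) i + v₂ i) ≈⟨ +-cong refl (-[a-b]≈-a+b _ _) ⟨
        (r i + - w i) + - ((r ·[ M ]^ t) i + - v₂ i) ∎
        where open ≈-Reasoning

    module CommonSpace (c : Vector k) (v₁≈cU₁ : v₁ ≈ᵥ (c ·ᵥ U₁)) (j : ℕ)
                   (v₂-wMʲ∈U₂ : rowsp U₂ (v₂ -ᵥ (c ·ᵥ U₂) ·[ M ]^ j))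
                   (v₂Mʲ-wMʲ∈U₂ : rowsp U₂ (v₂ ·[ M ]^ j -ᵥ (c ·ᵥ U₂) ·[ M ]^ j)) where

      U₂Mʲ : Matrix k (suc k)
      U₂Mʲ i = U₂ i ·[ M ]^ j

      W : Matrix (k ℕ.+ k) n
      W = (U₁ ∣ₘ U₂Mʲ) ++ (zeroMat ∣ₘ U₂)

      W-upper : ∀ c′ → rowsp W ((c′ ·ᵥ U₁) ++ (c′ ·ᵥ U₂) ·[ M ]^ j)
      W-upper c′ = c′ ++ zeroVec , ≋-sym (begin
        ((c′ ++ zeroVec) ·ᵥ W)                          ≈⟨ ++-·ᵥ-++ c′ zeroVec (U₁ ∣ₘ U₂Mʲ) (zeroMat ∣ₘ U₂) ⟩
        (c′ ·ᵥ (U₁ ∣ₘ U₂Mʲ)) +ᵥ (zeroVec ·ᵥ (zeroMat ∣ₘ U₂)) ≈⟨ (λ i → trans (+-cong refl (·ᵥ-zeroˡ (zeroMat ∣ₘ U₂) ≋-refl i)) (+-identityʳ _)) ⟩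
        (c′ ·ᵥ (U₁ ∣ₘ U₂Mʲ))                           ≈⟨ ·ᵥ-∣ₘ c′ U₁ U₂Mʲ ⟩
        ((c′ ·ᵥ U₁) ++ (c′ ·ᵥ U₂Mʲ))                    ≈⟨ ++⁺ _≈_ {k} ≋-refl (≋-sym (·^-lincomb M c′ U₂ j)) ⟩
        ((c′ ·ᵥ U₁) ++ (c′ ·ᵥ U₂) ·[ M ]^ j)            ∎)
        where open ≈ᵥ-Reasoning

      W-lower : ∀ d → rowsp W (zeroVec ++ (d ·ᵥ U₂))
      W-lower d = zeroVec ++ d , ≋-sym (begin
        ((zeroVec ++ d) ·ᵥ W)                           ≈⟨ ++-·ᵥ-++ zeroVec d (U₁ ∣ₘ U₂Mʲ) (zeroMat ∣ₘ U₂) ⟩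
        (zeroVec ·ᵥ (U₁ ∣ₘ U₂Mʲ)) +ᵥ (d ·ᵥ (zeroMat ∣ₘ U₂)) ≈⟨ (λ i → trans (+-cong (·ᵥ-zeroˡ (U₁ ∣ₘ U₂Mʲ) ≋-refl i) refl) (+-identityˡ _)) ⟩
        (d ·ᵥ (zeroMat ∣ₘ U₂))                          ≈⟨ ·ᵥ-∣ₘ d zeroMat U₂ ⟩
        ((d ·ᵥ zeroMat) ++ (d ·ᵥ U₂))                   ≈⟨ ++⁺ _≈_ {k} (·ᵥ-zeroMat d) ≋-refl ⟩
        (zeroVec ++ (d ·ᵥ U₂))                          ∎)
        where open ≈ᵥ-Reasoning

      W-v₁ : ∀ {y} → rowsp U₂ (y -ᵥ (c ·ᵥ U₂) ·[ M ]^ j) → rowsp W (v₁ ++ y)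
      W-v₁ {y} (d , y-wMʲ≈) = rowsp-resp W
        (≋-trans (++-+ᵥ {k} _ _ _ _) (++⁺ _≈_ {k} (λ i → trans (+-identityʳ _) (sym (v₁≈cU₁ i)))
                                                   (λ i → trans (+-cong refl (sym (y-wMʲ≈ i))) (x+[y-x]≈y _ (y i)))))
        (rowsp-+ W (W-upper c) (W-lower d))

      Orb-F″-in-W : (Orb j (suc k) +ₛ F″ (suc k)) ⊆ rowsp W
      Orb-F″-in-W w (x , y , x∈Orb , y∈F″ , w≈x+y) = rowsp-resp W (≋-sym w≈x+y) (rowsp-+ W (Orb∈W (Orbₖ₊₁⁻ j x∈Orb)) (F″∈W (F″ₖ₊₁⁻ y∈F″)))
        where
        split : ∀ (A : Vector k) (B : Vector (suc k)) u v s → ((A ++ B) +ᵥ s *ᵥ (u ++ v)) ≈ᵥ ((A +ᵥ s *ᵥ u) ++ (B +ᵥ s *ᵥ v))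
        split A B u v s i = trans (+-cong refl (*ᵥ-++ {k} s u v i)) (++-+ᵥ {k} A (s *ᵥ u) B (s *ᵥ v) i)
        Orb∈W : (∃ λ c₁ → ∃ λ t₁ → x ≈ᵥ (((c₁ ·ᵥ U₁) +ᵥ t₁ *ᵥ v₁) ++ ((c₁ ·ᵥ U₂) +ᵥ t₁ *ᵥ v₂) ·[ M ]^ j)) → rowsp W x
        Orb∈W (c₁ , t₁ , x≈) = rowsp-resp W (≋-trans (split _ _ _ _ t₁) (≋-trans (++⁺ _≈_ {k} ≋-refl
            (λ i → sym (trans (·^-+ᵥ M _ _ j i) (+-cong refl (·^-*ᵥ M t₁ v₂ j i))))) (≋-sym x≈)))
          (rowsp-+ W (W-upper c₁) (rowsp-* W t₁ (W-v₁ v₂Mʲ-wMʲ∈U₂)))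
        F″∈W : (∃ λ d₁ → ∃ λ s₁ → y ≈ᵥ (s₁ *ᵥ v₁ ++ (d₁ ·ᵥ U₂) +ᵥ s₁ *ᵥ v₂)) → rowsp W y
        F″∈W (d₁ , s₁ , y≈) = rowsp-resp W (≋-trans (split _ _ _ _ s₁) (≋-trans (++⁺ _≈_ {k} (λ i → +-identityˡ _) ≋-refl) (≋-sym y≈)))
          (rowsp-+ W (W-lower d₁) (rowsp-* W s₁ (W-v₁ v₂-wMʲ∈U₂)))

    v₁≉0⇒¬optimum : ¬ v₁ ≈ᵥ zeroVec → ¬ OptimumDistance C
    v₁≉0⇒¬optimum v₁≉0 (inj₁ (_ , maxDist≡0)) = ℕP.<⇒≢ (maxDist-positive (ℕP.≤-trans (s≤s 1≤k) (ℕP.m≤n+m (suc k) k))) (P.sym maxDist≡0)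
    v₁≉0⇒¬optimum v₁≉0 (inj₂ (_ , maxDist≤)) =
      ℕP.<⇒≱ (FlagDist-<-maxDist-odd 1≤k (Orb-full j) F″-full W Orb-F″-in-W (proj₂ dist))
             (maxDist≤ (Orb j) F″ (proj₁ dist) (inj₁ (j , ≐f-refl)) (inj₂ (inj₂ ≐f-refl))
                       (meet⇒distinct (Orb-nonTrivial j) (Orb-F″-meet j)) (proj₂ dist))
      where
      c = proj₁ (U₁-spanning v₁)
      v₁≈cU₁ = proj₂ (U₁-spanning v₁)
      cU₂≉0 : ¬ (c ·ᵥ U₂) ≈ᵥ zeroVec
      cU₂≉0 cU₂≈0 = v₁≉0 (≋-trans v₁≈cU₁ (·ᵥ-zeroˡ U₁ (U₂-independent c cU₂≈0)))
      shift = aligning-shift (c ·ᵥ U₂) (c , ≋-refl) cU₂≉0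
      j = proj₁ shift
      open CommonSpace c v₁≈cU₁ j (proj₁ (proj₂ shift)) (proj₂ (proj₂ shift))
      dist = FlagDist-exists (Orb-full j) F″-full

    optimum⇒v₁≈0 : OptimumDistance C → v₁ ≈ᵥ zeroVec
    optimum⇒v₁≈0 opt = decidable-stable (v₁ ≟ᵥ zeroVec) (λ v₁≉0 → v₁≉0⇒¬optimum v₁≉0 opt)

theorem5p11 : (𝔽 : FiniteField) → let open FF 𝔽 in
    (k : ℕ) → 1 < k →
    (a : Vector (suc k)) → Primitive a →
    (U₁ : Matrix k k) (U₂ : Matrix k (suc k)) →
    Rank U₁ k → Rank U₂ k →
    (v₁ : Vector k) (v₂ : Vector (suc k)) → ¬ rowsp U₂ v₂ →
    (F F′ F″ : Flag (k ℕ.+ suc k)) →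
    FullFlag F → FullFlag F′ → FullFlag F″ →
    F k ≐ rowsp (U₁ ∣ₘ U₂) →
    F (suc k) ≐ rowsp (addRow (U₁ ∣ₘ U₂) (v₁ ++ v₂)) →
    F′ k ≐ rowsp (U₁ ∣ₘ zeroMat) →
    F′ (suc k) ≐ rowsp (addRow (U₁ ∣ₘ zeroMat) (v₁ ++ v₂)) →
    F″ k ≐ rowsp (zeroMat ∣ₘ U₂) →
    F″ (suc k) ≐ rowsp (addRow (zeroMat ∣ₘ U₂) (v₁ ++ v₂)) →
    let g = blockDiag identity (companion a)
        C = orbitCode g F F′ F″
    in (OptimumDistance C × Card C ((q ℕ.^ suc k) ℕ.+ 1)) ⇔ (v₁ ≈ᵥ zeroVec)
theorem5p11 𝔽 k 1<k a a-primitive U₁ U₂ rank-U₁ rank-U₂ v₁ v₂ v₂∉U₂ F F′ F″ F-full F′-full F″-full Fₖ Fₖ₊₁ F′ₖ F′ₖ₊₁ F″ₖ F″ₖ₊₁ =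
  mk⇔ (λ (optimal , _) → optimum⇒v₁≈0 optimal) (λ v₁≈0 → Spanning.optimum v₁≈0 , card)
  where
  open Setting 𝔽 k 1<k a a-primitive U₁ U₂ rank-U₁ rank-U₂ v₁ v₂ v₂∉U₂ F F′ F″ F-full F′-full F″-full Fₖ Fₖ₊₁ F′ₖ F′ₖ₊₁ F″ₖ F″ₖ₊₁
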